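{- Let $A_n(x,y,s)=\sum_{\pi\in\mathfrak{S}_n}x^{{\rm basc}(\pi)}y^{{\rm des}(\pi)}s^{{\rm suc}(\pi)}$ for $n\geqslant1$ and $A=A(x,y,s;z)=\sum_{n\geqslant0}A_{n+1}(x,y,s)\frac{z^n}{n!}$. Then for $n\geqslant 1$ $$A_{n+1}(x,y,s)=(s+y)A_{n}(x,y,s)+xy\left(\frac{\partial}{\partial x}+\frac{\partial}{\partial y}+\frac{\partial}{\partial s}\right)A_{n}(x,y,s),$$ equivalently $\frac{\partial}{\partial z}A=(s+y)A+xy\left(\frac{\partial}{\partial x}+\frac{\partial}{\partial y}+\frac{\partial}{\partial s}\right)A$. Moreover, for every $n\geqslant0$, $$A_{n+1}(x,y,s)=\sum_{i=0}^n(s+y)^i\sum_{j=0}^{\lfloor (n-i)/2\rfloor}\gamma_{n,i,j}(2xy)^j(x+y)^{n-i-2j},$$ where the coefficients satisfy $$\gamma_{n+1,i,j}=\gamma_{n,i-1,j}+(1+i)\gamma_{n,i+1,j-1}+j\gamma_{n,i,j}+(n-i-2j+2)\gamma_{n,i,j-1}$$ with $\gamma_{0,0,0}=1$, $\gamma_{0,i,j}=0$ for $(i,j)\ne(0,0)$ (and $\gamma_{n,i,j}=0$ when an index is negative). Finally, $\gamma_{n,i,j}$ equals the number of 0-1-2 increasing planted trees on $\{0,1,\ldots,n\}$ with $i+j$ leaves, exactly $i$ of which are children of the root.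
   Context: For $\pi\in\mathfrak{S}_n$: ${\rm des}(\pi)=\#\{i\in[n-1]:\pi(i)>\pi(i+1)\}$, ${\rm suc}(\pi)=\#\{i\in[n-1]:\pi(i+1)=\pi(i)+1\}$, ${\rm basc}(\pi)=\#\{i\in[n-1]:\pi(i+1)\geqslant\pi(i)+2\}$. A 0-1-2 increasing planted tree on $\{0,1,\ldots,n\}$ is a rooted tree (children unordered) with vertex set $\{0,1,\ldots,n\}$ and root $0$ such that labels increase along every path from the root, every non-root vertex has at most two children, and every child of the root has at most one child (so the subtrees hanging from the root are increasing trees with at most two children per vertex whose label sets partition $[n]$). A leaf is a non-root vertex with no children. -}

module Defs where

open import Data.Nat as ℕ using (ℕ; zero; suc; _∸_; _<_; _≤_; _<?_; _≤?_; ⌊_/2⌋)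
open import Data.Nat.Properties as ℕP using ()
open import Data.Integer as ℤ using (ℤ; +_; _+_; _*_; _-_)
open import Data.List using (List; []; _∷_; [_]; map; concatMap; filter; length; upTo; foldr; _++_)
open import Data.List.Relation.Unary.Unique.DecPropositional ℕP._≟_ using (Unique; unique?)
open import Data.List.Relation.Unary.All using (All)
open import Data.List.Relation.Unary.All.Properties using ()
import Data.List.Relation.Unary.All as All
open import Data.Product using (_×_; _,_)
open import Relation.Binary.PropositionalEquality using (_≡_)
open import Relation.Nullary using (Dec; yes; no)
open import Relation.Nullary.Decidable using (_×-dec_; _→-dec_)

-- Permutations of [n] = {1,…,n}, in one-line notation π(1) π(2) … π(n).

words : ℕ → List ℕ → List (List ℕ)
words zero    as = [ [] ]
words (suc k) as = concatMap (λ w → map (λ a → a ∷ w) as) (words k as)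

range1 : ℕ → List ℕ
range1 n = map suc (upTo n)

perms : ℕ → List (List ℕ)
perms n = filter unique? (words n (range1 n))

adjPairs : List ℕ → List (ℕ × ℕ)
adjPairs (a ∷ b ∷ r) = (a , b) ∷ adjPairs (b ∷ r)
adjPairs _           = []

des : List ℕ → ℕ
des π = length (filter (λ { (a , b) → b <? a }) (adjPairs π))

sucs : List ℕ → ℕ
sucs π = length (filter (λ { (a , b) → b ℕP.≟ suc a }) (adjPairs π))

basc : List ℕ → ℕ
basc π = length (filter (λ { (a , b) → suc (suc a) ≤? b }) (adjPairs π))

-- Formal power series / polynomials in x, y, s with integer
-- coefficients, represented by their coefficient function:
-- p a b c = coefficient of x^a y^b s^c.

Ser : Set
Ser = ℕ → ℕ → ℕ → ℤ

_≈_ : Ser → Ser → Set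
p ≈ q = ∀ a b c → p a b c ≡ q a b c

infix 4 _≈_
infixl 6 _⊕_
infixl 7 _⊗_

sumℤ : ℕ → (ℕ → ℤ) → ℤ
sumℤ zero    f = f zero
sumℤ (suc n) f = sumℤ n f + f (suc n)

zeroS : Ser
zeroS _ _ _ = + 0

const : ℤ → Ser
const k zero zero zero = k
const k _    _    _    = + 0

oneS : Ser
oneS = const (+ 1)

mono : ℕ → ℕ → ℕ → Ser
mono a b c a' b' c' with a ℕP.≟ a' | b ℕP.≟ b' | c ℕP.≟ c'
... | yes _ | yes _ | yes _ = + 1
... | _     | _     | _     = + 0

X Y S : Ser
X = mono 1 0 0
Y = mono 0 1 0
S = mono 0 0 1

_⊕_ : Ser → Ser → Ser
(p ⊕ q) a b c = p a b c + q a b c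

_⊗_ : Ser → Ser → Ser
(p ⊗ q) a b c =
  sumℤ a (λ a₁ → sumℤ b (λ b₁ → sumℤ c (λ c₁ →
    p a₁ b₁ c₁ * q (a ∸ a₁) (b ∸ b₁) (c ∸ c₁))))

_^S_ : Ser → ℕ → Ser
p ^S zero  = oneS
p ^S suc k = p ⊗ (p ^S k)

sumS : ℕ → (ℕ → Ser) → Ser
sumS zero    f = f zero
sumS (suc n) f = sumS n f ⊕ f (suc n)

sumList : List Ser → Ser
sumList = foldr _⊕_ zeroS

∂x ∂y ∂s : Ser → Ser
∂x p a b c = + (suc a) * p (suc a) b c
∂y p a b c = + (suc b) * p a (suc b) c
∂s p a b c = + (suc c) * p a b (suc c)

Apoly : ℕ → Ser
Apoly n = sumList (map (λ π → mono (basc π) (des π) (sucs π)) (perms n))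

-- The coefficients γ_{n,i,j}  (γ_{n,i,j} = 0 when an index is negative)

γ : ℕ → ℕ → ℕ → ℤ
γ zero zero    zero    = + 1
γ zero zero    (suc j) = + 0
γ zero (suc i) j       = + 0
γ (suc n) i j = t₁ i + t₂ j + (+ j) * γ n i j + t₄ j
  where
  t₁ : ℕ → ℤ
  t₁ zero     = + 0
  t₁ (suc i') = γ n i' j
  t₂ : ℕ → ℤ
  t₂ zero     = + 0
  t₂ (suc j') = (+ (suc i)) * γ n (suc i) j'
  -- (n-i-2j+2) γ_{n,i,j-1}   (coefficient computed in ℤ)
  t₄ : ℕ → ℤ
  t₄ zero     = + 0
  t₄ (suc j') = (+ n - + i - + 2 * + (suc j') + + 2) * γ n i j'

-- A rooted tree on {0,…,n} with root 0 is encoded by its parent map: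
-- a list p of length n whose k-th entry (k = 0,…,n-1) is the parent
-- of vertex k+1, an element of {0,…,n}.

parentMaps : ℕ → List (List ℕ)
parentMaps n = words n (upTo (suc n))

labelled : ℕ → List ℕ → List (ℕ × ℕ)
labelled v []       = []
labelled v (q ∷ ps) = (v , q) ∷ labelled (suc v) ps

vertices : List ℕ → List (ℕ × ℕ)
vertices = labelled 1

children : List ℕ → ℕ → ℕ
children p u = length (filter (λ q → q ℕP.≟ u) p)

-- labels increase along every path from the root: parent(v) < v
-- (this also makes the parent map acyclic, i.e. a tree rooted at 0)
Increasing : List ℕ → Set
Increasing p = All (λ { (v , q) → q < v }) (vertices p)

Is012 : List ℕ → Set
Is012 p = All (λ { (v , q) → (children p v ≤ 2) × (q ≡ 0 → children p v ≤ 1) })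
              (vertices p)

planted? : (p : List ℕ) → Dec (Increasing p × Is012 p)
planted? p =
  All.all? (λ { (v , q) → q <? v }) (vertices p)
  ×-dec
  All.all? (λ { (v , q) → (children p v ≤? 2) ×-dec ((q ℕP.≟ 0) →-dec (children p v ≤? 1)) })
           (vertices p)

plantedTrees : ℕ → List (List ℕ)
plantedTrees n = filter planted? (parentMaps n)

leaves : List ℕ → ℕ
leaves p = length (filter (λ { (v , q) → children p v ℕP.≟ 0 }) (vertices p))

rootLeaves : List ℕ → ℕ
rootLeaves p =
  length (filter (λ { (v , q) → (children p v ℕP.≟ 0) ×-dec (q ℕP.≟ 0) }) (vertices p))

treeCount : ℕ → ℕ → ℕ → ℕ
treeCount n i j =
  length (filter (λ p → (leaves p ℕP.≟ (i ℕ.+ j)) ×-dec (rootLeaves p ℕP.≟ i))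
                 (plantedTrees n))

-- Inserting the new maximum n+1 into a permutation of [n] changes (basc, des, suc) in a way that
-- depends only on the kind of gap it goes into, and summing over the gaps gives the operator
-- 𝓛 P = (s + y) P + x y (∂x + ∂y + ∂s) P, i.e. A_{n+1} = 𝓛 A_n. With U = s + y, V = 2 x y, W = x + y,
-- ∂U = ∂W = 2 and ∂V = 2W, so 𝓛 sends U^i V^j W^k to a combination of four such products, and the
-- expansion Σ γ_{n,i,j} U^i V^j W^(n-i-2j) is carried to the one for n+1 exactly by the recurrence of γ.
-- Building an increasing 0-1-2 planted tree by hanging its largest vertex below an earlier one changes
-- (leaves, root leaves, non-root vertices with one child) according to the same recurrence, so γ
-- counts these trees.
module Submission where

open import Data.Bool using (Bool; true; false; _∧_; not; if_then_else_)
open import Data.Bool.Properties using (∧-assoc; ∧-identityʳ; ∧-zeroʳ)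
open import Data.Integer using (ℤ; +_; 0ℤ; 1ℤ)
import Data.Integer.Properties as ℤP
open import Data.Sum using (inj₁; inj₂)
open import Data.List using (List; []; _∷_; [_]; _++_; map; concatMap; filter; length; upTo)
open import Data.List.Membership.Propositional using (_∈_)
open import Data.List.Relation.Unary.Any using (here; there)
open import Data.List.Relation.Unary.All as All using (All; []; _∷_)
open import Data.Nat as ℕ using (ℕ; zero; suc; z≤n; s≤s; _≡ᵇ_; _<ᵇ_; _∸_; _≤_; _<_; ⌊_/2⌋; _≟_; _<?_; _≤?_)
import Data.Nat.Properties as ℕP
open import Data.Product using (_×_; _,_; proj₁; proj₂)
open import Function using (_∘_)
open import Relation.Nullary using (Dec; yes; no; does; ¬_)
open import Relation.Nullary.Decidable using (dec-true; dec-false)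
open import Relation.Unary using (Decidable)
open import Relation.Binary.PropositionalEquality
  using (_≡_; _≢_; refl; sym; trans; cong; cong₂; subst; module ≡-Reasoning)

open import Defs

module Sums where

  open import Data.Integer using (_+_; _*_)
  open import Algebra.Properties.CommutativeSemigroup ℤP.+-commutativeSemigroup
    using (interchange)

  Σl : {A : Set} → List A → (A → ℤ) → ℤ
  Σl []       f = 0ℤ
  Σl (x ∷ xs) f = f x + Σl xs f

  when : Bool → ℤ → ℤ
  when true  x = x
  when false x = 0ℤ

  bit : {P : Set} → Dec P → ℕ
  bit d = if does d then 1 else 0

  bit-yes : {P : Set} (d : Dec P) → P → bit d ≡ 1
  bit-yes d p rewrite dec-true d p = refl

  bit-no : {P : Set} (d : Dec P) → ¬ P → bit d ≡ 0
  bit-no d ¬p rewrite dec-false d ¬p = refl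

  does⇒ : {P : Set} (d : Dec P) → does d ≡ true → P
  does⇒ (yes p) _ = p

  bit≡1⇒ : {P : Set} (d : Dec P) → bit d ≡ 1 → P
  bit≡1⇒ (yes p) _ = p

  when-zero : ∀ b → when b 0ℤ ≡ 0ℤ
  when-zero true  = refl
  when-zero false = refl

  when-+ : ∀ b x y → when b (x + y) ≡ when b x + when b y
  when-+ true  x y = refl
  when-+ false x y = refl

  *-when : ∀ k b x → k * when b x ≡ when b (k * x)
  *-when k true  x = refl
  *-when k false x = ℤP.*-zeroʳ k

  when-* : ∀ b x y → when b x * y ≡ when b (x * y)
  when-* true  x y = refl
  when-* false x y = refl

  when-∧ : ∀ b c x → when (b ∧ c) x ≡ when b (when c x)
  when-∧ true  c x = refl
  when-∧ false c x = refl

  when-comm : ∀ b c x → when b (when c x) ≡ when c (when b x)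
  when-comm true  c     x = refl
  when-comm false true  x = refl
  when-comm false false x = refl

  when-not : ∀ b x → when (not b) x + when b x ≡ x
  when-not true  x = ℤP.+-identityˡ x
  when-not false x = ℤP.+-identityʳ x

  when-cong : ∀ b {x y} → (b ≡ true → x ≡ y) → when b x ≡ when b y
  when-cong true  h = h refl
  when-cong false h = refl

  module _ {A : Set} where

    Σl-cong : (xs : List A) {f g : A → ℤ} → (∀ x → f x ≡ g x) → Σl xs f ≡ Σl xs g
    Σl-cong []       e = refl
    Σl-cong (x ∷ xs) e = cong₂ _+_ (e x) (Σl-cong xs e)

    Σl-cong-∈ : (xs : List A) {f g : A → ℤ} → (∀ x → x ∈ xs → f x ≡ g x) → Σl xs f ≡ Σl xs g
    Σl-cong-∈ []       e = refl
    Σl-cong-∈ (x ∷ xs) e = cong₂ _+_ (e x (here refl)) (Σl-cong-∈ xs (λ y p → e y (there p)))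

    Σl-++ : (xs ys : List A) (f : A → ℤ) → Σl (xs ++ ys) f ≡ Σl xs f + Σl ys f
    Σl-++ []       ys f = sym (ℤP.+-identityˡ _)
    Σl-++ (x ∷ xs) ys f = trans (cong (_+_ (f x)) (Σl-++ xs ys f)) (sym (ℤP.+-assoc (f x) _ _))

    Σl-+ : (xs : List A) (f g : A → ℤ) → Σl xs (λ x → f x + g x) ≡ Σl xs f + Σl xs g
    Σl-+ []       f g = refl
    Σl-+ (x ∷ xs) f g = trans (cong (_+_ (f x + g x)) (Σl-+ xs f g)) (interchange (f x) (g x) _ _)

    Σl-*ˡ : (xs : List A) (c : ℤ) (f : A → ℤ) → Σl xs (λ x → c * f x) ≡ c * Σl xs f
    Σl-*ˡ []       c f = sym (ℤP.*-zeroʳ c)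
    Σl-*ˡ (x ∷ xs) c f = trans (cong (_+_ (c * f x)) (Σl-*ˡ xs c f)) (sym (ℤP.*-distribˡ-+ c (f x) _))

    Σl-zero : (xs : List A) → Σl xs (λ _ → 0ℤ) ≡ 0ℤ
    Σl-zero []       = refl
    Σl-zero (x ∷ xs) = trans (ℤP.+-identityˡ _) (Σl-zero xs)

    Σl-when : (xs : List A) (b : Bool) (f : A → ℤ) → Σl xs (λ x → when b (f x)) ≡ when b (Σl xs f)
    Σl-when xs true  f = refl
    Σl-when xs false f = Σl-zero xs

    Σl-filter : {P : A → Set} (P? : Decidable P) (xs : List A) (f : A → ℤ) →
                Σl (filter P? xs) f ≡ Σl xs (λ x → when (does (P? x)) (f x))
    Σl-filter P? []       f = refl
    Σl-filter P? (x ∷ xs) f with does (P? x)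
    ... | true  = cong (_+_ (f x)) (Σl-filter P? xs f)
    ... | false = trans (Σl-filter P? xs f) (sym (ℤP.+-identityˡ _))

    length-filter≡Σl : {P : A → Set} (P? : Decidable P) (xs : List A) →
                       + length (filter P? xs) ≡ Σl xs (λ x → when (does (P? x)) 1ℤ)
    length-filter≡Σl P? []       = refl
    length-filter≡Σl P? (x ∷ xs) with does (P? x)
    ... | true  = cong (_+_ 1ℤ) (length-filter≡Σl P? xs)
    ... | false = trans (length-filter≡Σl P? xs) (sym (ℤP.+-identityˡ _))

  module _ {A B : Set} where

    Σl-map : (g : A → B) (xs : List A) (f : B → ℤ) → Σl (map g xs) f ≡ Σl xs (f ∘ g)
    Σl-map g []       f = refl
    Σl-map g (x ∷ xs) f = cong (_+_ (f (g x))) (Σl-map g xs f)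

    Σl-concatMap : (g : A → List B) (xs : List A) (f : B → ℤ) →
                   Σl (concatMap g xs) f ≡ Σl xs (λ x → Σl (g x) f)
    Σl-concatMap g []       f = refl
    Σl-concatMap g (x ∷ xs) f =
      trans (Σl-++ (g x) (concatMap g xs) f) (cong (_+_ (Σl (g x) f)) (Σl-concatMap g xs f))

    Σl-swap : (xs : List A) (ys : List B) (f : A → B → ℤ) →
              Σl xs (λ x → Σl ys (f x)) ≡ Σl ys (λ y → Σl xs (λ x → f x y))
    Σl-swap []       ys f = sym (Σl-zero ys)
    Σl-swap (x ∷ xs) ys f =
      trans (cong (_+_ (Σl ys (f x))) (Σl-swap xs ys f)) (sym (Σl-+ ys (f x) (λ y → Σl xs (λ x' → f x' y))))

module Permutations where

  open Sums
  open import Data.Integer using (_+_)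
  open import Data.List.Properties using (map-++; upTo-∷ʳ)
  open import Data.List.Membership.Propositional.Properties using (∈-map⁻; ∈-upTo⁻)
  open import Data.List.Relation.Unary.AllPairs using ([]; _∷_)
  open import Data.List.Relation.Unary.Unique.DecPropositional ℕP._≟_ using (Unique; unique?)
  open import Relation.Nullary using (¬?)

  fresh : ℕ → List ℕ → Bool
  fresh b w = does (All.all? (λ c → ¬? (b ≟ c)) w)

  distinct : List ℕ → Bool
  distinct w = does (unique? w)

  insertions : ℕ → List ℕ → List (List ℕ)
  insertions b []      = [ b ∷ [] ]
  insertions b (c ∷ u) = (b ∷ c ∷ u) ∷ map (c ∷_) (insertions b u)

  Σl-words-suc : ∀ k (as : List ℕ) (f : List ℕ → ℤ) →
    Σl (words (suc k) as) f ≡ Σl (words k as) (λ w → Σl as (λ a → f (a ∷ w)))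
  Σl-words-suc k as f =
    trans (Σl-concatMap _ (words k as) f) (Σl-cong (words k as) (λ w → Σl-map _ as f))

  Σl-words-head : ∀ k (as : List ℕ) (f : List ℕ → ℤ) →
    Σl (words (suc k) as) f ≡ Σl as (λ a → Σl (words k as) (λ w → f (a ∷ w)))
  Σl-words-head k as f = trans (Σl-words-suc k as f) (Σl-swap (words k as) as _)

  Σl-words-snoc : ∀ k (as : List ℕ) (f : List ℕ → ℤ) →
    Σl (words (suc k) as) f ≡ Σl (words k as) (λ w → Σl as (λ a → f (w ++ [ a ])))
  Σl-words-snoc zero    as f = Σl-words-suc zero as f
  Σl-words-snoc (suc k) as f =
    trans (Σl-words-head (suc k) as f)
    (trans (Σl-cong as (λ b → Σl-words-snoc k as (λ w → f (b ∷ w))))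
           (sym (Σl-words-head k as (λ v → Σl as (λ a → f (v ++ [ a ]))))))

  Σl-words-cong : ∀ k (as : List ℕ) {f g : List ℕ → ℤ} →
    (∀ w → length w ≡ k → All (_∈ as) w → f w ≡ g w) → Σl (words k as) f ≡ Σl (words k as) g
  Σl-words-cong zero    as e = cong (_+ 0ℤ) (e [] refl [])
  Σl-words-cong (suc k) as {f} {g} e =
    trans (Σl-words-head k as f)
    (trans (Σl-cong-∈ as (λ a a∈ → Σl-words-cong k as (λ w len p → e (a ∷ w) (cong suc len) (a∈ ∷ p))))
           (sym (Σl-words-head k as g)))

  Fresh : ℕ → List ℕ → Set
  Fresh b A = ∀ c → c ∈ A → b ≢ c

  Σl-snoc : (A : List ℕ) (b : ℕ) (f : ℕ → ℤ) → Σl (A ++ [ b ]) f ≡ Σl A f + (f b + 0ℤ)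
  Σl-snoc A b f = Σl-++ A [ b ] f

  Σl-words-avoiding : ∀ m (A : List ℕ) b → Fresh b A → (G : List ℕ → ℤ) →
    Σl (words m (A ++ [ b ])) (λ w → when (fresh b w) (G w)) ≡ Σl (words m A) G
  Σl-words-avoiding zero    A b fr G = refl
  Σl-words-avoiding (suc m) A b fr G = begin
    Σl (words (suc m) (A ++ [ b ])) (λ w → when (fresh b w) (G w))
      ≡⟨ Σl-words-head m (A ++ [ b ]) _ ⟩
    Σl (A ++ [ b ]) (λ c → Σl (words m (A ++ [ b ])) (λ w → when (fresh b (c ∷ w)) (G (c ∷ w))))
      ≡⟨ Σl-snoc A b _ ⟩
    Σl A (λ c → Σl (words m (A ++ [ b ])) (λ w → when (fresh b (c ∷ w)) (G (c ∷ w))))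
      + (Σl (words m (A ++ [ b ])) (λ w → when (fresh b (b ∷ w)) (G (b ∷ w))) + 0ℤ)
      ≡⟨ cong₂ (λ x y → x + (y + 0ℤ)) (Σl-cong-∈ A other) own ⟩
    Σl A (λ c → Σl (words m A) (λ w → G (c ∷ w))) + (0ℤ + 0ℤ)
      ≡⟨ ℤP.+-identityʳ _ ⟩
    Σl A (λ c → Σl (words m A) (λ w → G (c ∷ w)))
      ≡⟨ Σl-words-head m A G ⟨
    Σl (words (suc m) A) G ∎
    where
    open ≡-Reasoning
    other : ∀ c → c ∈ A →
      Σl (words m (A ++ [ b ])) (λ w → when (fresh b (c ∷ w)) (G (c ∷ w))) ≡ Σl (words m A) (λ w → G (c ∷ w))
    other c c∈ rewrite dec-false (b ≟ c) (fr c c∈) = Σl-words-avoiding m A b fr (λ w → G (c ∷ w))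
    own : Σl (words m (A ++ [ b ])) (λ w → when (fresh b (b ∷ w)) (G (b ∷ w))) ≡ 0ℤ
    own rewrite dec-true (b ≟ b) refl = Σl-zero (words m (A ++ [ b ]))

  Σl-insertions-fresh : ∀ b c u → c ≢ b → (G : List ℕ → ℤ) →
    Σl (insertions b u) (λ v → when (fresh c v) (G v)) ≡ when (fresh c u) (Σl (insertions b u) G)
  Σl-insertions-fresh b c []      c≢b G rewrite dec-false (c ≟ b) c≢b = when-+ true (G (b ∷ [])) 0ℤ
  Σl-insertions-fresh b c (d ∷ u) c≢b G rewrite dec-false (c ≟ b) c≢b = begin
    when (fresh c (d ∷ u)) (G (b ∷ d ∷ u))
      + Σl (map (d ∷_) (insertions b u)) (λ v → when (fresh c v) (G v))
      ≡⟨ cong (_+_ (when (fresh c (d ∷ u)) (G (b ∷ d ∷ u)))) tail ⟩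
    when (fresh c (d ∷ u)) (G (b ∷ d ∷ u)) + when (fresh c (d ∷ u)) (Σl (map (d ∷_) (insertions b u)) G)
      ≡⟨ when-+ (fresh c (d ∷ u)) _ _ ⟨
    when (fresh c (d ∷ u)) (Σl (insertions b (d ∷ u)) G) ∎
    where
    open ≡-Reasoning
    d≢ = not (c ≡ᵇ d)
    tail : Σl (map (d ∷_) (insertions b u)) (λ v → when (fresh c v) (G v))
         ≡ when (fresh c (d ∷ u)) (Σl (map (d ∷_) (insertions b u)) G)
    tail = begin
      Σl (map (d ∷_) (insertions b u)) (λ v → when (fresh c v) (G v))
        ≡⟨ Σl-map (d ∷_) (insertions b u) _ ⟩
      Σl (insertions b u) (λ v → when (d≢ ∧ fresh c v) (G (d ∷ v)))
        ≡⟨ Σl-cong (insertions b u) (λ v → when-∧ d≢ (fresh c v) (G (d ∷ v))) ⟩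
      Σl (insertions b u) (λ v → when d≢ (when (fresh c v) (G (d ∷ v))))
        ≡⟨ Σl-when (insertions b u) d≢ _ ⟩
      when d≢ (Σl (insertions b u) (λ v → when (fresh c v) (G (d ∷ v))))
        ≡⟨ cong (when d≢) (Σl-insertions-fresh b c u c≢b (G ∘ (d ∷_))) ⟩
      when d≢ (when (fresh c u) (Σl (insertions b u) (G ∘ (d ∷_))))
        ≡⟨ when-∧ d≢ (fresh c u) _ ⟨
      when (fresh c (d ∷ u)) (Σl (insertions b u) (G ∘ (d ∷_)))
        ≡⟨ cong (when (fresh c (d ∷ u))) (Σl-map (d ∷_) (insertions b u) G) ⟨
      when (fresh c (d ∷ u)) (Σl (map (d ∷_) (insertions b u)) G) ∎

  Σl-words-containing : ∀ m (A : List ℕ) b → Fresh b A → (F : List ℕ → ℤ) →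
    Σl (words (suc m) (A ++ [ b ])) (λ w → when (not (fresh b w)) (when (distinct w) (F w)))
    ≡ Σl (words m A) (λ u → when (distinct u) (Σl (insertions b u) F))
  Σl-words-containing zero A b fr F =
    trans (Σl-words-head 0 (A ++ [ b ]) _)
    (trans (Σl-snoc A b _)
    (trans (cong₂ _+_ (trans (Σl-cong-∈ A absent) (Σl-zero A)) present)
           (ℤP.+-identityˡ _)))
    where
    absent : ∀ c → c ∈ A → when (not (fresh b (c ∷ []))) (F (c ∷ [])) + 0ℤ ≡ 0ℤ
    absent c c∈ rewrite dec-false (b ≟ c) (fr c c∈) = refl
    present : when (not (fresh b (b ∷ []))) (F (b ∷ [])) + 0ℤ + 0ℤ ≡ F (b ∷ []) + 0ℤ + 0ℤ
    present rewrite dec-true (b ≟ b) refl = refl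
  Σl-words-containing (suc m) A b fr F = begin
    Σl (words (suc (suc m)) (A ++ [ b ])) (λ w → when (not (fresh b w)) (when (distinct w) (F w)))
      ≡⟨ Σl-words-head (suc m) (A ++ [ b ]) _ ⟩
    Σl (A ++ [ b ]) (λ c → Σl W (λ w → when (not (fresh b (c ∷ w))) (when (distinct (c ∷ w)) (F (c ∷ w)))))
      ≡⟨ Σl-snoc A b _ ⟩
    Σl A (λ c → Σl W (λ w → when (not (fresh b (c ∷ w))) (when (distinct (c ∷ w)) (F (c ∷ w)))))
      + (Σl W (λ w → when (not (fresh b (b ∷ w))) (when (distinct (b ∷ w)) (F (b ∷ w)))) + 0ℤ)
      ≡⟨ cong₂ (λ x y → x + (y + 0ℤ)) (Σl-cong-∈ A startingElsewhere) startingWithB ⟩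
    Σl A R + (B + 0ℤ)
      ≡⟨ cong (_+_ (Σl A R)) (ℤP.+-identityʳ B) ⟩
    Σl A R + B
      ≡⟨ ℤP.+-comm (Σl A R) B ⟩
    B + Σl A R
      ≡⟨ byFirstLetter ⟨
    Σl (words (suc m) A) (λ u → when (distinct u) (Σl (insertions b u) F)) ∎
    where
    open ≡-Reasoning
    W = words (suc m) (A ++ [ b ])
    B : ℤ
    B = Σl (words (suc m) A) (λ w → when (distinct w) (F (b ∷ w)))
    R : ℕ → ℤ
    R c = Σl (words m A) (λ u → when (distinct (c ∷ u)) (Σl (map (c ∷_) (insertions b u)) F))
    startingWithB :
      Σl W (λ w → when (not (fresh b (b ∷ w))) (when (distinct (b ∷ w)) (F (b ∷ w)))) ≡ B
    startingWithB rewrite dec-true (b ≟ b) refl =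
      trans (Σl-cong W (λ w → when-∧ (fresh b w) (distinct w) (F (b ∷ w))))
            (Σl-words-avoiding (suc m) A b fr (λ w → when (distinct w) (F (b ∷ w))))
    startingElsewhere : ∀ c → c ∈ A →
      Σl W (λ w → when (not (fresh b (c ∷ w))) (when (distinct (c ∷ w)) (F (c ∷ w)))) ≡ R c
    startingElsewhere c c∈ rewrite dec-false (b ≟ c) (fr c c∈) = begin
      Σl W (λ w → when (not (fresh b w)) (when (fresh c w ∧ distinct w) (F (c ∷ w))))
        ≡⟨ Σl-cong W (λ w → cong (when (not (fresh b w)))
             (trans (when-∧ (fresh c w) (distinct w) _) (when-comm (fresh c w) (distinct w) _))) ⟩
      Σl W (λ w → when (not (fresh b w)) (when (distinct w) (when (fresh c w) (F (c ∷ w)))))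
        ≡⟨ Σl-words-containing m A b fr (λ w → when (fresh c w) (F (c ∷ w))) ⟩
      Σl (words m A) (λ u → when (distinct u) (Σl (insertions b u) (λ v → when (fresh c v) (F (c ∷ v)))))
        ≡⟨ Σl-cong (words m A) (λ u → cong (when (distinct u))
             (Σl-insertions-fresh b c u (λ c≡b → fr c c∈ (sym c≡b)) (F ∘ (c ∷_)))) ⟩
      Σl (words m A) (λ u → when (distinct u) (when (fresh c u) (Σl (insertions b u) (F ∘ (c ∷_)))))
        ≡⟨ Σl-cong (words m A) (λ u →
             trans (when-comm (distinct u) (fresh c u) _)
             (trans (sym (when-∧ (fresh c u) (distinct u) _))
                    (cong (when (distinct (c ∷ u))) (sym (Σl-map (c ∷_) (insertions b u) F))))) ⟩
      R c ∎
    byFirstLetter : Σl (words (suc m) A) (λ u → when (distinct u) (Σl (insertions b u) F)) ≡ B + Σl A R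
    byFirstLetter =
      trans (Σl-words-head m A _)
      (trans (Σl-cong A (λ c → trans (Σl-cong (words m A) (λ u → when-+ (distinct (c ∷ u)) _ _))
                                     (Σl-+ (words m A) _ _)))
      (trans (Σl-+ A _ R)
             (cong (_+ Σl A R) (sym (Σl-words-head m A (λ w → when (distinct w) (F (b ∷ w))))))))

  range1-suc : ∀ n → range1 (suc n) ≡ range1 n ++ [ suc n ]
  range1-suc n = trans (cong (map suc) (sym (upTo-∷ʳ n))) (map-++ suc (upTo n) [ n ])

  range1-fresh : ∀ n → Fresh (suc n) (range1 n)
  range1-fresh n c c∈ eq with ∈-map⁻ suc c∈
  ... | i , i∈ , refl = ℕP.<-irrefl (sym (cong ℕ.pred eq)) (∈-upTo⁻ i∈)

  Σl-split-fresh : ∀ (L : List (List ℕ)) b (h : List ℕ → ℤ) →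
    Σl L h ≡ Σl L (λ w → when (not (fresh b w)) (h w)) + Σl L (λ w → when (fresh b w) (h w))
  Σl-split-fresh L b h = trans (Σl-cong L (λ w → sym (when-not (fresh b w) (h w)))) (Σl-+ L _ _)

  Σl-distinct-words-too-long : ∀ n m → n ≤ m → (F : List ℕ → ℤ) →
    Σl (words (suc m) (range1 n)) (λ w → when (distinct w) (F w)) ≡ 0ℤ
  Σl-distinct-words-too-long zero    m       n≤m F = trans (Σl-words-suc m [] _) (Σl-zero (words m []))
  Σl-distinct-words-too-long (suc n) (suc m) (s≤s n≤m) F =
    trans (cong (λ A → Σl (words (suc (suc m)) A) (λ w → when (distinct w) (F w))) (range1-suc n))
    (trans (Σl-split-fresh (words (suc (suc m)) (range1 n ++ [ suc n ])) (suc n) _)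
      (cong₂ _+_
        (trans (Σl-words-containing (suc m) (range1 n) (suc n) (range1-fresh n) F)
               (Σl-distinct-words-too-long n m n≤m _))
        (trans (Σl-words-avoiding (suc (suc m)) (range1 n) (suc n) (range1-fresh n) _)
               (Σl-distinct-words-too-long n (suc m) (ℕP.m≤n⇒m≤1+n n≤m) F))))

  Σl-perms-suc : ∀ n (f : List ℕ → ℤ) →
    Σl (perms (suc n)) f ≡ Σl (perms n) (λ π → Σl (insertions (suc n) π) f)
  Σl-perms-suc n f = begin
    Σl (perms (suc n)) f
      ≡⟨ Σl-filter unique? (words (suc n) (range1 (suc n))) f ⟩
    Σl (words (suc n) (range1 (suc n))) (λ w → when (distinct w) (f w))
      ≡⟨ cong (λ A → Σl (words (suc n) A) (λ w → when (distinct w) (f w))) (range1-suc n) ⟩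
    Σl (words (suc n) (range1 n ++ [ suc n ])) (λ w → when (distinct w) (f w))
      ≡⟨ Σl-split-fresh (words (suc n) (range1 n ++ [ suc n ])) (suc n) _ ⟩
    Σl (words (suc n) (range1 n ++ [ suc n ])) (λ w → when (not (fresh (suc n) w)) (when (distinct w) (f w)))
      + Σl (words (suc n) (range1 n ++ [ suc n ])) (λ w → when (fresh (suc n) w) (when (distinct w) (f w)))
      ≡⟨ cong₂ _+_ (Σl-words-containing n (range1 n) (suc n) (range1-fresh n) f)
                   (trans (Σl-words-avoiding (suc n) (range1 n) (suc n) (range1-fresh n) _)
                          (Σl-distinct-words-too-long n n ℕP.≤-refl f)) ⟩
    Σl (words n (range1 n)) (λ u → when (distinct u) (Σl (insertions (suc n) u) f)) + 0ℤ
      ≡⟨ ℤP.+-identityʳ _ ⟩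
    Σl (words n (range1 n)) (λ u → when (distinct u) (Σl (insertions (suc n) u) f))
      ≡⟨ Σl-filter unique? (words n (range1 n)) _ ⟨
    Σl (perms n) (λ π → Σl (insertions (suc n) π) f) ∎
    where open ≡-Reasoning

  Σl-perms-cong : ∀ n {f g : List ℕ → ℤ} →
    (∀ π → Unique π → All (_∈ range1 n) π → f π ≡ g π) → Σl (perms n) f ≡ Σl (perms n) g
  Σl-perms-cong n {f} {g} h =
    trans (Σl-filter unique? (words n (range1 n)) f)
    (trans (Σl-words-cong n (range1 n) (λ w _ ∈range → when-cong (distinct w) (λ d → h w (does⇒ (unique? w) d) ∈range)))
           (sym (Σl-filter unique? (words n (range1 n)) g)))

  insertions-All : ∀ {P : ℕ → Set} {b} u {v} → P b → All P u → v ∈ insertions b u → All P v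
  insertions-All []      pb []         (here refl) = pb ∷ []
  insertions-All (c ∷ u) pb all       (here refl) = pb ∷ all
  insertions-All (c ∷ u) pb (pc ∷ pu) (there v∈) with ∈-map⁻ (c ∷_) v∈
  ... | v' , v'∈ , refl = pc ∷ insertions-All u pb pu v'∈

  insertions-Unique : ∀ {b} u {v} → All (b ≢_) u → Unique u → v ∈ insertions b u → Unique v
  insertions-Unique []      _           _             (here refl) = [] ∷ []
  insertions-Unique (c ∷ u) b∉          uu            (here refl) = b∉ ∷ uu
  insertions-Unique (c ∷ u) (b≢c ∷ b∉) (c∉ ∷ uu) (there v∈) with ∈-map⁻ (c ∷_) v∈
  ... | v' , v'∈ , refl =
    insertions-All u (λ c≡b → b≢c (sym c≡b)) c∉ v'∈ ∷ insertions-Unique u b∉ uu v'∈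

module Statistics where

  open Sums
  open Permutations using (insertions)
  open import Data.Integer using (_+_; _*_)
  open import Data.Integer.Solver using (module +-*-Solver)
  open import Data.Empty using (⊥-elim)
  open import Data.List.Membership.Propositional.Properties using (∈-map⁻)
  open import Data.List.Relation.Unary.AllPairs using ([]; _∷_)
  open import Data.List.Relation.Unary.Unique.DecPropositional ℕP._≟_ using (Unique)
  open import Data.Sum using (inj₁; inj₂)
  open import Relation.Binary.Definitions using (tri<; tri≈; tri>)

  bascAt desAt sucAt : ℕ → ℕ → ℕ
  bascAt u v = bit (suc (suc u) ≤? v)
  desAt  u v = bit (v <? u)
  sucAt  u v = bit (v ≟ suc u)

  basc′ des′ sucs′ : List ℕ → ℕ
  basc′ (a ∷ b ∷ r) = bascAt a b ℕ.+ basc′ (b ∷ r)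
  basc′ _           = 0
  des′ (a ∷ b ∷ r)  = desAt a b ℕ.+ des′ (b ∷ r)
  des′ _            = 0
  sucs′ (a ∷ b ∷ r) = sucAt a b ℕ.+ sucs′ (b ∷ r)
  sucs′ _           = 0

  length-filter-∷ : {A : Set} {P : A → Set} (P? : Decidable P) (x : A) (xs : List A) →
    length (filter P? (x ∷ xs)) ≡ bit (P? x) ℕ.+ length (filter P? xs)
  length-filter-∷ P? x xs with does (P? x)
  ... | true  = refl
  ... | false = refl

  basc≡basc′ : ∀ π → basc π ≡ basc′ π
  basc≡basc′ []          = refl
  basc≡basc′ (a ∷ [])    = refl
  basc≡basc′ (a ∷ b ∷ r) =
    trans (length-filter-∷ _ (a , b) (adjPairs (b ∷ r))) (cong (bascAt a b ℕ.+_) (basc≡basc′ (b ∷ r)))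

  des≡des′ : ∀ π → des π ≡ des′ π
  des≡des′ []          = refl
  des≡des′ (a ∷ [])    = refl
  des≡des′ (a ∷ b ∷ r) =
    trans (length-filter-∷ _ (a , b) (adjPairs (b ∷ r))) (cong (desAt a b ℕ.+_) (des≡des′ (b ∷ r)))

  sucs≡sucs′ : ∀ π → sucs π ≡ sucs′ π
  sucs≡sucs′ []          = refl
  sucs≡sucs′ (a ∷ [])    = refl
  sucs≡sucs′ (a ∷ b ∷ r) =
    trans (length-filter-∷ _ (a , b) (adjPairs (b ∷ r))) (cong (sucAt a b ℕ.+_) (sucs≡sucs′ (b ∷ r)))

  count : ℕ → List ℕ → ℕ
  count n []      = 0
  count n (c ∷ w) = bit (n ≟ c) ℕ.+ count n w

  count-absent : ∀ {b} u → All (b ≢_) u → count b u ≡ 0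
  count-absent []      []         = refl
  count-absent (c ∷ u) (b≢c ∷ b∉) = cong₂ ℕ._+_ (bit-no (_ ≟ c) b≢c) (count-absent u b∉)

  count-insertions : ∀ {b} u {v} → All (b ≢_) u → v ∈ insertions b u → count b v ≡ 1
  count-insertions {b} []      []  (here refl) = cong₂ ℕ._+_ (bit-yes (b ≟ b) refl) refl
  count-insertions {b} (c ∷ u) b∉ (here refl) = cong₂ ℕ._+_ (bit-yes (b ≟ b) refl) (count-absent (c ∷ u) b∉)
  count-insertions (c ∷ u) (b≢c ∷ b∉) (there v∈) with ∈-map⁻ (c ∷_) v∈
  ... | v' , v'∈ , refl = cong₂ ℕ._+_ (bit-no (_ ≟ c) b≢c) (count-insertions u b∉ v'∈)

  Weight : Set
  Weight = ℕ → ℕ → ℕ → ℤ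

  atStats : Weight → List ℕ → ℤ
  atStats G w = G (basc′ w) (des′ w) (sucs′ w)

  -- Inserting a new maximum into a gap after a descent, or at the end, creates a big ascent,
  -- except in the gap after the old maximum, where it creates a succession; hence the
  -- correction term h · G (suc B) D S, h being the number of occurrences of the old maximum.
  insertionTransform : Weight → ℕ → ℕ → ℕ → ℕ → ℤ
  insertionTransform G h B D S =
    (+ h) * G B D (suc S) + (+ B) * G B (suc D) S + (+ suc D) * G (suc B) D S
    + (+ S) * G (suc B) (suc D) (S ∸ 1)

  data FirstPair (m p₁ p₂ p₃ r₁ r₂ r₃ : ℕ) : Set where
    atMax      : m ≡ 1 → p₁ ≡ 0 → p₂ ≡ 1 → p₃ ≡ 0 →
                 r₁ ≡ 0 → r₂ ≡ 0 → r₃ ≡ 1 → FirstPair m p₁ p₂ p₃ r₁ r₂ r₃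
    descent    : m ≡ 0 → p₁ ≡ 0 → p₂ ≡ 1 → p₃ ≡ 0 →
                 r₁ ≡ 1 → r₂ ≡ 0 → r₃ ≡ 0 → FirstPair m p₁ p₂ p₃ r₁ r₂ r₃
    succession : m ≡ 0 → p₁ ≡ 0 → p₂ ≡ 0 → p₃ ≡ 1 →
                 r₁ ≡ 1 → r₂ ≡ 0 → r₃ ≡ 0 → FirstPair m p₁ p₂ p₃ r₁ r₂ r₃
    bigAscent  : m ≡ 0 → p₁ ≡ 1 → p₂ ≡ 0 → p₃ ≡ 0 →
                 r₁ ≡ 1 → r₂ ≡ 0 → r₃ ≡ 0 → FirstPair m p₁ p₂ p₃ r₁ r₂ r₃

  data LastLetter (m r₁ r₂ r₃ : ℕ) : Set where
    atMax    : m ≡ 1 → r₁ ≡ 0 → r₂ ≡ 0 → r₃ ≡ 1 → LastLetter m r₁ r₂ r₃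
    belowMax : m ≡ 0 → r₁ ≡ 1 → r₂ ≡ 0 → r₃ ≡ 0 → LastLetter m r₁ r₂ r₃

  open +-*-Solver

  insertion-step : ∀ (G : Weight) (Σ′ : ℤ) B D S h m p₁ p₂ p₃ r₁ r₂ r₃ →
    FirstPair m p₁ p₂ p₃ r₁ r₂ r₃ →
    Σ′ + (+ h) * G (p₁ ℕ.+ suc B) (p₂ ℕ.+ D) (p₃ ℕ.+ S)
      ≡ insertionTransform (λ a b c → G (p₁ ℕ.+ a) (p₂ ℕ.+ b) (p₃ ℕ.+ c)) h B D S →
    (G (r₁ ℕ.+ B) (r₂ ℕ.+ suc D) (r₃ ℕ.+ S) + Σ′) + (+ (m ℕ.+ h)) * G (suc (p₁ ℕ.+ B)) (p₂ ℕ.+ D) (p₃ ℕ.+ S)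
      ≡ insertionTransform G (m ℕ.+ h) (p₁ ℕ.+ B) (p₂ ℕ.+ D) (p₃ ℕ.+ S)
  insertion-step G Σ′ B D S h .1 .0 .1 .0 .0 .0 .1 (atMax refl refl refl refl refl refl refl) IH =
    trans (solve 4 (λ q h x y → (y :+ q) :+ (con 1ℤ :+ h) :* x := y :+ (q :+ h :* x) :+ x) refl Σ′ (+ h) G₁ G₂)
    (trans (cong (λ t → G₂ + t + G₁) IH)
    (solve 9 (λ q h x y z w b d s → y :+ (h :* y :+ b :* z :+ (con 1ℤ :+ d) :* x :+ s :* w) :+ x
                                   := (con 1ℤ :+ h) :* y :+ b :* z :+ (con 1ℤ :+ (con 1ℤ :+ d)) :* x :+ s :* w)
           refl Σ′ (+ h) G₁ G₂ G₃ G₄ (+ B) (+ D) (+ S)))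
    where
    G₁ = G (suc B) (suc D) S
    G₂ = G B (suc D) (suc S)
    G₃ = G B (suc (suc D)) S
    G₄ = G (suc B) (suc (suc D)) (S ∸ 1)
  insertion-step G Σ′ B D S h .0 .0 .1 .0 .1 .0 .0 (descent refl refl refl refl refl refl refl) IH =
    trans (solve 3 (λ q h x → (x :+ q) :+ h :* x := (q :+ h :* x) :+ x) refl Σ′ (+ h) G₁)
    (trans (cong (_+ G₁) IH)
    (solve 8 (λ h x y z w b d s → (h :* y :+ b :* z :+ (con 1ℤ :+ d) :* x :+ s :* w) :+ x
                                   := h :* y :+ b :* z :+ (con 1ℤ :+ (con 1ℤ :+ d)) :* x :+ s :* w)
           refl (+ h) G₁ G₂ G₃ G₄ (+ B) (+ D) (+ S)))
    where
    G₁ = G (suc B) (suc D) S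
    G₂ = G B (suc D) (suc S)
    G₃ = G B (suc (suc D)) S
    G₄ = G (suc B) (suc (suc D)) (S ∸ 1)
  insertion-step G Σ′ B D S h .0 .0 .0 .1 .1 .0 .0 (succession refl refl refl refl refl refl refl) IH =
    trans (solve 4 (λ q h x w → (w :+ q) :+ h :* x := w :+ (q :+ h :* x)) refl Σ′ (+ h) G₁ G₄)
    (trans (cong (_+_ G₄) IH)
    (trans (cong (λ t → G₄ + ((+ h) * G₂ + (+ B) * G₃ + (+ suc D) * G₁ + t)) (pred-suc S))
    (solve 8 (λ h x y z w b d s → w :+ (h :* y :+ b :* z :+ (con 1ℤ :+ d) :* x :+ s :* w)
                                   := h :* y :+ b :* z :+ (con 1ℤ :+ d) :* x :+ (con 1ℤ :+ s) :* w)
           refl (+ h) G₁ G₂ G₃ G₄ (+ B) (+ D) (+ S))))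
    where
    G₁ = G (suc B) D (suc S)
    G₂ = G B D (suc (suc S))
    G₃ = G B (suc D) (suc S)
    G₄ = G (suc B) (suc D) S
    pred-suc : ∀ s → (+ s) * G (suc B) (suc D) (suc (s ∸ 1)) ≡ (+ s) * G (suc B) (suc D) s
    pred-suc zero    = refl
    pred-suc (suc s) = refl
  insertion-step G Σ′ B D S h .0 .1 .0 .0 .1 .0 .0 (bigAscent refl refl refl refl refl refl refl) IH =
    trans (solve 4 (λ q h x z → (z :+ q) :+ h :* x := z :+ (q :+ h :* x)) refl Σ′ (+ h) G₁ G₃)
    (trans (cong (_+_ G₃) IH)
    (solve 8 (λ h x y z w b d s → z :+ (h :* y :+ b :* z :+ (con 1ℤ :+ d) :* x :+ s :* w)
                                   := h :* y :+ (con 1ℤ :+ b) :* z :+ (con 1ℤ :+ d) :* x :+ s :* w)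
           refl (+ h) G₁ G₂ G₃ G₄ (+ B) (+ D) (+ S)))
    where
    G₁ = G (suc (suc B)) D S
    G₂ = G (suc B) D (suc S)
    G₃ = G (suc B) (suc D) S
    G₄ = G (suc (suc B)) (suc D) (S ∸ 1)

  insertion-base : ∀ (G : Weight) m r₁ r₂ r₃ → LastLetter m r₁ r₂ r₃ →
    (G (r₁ ℕ.+ 0) (r₂ ℕ.+ 0) (r₃ ℕ.+ 0) + 0ℤ) + (+ (m ℕ.+ 0)) * G 1 0 0 ≡ insertionTransform G (m ℕ.+ 0) 0 0 0
  insertion-base G .1 .0 .0 .1 (atMax refl refl refl refl) =
    solve 4 (λ x y z w → (y :+ con 0ℤ) :+ con 1ℤ :* x := con 1ℤ :* y :+ con 0ℤ :* z :+ con 1ℤ :* x :+ con 0ℤ :* w)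
      refl (G 1 0 0) (G 0 0 1) (G 0 1 0) (G 1 1 0)
  insertion-base G .0 .1 .0 .0 (belowMax refl refl refl refl) =
    solve 4 (λ x y z w → (x :+ con 0ℤ) :+ con 0ℤ :* x := con 0ℤ :* y :+ con 0ℤ :* z :+ con 1ℤ :* x :+ con 0ℤ :* w)
      refl (G 1 0 0) (G 0 0 1) (G 0 1 0) (G 1 1 0)

  pairBits-descent : ∀ y z → z < y → (bascAt y z ≡ 0) × (desAt y z ≡ 1) × (sucAt y z ≡ 0)
  pairBits-descent y z z<y =
      bit-no (suc (suc y) ≤? z) (λ y+2≤z → ℕP.<-asym z<y (ℕP.<-trans (ℕP.n<1+n y) y+2≤z))
    , bit-yes (z <? y) z<y
    , bit-no (z ≟ suc y) (λ z≡y+1 → ℕP.<-asym z<y (subst (y <_) (sym z≡y+1) (ℕP.n<1+n y)))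

  pairBits-succession : ∀ y z → z ≡ suc y → (bascAt y z ≡ 0) × (desAt y z ≡ 0) × (sucAt y z ≡ 1)
  pairBits-succession y .(suc y) refl =
      bit-no (suc (suc y) ≤? suc y) ℕP.1+n≰n
    , bit-no (suc y <? y) (λ y+1<y → ℕP.1+n≰n (ℕP.<⇒≤ y+1<y))
    , bit-yes (suc y ≟ suc y) refl

  pairBits-bigAscent : ∀ y z → suc (suc y) ≤ z → (bascAt y z ≡ 1) × (desAt y z ≡ 0) × (sucAt y z ≡ 0)
  pairBits-bigAscent y z y+2≤z =
      bit-yes (suc (suc y) ≤? z) y+2≤z
    , bit-no (z <? y) (λ z<y → ℕP.<-asym z<y (ℕP.<-trans (ℕP.n<1+n y) y+2≤z))
    , bit-no (z ≟ suc y) (λ z≡y+1 → ℕP.1+n≰n (ℕP.≤-trans y+2≤z (ℕP.≤-reflexive z≡y+1)))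

  classifyLast : ∀ n y → y ≤ n →
    LastLetter (bit (n ≟ y)) (bascAt y (suc n)) (desAt y (suc n)) (sucAt y (suc n))
  classifyLast n y y≤n with ℕP.m≤n⇒m<n∨m≡n y≤n
  ... | inj₂ refl = let (b , d , s) = pairBits-succession n (suc n) refl in atMax (bit-yes (n ≟ n) refl) b d s
  ... | inj₁ y<n  = let (b , d , s) = pairBits-bigAscent y (suc n) (s≤s y<n)
                    in belowMax (bit-no (n ≟ y) (λ n≡y → ℕP.<-irrefl (sym n≡y) y<n)) b d s

  classifyFirst : ∀ n y z → y ≤ n → z ≤ n → y ≢ z →
    FirstPair (bit (n ≟ y)) (bascAt y z) (desAt y z) (sucAt y z)
              (bascAt y (suc n)) (desAt y (suc n)) (sucAt y (suc n))
  classifyFirst n y z y≤n z≤n′ y≢z with classifyLast n y y≤n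
  ... | atMax m r₁ r₂ r₃ with ℕP.<-cmp z y
  ...   | tri< z<y _ _ = let (p₁ , p₂ , p₃) = pairBits-descent y z z<y in atMax m p₁ p₂ p₃ r₁ r₂ r₃
  ...   | tri≈ _ z≡y _ = ⊥-elim (y≢z (sym z≡y))
  ...   | tri> _ _ y<z = ⊥-elim (ℕP.<-irrefl refl (ℕP.<-≤-trans y<z (subst (z ≤_) (bit≡1⇒ (n ≟ y) m) z≤n′)))
  classifyFirst n y z y≤n z≤n′ y≢z | belowMax m r₁ r₂ r₃ with ℕP.<-cmp z y
  ...   | tri< z<y _ _ = let (p₁ , p₂ , p₃) = pairBits-descent y z z<y in descent m p₁ p₂ p₃ r₁ r₂ r₃
  ...   | tri≈ _ z≡y _ = ⊥-elim (y≢z (sym z≡y))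
  ...   | tri> _ _ y<z with ℕP.m≤n⇒m<n∨m≡n y<z
  ...     | inj₂ y+1≡z = let (p₁ , p₂ , p₃) = pairBits-succession y z (sym y+1≡z) in succession m p₁ p₂ p₃ r₁ r₂ r₃
  ...     | inj₁ y+1<z = let (p₁ , p₂ , p₃) = pairBits-bigAscent y z y+1<z in bigAscent m p₁ p₂ p₃ r₁ r₂ r₃

  Σl-insertions-tail : ∀ n y ρ (G : Weight) → Unique (y ∷ ρ) → All (_≤ n) (y ∷ ρ) →
    Σl (insertions (suc n) ρ) (λ v → atStats G (y ∷ v))
      + (+ count n (y ∷ ρ)) * G (suc (basc′ (y ∷ ρ))) (des′ (y ∷ ρ)) (sucs′ (y ∷ ρ))
    ≡ insertionTransform G (count n (y ∷ ρ)) (basc′ (y ∷ ρ)) (des′ (y ∷ ρ)) (sucs′ (y ∷ ρ))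
  Σl-insertions-tail n y [] G _ (y≤n ∷ []) =
    insertion-base G (bit (n ≟ y)) (bascAt y (suc n)) (desAt y (suc n)) (sucAt y (suc n)) (classifyLast n y y≤n)
  Σl-insertions-tail n y (z ∷ ρ) G ((y≢z ∷ _) ∷ unique) (y≤n ∷ z≤n′ ∷ bounded) =
    trans (cong (_+ (+ count n (y ∷ z ∷ ρ) * G (suc (basc′ (y ∷ z ∷ ρ))) (des′ (y ∷ z ∷ ρ)) (sucs′ (y ∷ z ∷ ρ))))
                (cong₂ _+_ insertedFirst (Σl-map (z ∷_) (insertions (suc n) ρ) _)))
      (insertion-step G (Σl (insertions (suc n) ρ) (λ v → atStats G′ (z ∷ v)))
         (basc′ (z ∷ ρ)) (des′ (z ∷ ρ)) (sucs′ (z ∷ ρ)) (count n (z ∷ ρ)) (bit (n ≟ y))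
         (bascAt y z) (desAt y z) (sucAt y z) (bascAt y (suc n)) (desAt y (suc n)) (sucAt y (suc n))
         (classifyFirst n y z y≤n z≤n′ y≢z)
         (Σl-insertions-tail n z ρ G′ unique (z≤n′ ∷ bounded)))
    where
    G′ : Weight
    G′ a b c = G (bascAt y z ℕ.+ a) (desAt y z ℕ.+ b) (sucAt y z ℕ.+ c)
    insertedFirst : atStats G (y ∷ suc n ∷ z ∷ ρ)
      ≡ G (bascAt y (suc n) ℕ.+ basc′ (z ∷ ρ)) (desAt y (suc n) ℕ.+ suc (des′ (z ∷ ρ))) (sucAt y (suc n) ℕ.+ sucs′ (z ∷ ρ))
    insertedFirst with pairBits-descent (suc n) z (s≤s z≤n′)
    ... | b≡0 , d≡1 , s≡0 rewrite b≡0 | d≡1 | s≡0 = refl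

module IndexSums where

  open Sums using (when)
  open import Data.Integer using (_+_; _*_)
  open import Algebra.Properties.CommutativeSemigroup ℤP.+-commutativeSemigroup
    using (interchange)

  sumℤ-cong : ∀ n {f g : ℕ → ℤ} → (∀ k → f k ≡ g k) → sumℤ n f ≡ sumℤ n g
  sumℤ-cong zero    e = e zero
  sumℤ-cong (suc n) e = cong₂ _+_ (sumℤ-cong n e) (e (suc n))

  sumℤ-cong≤ : ∀ n {f g : ℕ → ℤ} → (∀ k → k ≤ n → f k ≡ g k) → sumℤ n f ≡ sumℤ n g
  sumℤ-cong≤ zero    e = e zero z≤n
  sumℤ-cong≤ (suc n) e = cong₂ _+_ (sumℤ-cong≤ n (λ k k≤n → e k (ℕP.m≤n⇒m≤1+n k≤n))) (e (suc n) ℕP.≤-refl)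

  sumℤ-+ : ∀ n (f g : ℕ → ℤ) → sumℤ n (λ k → f k + g k) ≡ sumℤ n f + sumℤ n g
  sumℤ-+ zero    f g = refl
  sumℤ-+ (suc n) f g =
    trans (cong (_+ (f (suc n) + g (suc n))) (sumℤ-+ n f g)) (interchange (sumℤ n f) (sumℤ n g) _ _)

  sumℤ-*ˡ : ∀ n (c : ℤ) (f : ℕ → ℤ) → sumℤ n (λ k → c * f k) ≡ c * sumℤ n f
  sumℤ-*ˡ zero    c f = refl
  sumℤ-*ˡ (suc n) c f =
    trans (cong (_+ c * f (suc n)) (sumℤ-*ˡ n c f)) (sym (ℤP.*-distribˡ-+ c (sumℤ n f) (f (suc n))))

  sumℤ-*ʳ : ∀ n (c : ℤ) (f : ℕ → ℤ) → sumℤ n (λ k → f k * c) ≡ sumℤ n f * c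
  sumℤ-*ʳ zero    c f = refl
  sumℤ-*ʳ (suc n) c f =
    trans (cong (_+ f (suc n) * c) (sumℤ-*ʳ n c f)) (sym (ℤP.*-distribʳ-+ c (sumℤ n f) (f (suc n))))

  sumℤ-zero : ∀ n → sumℤ n (λ _ → 0ℤ) ≡ 0ℤ
  sumℤ-zero zero    = refl
  sumℤ-zero (suc n) = trans (ℤP.+-identityʳ (sumℤ n (λ _ → 0ℤ))) (sumℤ-zero n)

  sumℤ-when : ∀ n b (f : ℕ → ℤ) → sumℤ n (λ k → when b (f k)) ≡ when b (sumℤ n f)
  sumℤ-when n true  f = refl
  sumℤ-when n false f = sumℤ-zero n

  sumℤ-front : ∀ n (f : ℕ → ℤ) → sumℤ (suc n) f ≡ f 0 + sumℤ n (f ∘ suc)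
  sumℤ-front zero    f = refl
  sumℤ-front (suc n) f =
    trans (cong (_+ f (suc (suc n))) (sumℤ-front n f)) (ℤP.+-assoc (f 0) (sumℤ n (f ∘ suc)) (f (suc (suc n))))

  sumℤ-δ : ∀ n p (g : ℕ → ℤ) → sumℤ n (λ k → when (p ≡ᵇ k) (g k)) ≡ when (p <ᵇ suc n) (g p)
  sumℤ-δ zero    zero    g = refl
  sumℤ-δ zero    (suc p) g = refl
  sumℤ-δ (suc n) zero    g =
    trans (sumℤ-front n _) (trans (cong (_+_ (g 0)) (sumℤ-zero n)) (ℤP.+-identityʳ (g 0)))
  sumℤ-δ (suc n) (suc p) g =
    trans (sumℤ-front n _) (trans (ℤP.+-identityˡ _) (sumℤ-δ n p (g ∘ suc)))

  sumℤ-swap : ∀ m n (f : ℕ → ℕ → ℤ) →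
    sumℤ m (λ i → sumℤ n (f i)) ≡ sumℤ n (λ j → sumℤ m (λ i → f i j))
  sumℤ-swap zero    n f = refl
  sumℤ-swap (suc m) n f =
    trans (cong (_+ sumℤ n (f (suc m))) (sumℤ-swap m n f))
          (sym (sumℤ-+ n (λ j → sumℤ m (λ i → f i j)) (f (suc m))))

  sumℤ-reverse : ∀ n (f : ℕ → ℤ) → sumℤ n f ≡ sumℤ n (λ k → f (n ∸ k))
  sumℤ-reverse zero    f = refl
  sumℤ-reverse (suc n) f =
    trans (sumℤ-front n f)
    (trans (cong (_+_ (f 0)) (sumℤ-reverse n (f ∘ suc)))
    (trans (ℤP.+-comm (f 0) _)
    (cong₂ _+_ (sumℤ-cong≤ n (λ k k≤n → cong f (sym (ℕP.+-∸-assoc 1 k≤n))))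
               (cong f (sym (ℕP.n∸n≡0 n))))))

  sumℤ-triangle : ∀ a (g : ℕ → ℕ → ℤ) →
    sumℤ a (λ i → sumℤ i (λ k → g k i)) ≡ sumℤ a (λ k → sumℤ (a ∸ k) (λ m → g k (k ℕ.+ m)))
  sumℤ-triangle zero    g = refl
  sumℤ-triangle (suc a) g = begin
    sumℤ a (λ i → sumℤ i (λ k → g k i)) + sumℤ (suc a) (λ k → g k (suc a))
      ≡⟨ cong (_+ sumℤ (suc a) (λ k → g k (suc a))) (sumℤ-triangle a g) ⟩
    sumℤ a (λ k → sumℤ (a ∸ k) (λ m → g k (k ℕ.+ m))) + (sumℤ a (λ k → g k (suc a)) + g (suc a) (suc a))
      ≡⟨ ℤP.+-assoc (sumℤ a (λ k → sumℤ (a ∸ k) (λ m → g k (k ℕ.+ m)))) _ _ ⟨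
    sumℤ a (λ k → sumℤ (a ∸ k) (λ m → g k (k ℕ.+ m))) + sumℤ a (λ k → g k (suc a)) + g (suc a) (suc a)
      ≡⟨ cong₂ _+_ (sym (sumℤ-+ a _ _)) lastRow ⟩
    sumℤ a (λ k → sumℤ (a ∸ k) (λ m → g k (k ℕ.+ m)) + g k (suc a))
      + sumℤ (suc a ∸ suc a) (λ m → g (suc a) (suc a ℕ.+ m))
      ≡⟨ cong (_+ sumℤ (suc a ∸ suc a) (λ m → g (suc a) (suc a ℕ.+ m))) (sumℤ-cong≤ a extendRow) ⟩
    sumℤ (suc a) (λ k → sumℤ (suc a ∸ k) (λ m → g k (k ℕ.+ m))) ∎
    where
    open ≡-Reasoning
    lastRow : g (suc a) (suc a) ≡ sumℤ (suc a ∸ suc a) (λ m → g (suc a) (suc a ℕ.+ m))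
    lastRow = sym (trans (cong (λ t → sumℤ t (λ m → g (suc a) (suc a ℕ.+ m))) (ℕP.n∸n≡0 a))
                         (cong (g (suc a)) (ℕP.+-identityʳ (suc a))))
    extendRow : ∀ k → k ≤ a →
      sumℤ (a ∸ k) (λ m → g k (k ℕ.+ m)) + g k (suc a) ≡ sumℤ (suc a ∸ k) (λ m → g k (k ℕ.+ m))
    extendRow k k≤a rewrite ℕP.+-∸-assoc 1 k≤a =
      cong (_+_ (sumℤ (a ∸ k) (λ m → g k (k ℕ.+ m))))
           (cong (g k) (sym (trans (ℕP.+-suc k (a ∸ k)) (cong suc (ℕP.m+[n∸m]≡n k≤a)))))

module Series where

  open Sums using (when; when-*)
  open IndexSums
  open import Data.Integer using (_+_; _*_)
  open import Algebra.Bundles using (CommutativeSemiring)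
  open import Relation.Binary.Structures using (IsEquivalence)

  ⊕-cong : ∀ {p p′ q q′} → p ≈ p′ → q ≈ q′ → p ⊕ q ≈ p′ ⊕ q′
  ⊕-cong e f a b c = cong₂ _+_ (e a b c) (f a b c)

  ⊗-congˡ : ∀ {p p′ : Ser} q → p ≈ p′ → p ⊗ q ≈ p′ ⊗ q
  ⊗-congˡ q e a b c = sumℤ-cong a (λ a₁ → sumℤ-cong b (λ b₁ → sumℤ-cong c (λ c₁ →
    cong (_* q (a ∸ a₁) (b ∸ b₁) (c ∸ c₁)) (e a₁ b₁ c₁))))

  ⊗-congʳ : ∀ p {q q′ : Ser} → q ≈ q′ → p ⊗ q ≈ p ⊗ q′
  ⊗-congʳ p e a b c = sumℤ-cong a (λ a₁ → sumℤ-cong b (λ b₁ → sumℤ-cong c (λ c₁ →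
    cong (p a₁ b₁ c₁ *_) (e (a ∸ a₁) (b ∸ b₁) (c ∸ c₁)))))

  ⊗-cong : ∀ {p p′ q q′} → p ≈ p′ → q ≈ q′ → p ⊗ q ≈ p′ ⊗ q′
  ⊗-cong {p′ = p′} {q} e f a b c = trans (⊗-congˡ q e a b c) (⊗-congʳ p′ f a b c)

  sumℤ³-+ : ∀ a b c (f g : ℕ → ℕ → ℕ → ℤ) →
    sumℤ a (λ i → sumℤ b (λ j → sumℤ c (λ k → f i j k + g i j k)))
    ≡ sumℤ a (λ i → sumℤ b (λ j → sumℤ c (f i j))) + sumℤ a (λ i → sumℤ b (λ j → sumℤ c (g i j)))
  sumℤ³-+ a b c f g =
    trans (sumℤ-cong a (λ i → trans (sumℤ-cong b (λ j → sumℤ-+ c (f i j) (g i j))) (sumℤ-+ b _ _)))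
          (sumℤ-+ a _ _)

  ⊗-distribʳ : ∀ p q r → (p ⊕ q) ⊗ r ≈ p ⊗ r ⊕ q ⊗ r
  ⊗-distribʳ p q r a b c =
    trans (sumℤ-cong a (λ a₁ → sumℤ-cong b (λ b₁ → sumℤ-cong c (λ c₁ →
             ℤP.*-distribʳ-+ (r (a ∸ a₁) (b ∸ b₁) (c ∸ c₁)) (p a₁ b₁ c₁) (q a₁ b₁ c₁)))))
          (sumℤ³-+ a b c _ _)

  ⊗-distribˡ : ∀ p q r → p ⊗ (q ⊕ r) ≈ p ⊗ q ⊕ p ⊗ r
  ⊗-distribˡ p q r a b c =
    trans (sumℤ-cong a (λ a₁ → sumℤ-cong b (λ b₁ → sumℤ-cong c (λ c₁ →
             ℤP.*-distribˡ-+ (p a₁ b₁ c₁) (q (a ∸ a₁) (b ∸ b₁) (c ∸ c₁)) (r (a ∸ a₁) (b ∸ b₁) (c ∸ c₁))))))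
          (sumℤ³-+ a b c _ _)

  ⊗-comm : ∀ p q → p ⊗ q ≈ q ⊗ p
  ⊗-comm p q a b c =
    trans (sumℤ-reverse a _)
    (sumℤ-cong≤ a (λ a₁ a₁≤a → trans (sumℤ-reverse b _)
    (sumℤ-cong≤ b (λ b₁ b₁≤b → trans (sumℤ-reverse c _)
    (sumℤ-cong≤ c (λ c₁ c₁≤c → trans (ℤP.*-comm (p (a ∸ a₁) (b ∸ b₁) (c ∸ c₁)) _)
       (cong (_* p (a ∸ a₁) (b ∸ b₁) (c ∸ c₁))
         (cong₂ (λ u v → u v) (cong₂ q (ℕP.m∸[m∸n]≡n a₁≤a) (ℕP.m∸[m∸n]≡n b₁≤b)) (ℕP.m∸[m∸n]≡n c₁≤c)))))))))

  sumℤ³-*ˡ : ∀ x m n o (F : ℕ → ℕ → ℕ → ℤ) →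
    x * sumℤ m (λ i → sumℤ n (λ j → sumℤ o (F i j))) ≡ sumℤ m (λ i → sumℤ n (λ j → sumℤ o (λ k → x * F i j k)))
  sumℤ³-*ˡ x m n o F =
    trans (sym (sumℤ-*ˡ m x _)) (sumℤ-cong m (λ i → trans (sym (sumℤ-*ˡ n x _)) (sumℤ-cong n (λ j → sym (sumℤ-*ˡ o x _)))))

  sumℤ³-*ʳ : ∀ x m n o (F : ℕ → ℕ → ℕ → ℤ) →
    sumℤ m (λ i → sumℤ n (λ j → sumℤ o (F i j))) * x ≡ sumℤ m (λ i → sumℤ n (λ j → sumℤ o (λ k → F i j k * x)))
  sumℤ³-*ʳ x m n o F =
    trans (sym (sumℤ-*ʳ m x _)) (sumℤ-cong m (λ i → trans (sym (sumℤ-*ʳ n x _)) (sumℤ-cong n (λ j → sym (sumℤ-*ʳ o x _)))))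

  sumℤ³-rotate : ∀ m n o (F : ℕ → ℕ → ℕ → ℤ) →
    sumℤ m (λ x → sumℤ n (λ y → sumℤ o (F x y))) ≡ sumℤ o (λ z → sumℤ m (λ x → sumℤ n (λ y → F x y z)))
  sumℤ³-rotate m n o F =
    trans (sumℤ-cong m (λ x → sumℤ-swap n o (F x))) (sumℤ-swap m o (λ x z → sumℤ n (λ y → F x y z)))

  -- Both sides are rewritten to one sum over a₁ + a₂ + a₃ = a (and likewise for b, c).
  ⊗-assoc : ∀ p q r → (p ⊗ q) ⊗ r ≈ p ⊗ (q ⊗ r)
  ⊗-assoc p q r a b c = trans left (sym right)
    where
    K : ℕ → ℕ → ℕ → ℕ → ℕ → ℕ → ℤ
    K a₁ a₂ b₁ b₂ c₁ c₂ = p a₁ b₁ c₁ * (q a₂ b₂ c₂ * r (a ∸ a₁ ∸ a₂) (b ∸ b₁ ∸ b₂) (c ∸ c₁ ∸ c₂))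
    canonical : ℤ
    canonical = sumℤ a (λ a₁ → sumℤ (a ∸ a₁) (λ a₂ → sumℤ b (λ b₁ → sumℤ (b ∸ b₁) (λ b₂ →
                  sumℤ c (λ c₁ → sumℤ (c ∸ c₁) (K a₁ a₂ b₁ b₂ c₁))))))
    right : (p ⊗ (q ⊗ r)) a b c ≡ canonical
    right =
      trans (sumℤ-cong a (λ a₁ → sumℤ-cong b (λ b₁ → sumℤ-cong c (λ c₁ →
               sumℤ³-*ˡ (p a₁ b₁ c₁) (a ∸ a₁) (b ∸ b₁) (c ∸ c₁) _))))
      (sumℤ-cong a (λ a₁ → trans (sumℤ³-rotate b c (a ∸ a₁) _)
        (sumℤ-cong (a ∸ a₁) (λ a₂ → sumℤ-cong b (λ b₁ → sumℤ-swap c (b ∸ b₁) _)))))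
    M : ℕ → ℕ → ℕ → ℕ → ℕ → ℕ → ℤ
    M a₁ a₂ b₁ b₂ c₁ c₂ = p a₂ b₂ c₂ * q (a₁ ∸ a₂) (b₁ ∸ b₂) (c₁ ∸ c₂) * r (a ∸ a₁) (b ∸ b₁) (c ∸ c₁)
    reindex : ∀ a₂ m b₂ m′ c₂ m″ → M (a₂ ℕ.+ m) a₂ (b₂ ℕ.+ m′) b₂ (c₂ ℕ.+ m″) c₂ ≡ K a₂ m b₂ m′ c₂ m″
    reindex a₂ m b₂ m′ c₂ m″ =
      trans (cong₂ (λ x y → p a₂ b₂ c₂ * x * y)
              (cong₂ (λ u v → u v) (cong₂ q (ℕP.m+n∸m≡n a₂ m) (ℕP.m+n∸m≡n b₂ m′)) (ℕP.m+n∸m≡n c₂ m″))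
              (cong₂ (λ u v → u v) (cong₂ r (sym (ℕP.∸-+-assoc a a₂ m)) (sym (ℕP.∸-+-assoc b b₂ m′)))
                     (sym (ℕP.∸-+-assoc c c₂ m″))))
            (ℤP.*-assoc (p a₂ b₂ c₂) _ _)
    left : ((p ⊗ q) ⊗ r) a b c ≡ canonical
    left =
      trans (sumℤ-cong a (λ a₁ → sumℤ-cong b (λ b₁ → sumℤ-cong c (λ c₁ →
               sumℤ³-*ʳ (r (a ∸ a₁) (b ∸ b₁) (c ∸ c₁)) a₁ b₁ c₁ _))))
      (trans (sumℤ-cong a (λ a₁ → trans (sumℤ³-rotate b c a₁ _)
        (sumℤ-cong a₁ (λ a₂ → sumℤ-cong b (λ b₁ → sumℤ-swap c b₁ _)))))
      (trans (sumℤ-triangle a _)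
      (sumℤ-cong a (λ a₂ → sumℤ-cong (a ∸ a₂) (λ m →
         trans (sumℤ-triangle b _)
         (sumℤ-cong b (λ b₂ → sumℤ-cong (b ∸ b₂) (λ m′ →
           trans (sumℤ-triangle c _)
           (sumℤ-cong c (λ c₂ → sumℤ-cong (c ∸ c₂) (λ m″ → reindex a₂ m b₂ m′ c₂ m″)))))))))))

  scale : ℤ → Ser → Ser
  scale k P a b c = k * P a b c

  const-* : ∀ k a b c x → const k a b c * x ≡ when (0 ≡ᵇ a) (when (0 ≡ᵇ b) (when (0 ≡ᵇ c) (k * x)))
  const-* k zero    zero    zero    x = refl
  const-* k zero    zero    (suc c) x = refl
  const-* k zero    (suc b) c       x = refl
  const-* k (suc a) b       c       x = refl

  const-⊗ : ∀ k p → const k ⊗ p ≈ scale k p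
  const-⊗ k p a b c =
    trans (sumℤ-cong a (λ a₁ → trans (sumℤ-cong b (λ b₁ →
             trans (sumℤ-cong c (λ c₁ → const-* k a₁ b₁ c₁ (p (a ∸ a₁) (b ∸ b₁) (c ∸ c₁))))
             (trans (sumℤ-when c (0 ≡ᵇ a₁) _) (cong (when (0 ≡ᵇ a₁)) (sumℤ-when c (0 ≡ᵇ b₁) _)))))
           (trans (sumℤ-when b (0 ≡ᵇ a₁) _)
             (cong (when (0 ≡ᵇ a₁)) (trans (sumℤ-cong b (λ b₁ → cong (when (0 ≡ᵇ b₁)) (sumℤ-δ c 0 _)))
                                           (sumℤ-δ b 0 _))))))
          (sumℤ-δ a 0 _)

  ⊗-identityˡ : ∀ p → oneS ⊗ p ≈ p
  ⊗-identityˡ p a b c = trans (const-⊗ (+ 1) p a b c) (ℤP.*-identityˡ (p a b c))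

  ⊗-zeroˡ : ∀ p → zeroS ⊗ p ≈ zeroS
  ⊗-zeroˡ p a b c = trans (sumℤ-cong a (λ a₁ → trans (sumℤ-cong b (λ b₁ → sumℤ-zero c)) (sumℤ-zero b))) (sumℤ-zero a)

  -- Wrapping ≈ in a record makes it injective, which the ring solver's unifier needs.
  infix 4 _≋_
  record _≋_ (p q : Ser) : Set where
    constructor mk≋
    field get≋ : p ≈ q
  open _≋_ public

  ≋-isEquivalence : IsEquivalence _≋_
  ≋-isEquivalence = record
    { refl  = mk≋ (λ a b c → refl)
    ; sym   = λ e → mk≋ (λ a b c → sym (get≋ e a b c))
    ; trans = λ e f → mk≋ (λ a b c → trans (get≋ e a b c) (get≋ f a b c))
    }

  Ser-commutativeSemiring : CommutativeSemiring _ _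
  Ser-commutativeSemiring = record
    { Carrier = Ser
    ; _≈_ = _≋_
    ; _+_ = _⊕_
    ; _*_ = _⊗_
    ; 0# = zeroS
    ; 1# = oneS
    ; isCommutativeSemiring = record
      { isSemiring = record
        { isSemiringWithoutAnnihilatingZero = record
          { +-isCommutativeMonoid = record
            { isMonoid = record
              { isSemigroup = record
                { isMagma = record
                  { isEquivalence = ≋-isEquivalence
                  ; ∙-cong = λ e f → mk≋ (⊕-cong (get≋ e) (get≋ f)) }
                ; assoc = λ p q r → mk≋ (λ a b c → ℤP.+-assoc (p a b c) (q a b c) (r a b c)) }
              ; identity = (λ p → mk≋ (λ a b c → ℤP.+-identityˡ (p a b c)))
                         , (λ p → mk≋ (λ a b c → ℤP.+-identityʳ (p a b c))) }
            ; comm = λ p q → mk≋ (λ a b c → ℤP.+-comm (p a b c) (q a b c)) }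
          ; *-cong = λ e f → mk≋ (⊗-cong (get≋ e) (get≋ f))
          ; *-assoc = λ p q r → mk≋ (⊗-assoc p q r)
          ; *-identity = (λ p → mk≋ (⊗-identityˡ p))
                       , (λ p → mk≋ (λ a b c → trans (⊗-comm p oneS a b c) (⊗-identityˡ p a b c)))
          ; distrib = (λ p q r → mk≋ (⊗-distribˡ p q r)) , (λ p q r → mk≋ (λ a b c → ⊗-distribʳ q r p a b c)) }
        ; zero = (λ p → mk≋ (⊗-zeroˡ p)) , (λ p → mk≋ (λ a b c → trans (⊗-comm p zeroS a b c) (⊗-zeroˡ p a b c))) }
      ; *-comm = λ p q → mk≋ (⊗-comm p q) } }

  mono-* : ∀ p q r a b c x →
    mono p q r a b c * x ≡ when (p ≡ᵇ a) (when (q ≡ᵇ b) (when (r ≡ᵇ c) x))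
  mono-* p q r a b c x with p ℕP.≟ a in e₁ | q ℕP.≟ b in e₂ | r ℕP.≟ c in e₃
  ... | yes _ | yes _ | yes _ rewrite cong does e₁ | cong does e₂ | cong does e₃ = ℤP.*-identityˡ x
  ... | yes _ | yes _ | no _  rewrite cong does e₁ | cong does e₂ | cong does e₃ = refl
  ... | yes _ | no _  | _     rewrite cong does e₁ | cong does e₂ = refl
  ... | no _  | _     | _     rewrite cong does e₁ = refl

  mono-when : ∀ p q r a b c → mono p q r a b c ≡ when (p ≡ᵇ a) (when (q ≡ᵇ b) (when (r ≡ᵇ c) 1ℤ))
  mono-when p q r a b c = trans (sym (ℤP.*-identityʳ _)) (mono-* p q r a b c 1ℤ)

  shift : ℕ → ℕ → ℕ → Ser → Ser
  shift p q r P a b c =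
    when (p <ᵇ suc a) (when (q <ᵇ suc b) (when (r <ᵇ suc c) (P (a ∸ p) (b ∸ q) (c ∸ r))))

  mono-⊗ : ∀ p q r P → mono p q r ⊗ P ≈ shift p q r P
  mono-⊗ p q r P a b c =
    trans (sumℤ-cong a (λ a₁ → trans (sumℤ-cong b (λ b₁ →
             trans (sumℤ-cong c (λ c₁ → mono-* p q r a₁ b₁ c₁ (P (a ∸ a₁) (b ∸ b₁) (c ∸ c₁))))
             (trans (sumℤ-when c (p ≡ᵇ a₁) _) (cong (when (p ≡ᵇ a₁)) (sumℤ-when c (q ≡ᵇ b₁) _)))))
           (trans (sumℤ-when b (p ≡ᵇ a₁) _)
             (cong (when (p ≡ᵇ a₁)) (trans (sumℤ-cong b (λ b₁ → cong (when (q ≡ᵇ b₁)) (sumℤ-δ c r _)))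
                                           (sumℤ-δ b q _))))))
          (sumℤ-δ a p _)

  sumList-map : {A : Set} (f : A → Ser) (L : List A) (a b c : ℕ) →
    sumList (map f L) a b c ≡ Sums.Σl L (λ x → f x a b c)
  sumList-map f []      a b c = refl
  sumList-map f (x ∷ L) a b c = cong (_+_ (f x a b c)) (sumList-map f L a b c)

  mono-one : mono 0 0 0 ≈ oneS
  mono-one zero    zero    zero    = refl
  mono-one zero    zero    (suc c) = refl
  mono-one zero    (suc b) c       = refl
  mono-one (suc a) b       c       = refl

  mono-sucˣ : ∀ B D S a b c → mono (suc B) D S (suc a) b c ≡ mono B D S a b c
  mono-sucˣ B D S a b c = trans (mono-when (suc B) D S (suc a) b c) (sym (mono-when B D S a b c))

  mono-sucʸ : ∀ B D S a b c → mono B (suc D) S a (suc b) c ≡ mono B D S a b c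
  mono-sucʸ B D S a b c = trans (mono-when B (suc D) S a (suc b) c) (sym (mono-when B D S a b c))

  mono-sucˢ : ∀ B D S a b c → mono B D (suc S) a b (suc c) ≡ mono B D S a b c
  mono-sucˢ B D S a b c = trans (mono-when B D (suc S) a b (suc c)) (sym (mono-when B D S a b c))

  shift-monoˣ : ∀ p B D S a b c → when (p <ᵇ suc a) (mono B D S (a ∸ p) b c) ≡ mono (p ℕ.+ B) D S a b c
  shift-monoˣ zero    B D S a       b c = refl
  shift-monoˣ (suc p) B D S zero    b c = refl
  shift-monoˣ (suc p) B D S (suc a) b c = trans (shift-monoˣ p B D S a b c) (sym (mono-sucˣ (p ℕ.+ B) D S a b c))

  shift-monoʸ : ∀ q B D S a b c → when (q <ᵇ suc b) (mono B D S a (b ∸ q) c) ≡ mono B (q ℕ.+ D) S a b c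
  shift-monoʸ zero    B D S a b       c = refl
  shift-monoʸ (suc q) B D S a zero    c = sym (trans (mono-when B (suc (q ℕ.+ D)) S a 0 c) (Sums.when-zero (B ≡ᵇ a)))
  shift-monoʸ (suc q) B D S a (suc b) c = trans (shift-monoʸ q B D S a b c) (sym (mono-sucʸ B (q ℕ.+ D) S a b c))

  shift-monoˢ : ∀ r B D S a b c → when (r <ᵇ suc c) (mono B D S a b (c ∸ r)) ≡ mono B D (r ℕ.+ S) a b c
  shift-monoˢ zero    B D S a b c       = refl
  shift-monoˢ (suc r) B D S a b zero    =
    sym (trans (mono-when B D (suc (r ℕ.+ S)) a b 0)
               (trans (cong (when (B ≡ᵇ a)) (Sums.when-zero (D ≡ᵇ b))) (Sums.when-zero (B ≡ᵇ a))))
  shift-monoˢ (suc r) B D S a b (suc c) = trans (shift-monoˢ r B D S a b c) (sym (mono-sucˢ B D (r ℕ.+ S) a b c))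

  shift-mono : ∀ p q r B D S → shift p q r (mono B D S) ≈ mono (p ℕ.+ B) (q ℕ.+ D) (r ℕ.+ S)
  shift-mono p q r B D S a b c =
    trans (cong (when (p <ᵇ suc a)) (cong (when (q <ᵇ suc b)) (shift-monoˢ r B D S (a ∸ p) (b ∸ q) c)))
    (trans (cong (when (p <ᵇ suc a)) (shift-monoʸ q B D (r ℕ.+ S) (a ∸ p) b c))
           (shift-monoˣ p B (q ℕ.+ D) (r ℕ.+ S) a b c))

  shift-⊕ : ∀ p q r P Q → shift p q r (P ⊕ Q) ≈ shift p q r P ⊕ shift p q r Q
  shift-⊕ p q r P Q a b c =
    trans (cong (when (p <ᵇ suc a)) (trans (cong (when (q <ᵇ suc b)) (Sums.when-+ (r <ᵇ suc c) _ _))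
                                             (Sums.when-+ (q <ᵇ suc b) _ _)))
          (Sums.when-+ (p <ᵇ suc a) _ _)

  shift-scale : ∀ p q r k P → shift p q r (scale k P) ≈ scale k (shift p q r P)
  shift-scale p q r k P a b c =
    sym (trans (Sums.*-when k (p <ᵇ suc a) _)
          (cong (when (p <ᵇ suc a)) (trans (Sums.*-when k (q <ᵇ suc b) _)
                                             (cong (when (q <ᵇ suc b)) (Sums.*-when k (r <ᵇ suc c) _)))))

  shift-cong : ∀ p q r {P Q} → P ≈ Q → shift p q r P ≈ shift p q r Q
  shift-cong p q r e a b c = cong (λ t → when (p <ᵇ suc a) (when (q <ᵇ suc b) (when (r <ᵇ suc c) t))) (e _ _ _)

module Derivatives where

  open Sums using (when)
  open IndexSums
  open Series
  open import Data.Integer using (_+_; _*_)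
  open import Algebra.Properties.CommutativeSemigroup ℤP.*-commutativeSemigroup using (x∙yz≈y∙xz)
  open import Relation.Nullary.Decidable using (dec-false)

  ∂ : Ser → Ser
  ∂ P = ∂x P ⊕ ∂y P ⊕ ∂s P

  -- Split the factor a+1 as k + (a+1-k).
  sumℤ-Leibniz : ∀ a (H : ℕ → ℕ → ℤ) →
    (+ suc a) * sumℤ (suc a) (λ k → H k (suc a ∸ k))
    ≡ sumℤ a (λ k → (+ suc k) * H (suc k) (a ∸ k)) + sumℤ a (λ k → (+ suc (a ∸ k)) * H k (suc (a ∸ k)))
  sumℤ-Leibniz a H =
    trans (sym (sumℤ-*ˡ (suc a) (+ suc a) (λ k → H k (suc a ∸ k))))
    (trans (sumℤ-cong≤ (suc a) (λ k k≤ →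
              trans (cong (_* H k (suc a ∸ k)) (trans (cong +_ (sym (ℕP.m+[n∸m]≡n k≤))) (ℤP.pos-+ k (suc a ∸ k))))
                    (ℤP.*-distribʳ-+ (H k (suc a ∸ k)) (+ k) (+ (suc a ∸ k)))))
    (trans (sumℤ-+ (suc a) (λ k → (+ k) * H k (suc a ∸ k)) (λ k → (+ (suc a ∸ k)) * H k (suc a ∸ k)))
    (cong₂ _+_
       (trans (sumℤ-front a (λ k → (+ k) * H k (suc a ∸ k))) (ℤP.+-identityˡ (sumℤ a (λ k → (+ suc k) * H (suc k) (a ∸ k)))))
       (trans (cong₂ _+_ (sumℤ-cong≤ a (λ k k≤a → cong (λ t → (+ t) * H k t) (ℕP.+-∸-assoc 1 k≤a)))
                         (cong (λ t → (+ t) * H (suc a) t) (ℕP.n∸n≡0 a)))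
              (ℤP.+-identityʳ (sumℤ a (λ k → (+ suc (a ∸ k)) * H k (suc (a ∸ k)))))))))

  sumℤ²-*ˡ : ∀ k m n (F : ℕ → ℕ → ℤ) → sumℤ m (λ i → sumℤ n (λ j → k * F i j)) ≡ k * sumℤ m (λ i → sumℤ n (F i))
  sumℤ²-*ˡ k m n F = trans (sumℤ-cong m (λ i → sumℤ-*ˡ n k (F i))) (sumℤ-*ˡ m k _)

  ∂x-⊗ : ∀ p q → ∂x (p ⊗ q) ≈ ∂x p ⊗ q ⊕ p ⊗ ∂x q
  ∂x-⊗ p q a b c =
    trans (sumℤ-Leibniz a H)
    (cong₂ _+_
      (sumℤ-cong a (λ k → sym (trans (sumℤ-cong b (λ b₁ → sumℤ-cong c (λ c₁ →
         ℤP.*-assoc (+ suc k) (p (suc k) b₁ c₁) (q (a ∸ k) (b ∸ b₁) (c ∸ c₁))))) (sumℤ²-*ˡ (+ suc k) b c _))))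
      (sym (sumℤ-cong≤ a (λ k _ → trans (sumℤ-cong b (λ b₁ → sumℤ-cong c (λ c₁ →
         x∙yz≈y∙xz (p k b₁ c₁) (+ suc (a ∸ k)) (q (suc (a ∸ k)) (b ∸ b₁) (c ∸ c₁)))))
           (sumℤ²-*ˡ (+ suc (a ∸ k)) b c _)))))
    where
    H : ℕ → ℕ → ℤ
    H a₁ a₂ = sumℤ b (λ b₁ → sumℤ c (λ c₁ → p a₁ b₁ c₁ * q a₂ (b ∸ b₁) (c ∸ c₁)))

  ∂y-⊗ : ∀ p q → ∂y (p ⊗ q) ≈ ∂y p ⊗ q ⊕ p ⊗ ∂y q
  ∂y-⊗ p q a b c =
    trans (sym (sumℤ-*ˡ a (+ suc b) _))
    (trans (sumℤ-cong a (λ a₁ → sumℤ-Leibniz b (H a₁)))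
    (trans (sumℤ-+ a _ _)
    (cong₂ _+_
      (sumℤ-cong a (λ a₁ → sumℤ-cong b (λ k → sym (trans (sumℤ-cong c (λ c₁ →
         ℤP.*-assoc (+ suc k) (p a₁ (suc k) c₁) (q (a ∸ a₁) (b ∸ k) (c ∸ c₁)))) (sumℤ-*ˡ c (+ suc k) _)))))
      (sumℤ-cong a (λ a₁ → sym (sumℤ-cong≤ b (λ k _ → trans (sumℤ-cong c (λ c₁ →
         x∙yz≈y∙xz (p a₁ k c₁) (+ suc (b ∸ k)) (q (a ∸ a₁) (suc (b ∸ k)) (c ∸ c₁))))
           (sumℤ-*ˡ c (+ suc (b ∸ k)) _))))))))
    where
    H : ℕ → ℕ → ℕ → ℤ
    H a₁ b₁ b₂ = sumℤ c (λ c₁ → p a₁ b₁ c₁ * q (a ∸ a₁) b₂ (c ∸ c₁))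

  ∂s-⊗ : ∀ p q → ∂s (p ⊗ q) ≈ ∂s p ⊗ q ⊕ p ⊗ ∂s q
  ∂s-⊗ p q a b c =
    trans (sym (sumℤ²-*ˡ (+ suc c) a b _))
    (trans (sumℤ-cong a (λ a₁ → sumℤ-cong b (λ b₁ → sumℤ-Leibniz c (H a₁ b₁))))
    (trans (sumℤ-cong a (λ a₁ → sumℤ-+ b _ _))
    (trans (sumℤ-+ a _ _)
    (cong₂ _+_
      (sumℤ-cong a (λ a₁ → sumℤ-cong b (λ b₁ → sumℤ-cong c (λ k →
         sym (ℤP.*-assoc (+ suc k) (p a₁ b₁ (suc k)) (q (a ∸ a₁) (b ∸ b₁) (c ∸ k)))))))
      (sumℤ-cong a (λ a₁ → sumℤ-cong b (λ b₁ → sym (sumℤ-cong≤ c (λ k _ →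
         x∙yz≈y∙xz (p a₁ b₁ k) (+ suc (c ∸ k)) (q (a ∸ a₁) (b ∸ b₁) (suc (c ∸ k))))))))))))
    where
    H : ℕ → ℕ → ℕ → ℕ → ℤ
    H a₁ b₁ c₁ c₂ = p a₁ b₁ c₁ * q (a ∸ a₁) (b ∸ b₁) c₂

  ∂-cong : ∀ {p q} → p ≈ q → ∂ p ≈ ∂ q
  ∂-cong e a b c = cong₂ _+_ (cong₂ _+_ (cong (+ suc a *_) (e (suc a) b c)) (cong (+ suc b *_) (e a (suc b) c)))
                             (cong (+ suc c *_) (e a b (suc c)))

  ∂-⊕ : ∀ p q → ∂ (p ⊕ q) ≈ ∂ p ⊕ ∂ q
  ∂-⊕ p q a b c =
    trans (cong₂ _+_ (cong₂ _+_ (ℤP.*-distribˡ-+ (+ suc a) (p (suc a) b c) (q (suc a) b c))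
                                (ℤP.*-distribˡ-+ (+ suc b) (p a (suc b) c) (q a (suc b) c)))
                     (ℤP.*-distribˡ-+ (+ suc c) (p a b (suc c)) (q a b (suc c))))
    (trans (cong (_+ (z₁ + z₂)) (interchange x₁ x₂ y₁ y₂)) (interchange (x₁ + y₁) (x₂ + y₂) z₁ z₂))
    where
    open import Algebra.Properties.CommutativeSemigroup ℤP.+-commutativeSemigroup using (interchange)
    x₁ = + suc a * p (suc a) b c
    x₂ = + suc a * q (suc a) b c
    y₁ = + suc b * p a (suc b) c
    y₂ = + suc b * q a (suc b) c
    z₁ = + suc c * p a b (suc c)
    z₂ = + suc c * q a b (suc c)

  ∂-const : ∀ k → ∂ (const k) ≈ zeroS
  ∂-const k a b c = cong₂ _+_ (cong₂ _+_ (ℤP.*-zeroʳ (+ suc a)) (trans (cong (+ suc b *_) (const-y k a b c)) (ℤP.*-zeroʳ (+ suc b))))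
                              (trans (cong (+ suc c *_) (const-s k a b c)) (ℤP.*-zeroʳ (+ suc c)))
    where
    const-y : ∀ k a b c → const k a (suc b) c ≡ 0ℤ
    const-y k zero    b c = refl
    const-y k (suc a) b c = refl
    const-s : ∀ k a b c → const k a b (suc c) ≡ 0ℤ
    const-s k zero    zero    c = refl
    const-s k zero    (suc b) c = refl
    const-s k (suc a) b       c = refl

  mono-offˣ : ∀ {B a} D S b c → B ≢ a → mono B D S a b c ≡ 0ℤ
  mono-offˣ {B} {a} D S b c B≢a rewrite mono-when B D S a b c | dec-false (B ℕP.≟ a) B≢a = refl

  mono-offʸ : ∀ {D b} B S a c → D ≢ b → mono B D S a b c ≡ 0ℤ
  mono-offʸ {D} {b} B S a c D≢b rewrite mono-when B D S a b c | dec-false (D ℕP.≟ b) D≢b =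
    Sums.when-zero (B ≡ᵇ a)

  mono-offˢ : ∀ {S c} B D a b → S ≢ c → mono B D S a b c ≡ 0ℤ
  mono-offˢ {S} {c} B D a b S≢c rewrite mono-when B D S a b c | dec-false (S ℕP.≟ c) S≢c =
    trans (cong (when (B ≡ᵇ a)) (Sums.when-zero (D ≡ᵇ b))) (Sums.when-zero (B ≡ᵇ a))

  exponentˣ : ∀ B D S a b c → (+ a) * mono B D S a b c ≡ (+ B) * mono B D S a b c
  exponentˣ B D S a b c = by-cases (B ℕP.≟ a)
    where
    by-cases : Dec (B ≡ a) → (+ a) * mono B D S a b c ≡ (+ B) * mono B D S a b c
    by-cases (yes refl) = refl
    by-cases (no ≢) =
      trans (cong (+ a *_) (mono-offˣ D S b c ≢))
      (trans (ℤP.*-zeroʳ (+ a)) (sym (trans (cong (+ B *_) (mono-offˣ D S b c ≢)) (ℤP.*-zeroʳ (+ B)))))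

  exponentʸ : ∀ B D S a b c → (+ b) * mono B D S a b c ≡ (+ D) * mono B D S a b c
  exponentʸ B D S a b c = by-cases (D ℕP.≟ b)
    where
    by-cases : Dec (D ≡ b) → (+ b) * mono B D S a b c ≡ (+ D) * mono B D S a b c
    by-cases (yes refl) = refl
    by-cases (no ≢) =
      trans (cong (+ b *_) (mono-offʸ B S a c ≢))
      (trans (ℤP.*-zeroʳ (+ b)) (sym (trans (cong (+ D *_) (mono-offʸ B S a c ≢)) (ℤP.*-zeroʳ (+ D)))))

  exponentˢ : ∀ B D S a b c → (+ c) * mono B D S a b c ≡ (+ S) * mono B D S a b c
  exponentˢ B D S a b c = by-cases (S ℕP.≟ c)
    where
    by-cases : Dec (S ≡ c) → (+ c) * mono B D S a b c ≡ (+ S) * mono B D S a b c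
    by-cases (yes refl) = refl
    by-cases (no ≢) =
      trans (cong (+ c *_) (mono-offˢ B D a b ≢))
      (trans (ℤP.*-zeroʳ (+ c)) (sym (trans (cong (+ S *_) (mono-offˢ B D a b ≢)) (ℤP.*-zeroʳ (+ S)))))

  ∂x-mono : ∀ B D S a b c → ∂x (mono B D S) a b c ≡ (+ B) * mono (B ∸ 1) D S a b c
  ∂x-mono zero    D S a b c = ℤP.*-zeroʳ (+ suc a)
  ∂x-mono (suc B) D S a b c =
    trans (exponentˣ (suc B) D S (suc a) b c) (cong (+ suc B *_) (mono-sucˣ B D S a b c))

  ∂y-mono : ∀ B D S a b c → ∂y (mono B D S) a b c ≡ (+ D) * mono B (D ∸ 1) S a b c
  ∂y-mono B zero    S a b c = trans (cong (+ suc b *_) (mono-offʸ B S a c (λ ()))) (ℤP.*-zeroʳ (+ suc b))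
  ∂y-mono B (suc D) S a b c =
    trans (exponentʸ B (suc D) S a (suc b) c) (cong (+ suc D *_) (mono-sucʸ B D S a b c))

  ∂s-mono : ∀ B D S a b c → ∂s (mono B D S) a b c ≡ (+ S) * mono B D (S ∸ 1) a b c
  ∂s-mono B D zero    a b c = trans (cong (+ suc c *_) (mono-offˢ B D a b (λ ()))) (ℤP.*-zeroʳ (+ suc c))
  ∂s-mono B D (suc S) a b c =
    trans (exponentˢ B D (suc S) a b (suc c)) (cong (+ suc S *_) (mono-sucˢ B D S a b c))

  ∂-mono : ∀ B D S →
    ∂ (mono B D S) ≈ scale (+ B) (mono (B ∸ 1) D S) ⊕ scale (+ D) (mono B (D ∸ 1) S) ⊕ scale (+ S) (mono B D (S ∸ 1))
  ∂-mono B D S a b c = cong₂ _+_ (cong₂ _+_ (∂x-mono B D S a b c) (∂y-mono B D S a b c)) (∂s-mono B D S a b c)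

  ∂-X : ∂ X ≈ oneS
  ∂-X a b c = trans (∂-mono 1 0 0 a b c)
    (trans (ℤP.+-identityʳ _) (trans (ℤP.+-identityʳ _) (trans (ℤP.*-identityˡ _) (mono-one a b c))))

  ∂-Y : ∂ Y ≈ oneS
  ∂-Y a b c = trans (∂-mono 0 1 0 a b c)
    (trans (ℤP.+-identityʳ _) (trans (ℤP.+-identityˡ _) (trans (ℤP.*-identityˡ _) (mono-one a b c))))

  ∂-S : ∂ S ≈ oneS
  ∂-S a b c = trans (∂-mono 0 0 1 a b c) (trans (ℤP.+-identityˡ _) (trans (ℤP.*-identityˡ _) (mono-one a b c)))

module Operator where

  open Series
  open Derivatives
  open import Data.Integer using (_+_)
  open import Algebra.Bundles using (CommutativeSemiring)
  open import Algebra.Solver.Ring.NaturalCoefficients.Default Ser-commutativeSemiring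
    using (solve; _:+_; _:*_; _:=_; con)
  open CommutativeSemiring Ser-commutativeSemiring
    using (setoid; +-cong; *-cong) renaming (refl to ≋-refl; sym to ≋-sym; trans to ≋-trans)
  open import Relation.Binary.Reasoning.Setoid setoid

  𝓛 : Ser → Ser
  𝓛 P = (S ⊕ Y) ⊗ P ⊕ (X ⊗ Y) ⊗ ∂ P

  ⊕-congˡ : ∀ {p p′} q → p ≋ p′ → p ⊕ q ≋ p′ ⊕ q
  ⊕-congˡ q e = +-cong e (≋-refl {q})

  ⊕-congʳ : ∀ p {q q′} → q ≋ q′ → p ⊕ q ≋ p ⊕ q′
  ⊕-congʳ p e = +-cong (≋-refl {p}) e

  ⊗-congˡ≋ : ∀ {p p′} q → p ≋ p′ → p ⊗ q ≋ p′ ⊗ q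
  ⊗-congˡ≋ q e = *-cong e (≋-refl {q})

  ⊗-congʳ≋ : ∀ p {q q′} → q ≋ q′ → p ⊗ q ≋ p ⊗ q′
  ⊗-congʳ≋ p e = *-cong (≋-refl {p}) e

  const-+ : ∀ a b → const (a + b) ≋ const a ⊕ const b
  const-+ a b = mk≋ pointwise
    where
    pointwise : const (a + b) ≈ const a ⊕ const b
    pointwise zero    zero    zero    = refl
    pointwise zero    zero    (suc c) = refl
    pointwise zero    (suc b) c       = refl
    pointwise (suc a) b       c       = refl

  const-zero : const 0ℤ ≋ zeroS
  const-zero = mk≋ pointwise
    where
    pointwise : const 0ℤ ≈ zeroS
    pointwise zero    zero    zero    = refl
    pointwise zero    zero    (suc c) = refl
    pointwise zero    (suc b) c       = refl
    pointwise (suc a) b       c       = refl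

  ∂-⊗ : ∀ p q → ∂ (p ⊗ q) ≋ ∂ p ⊗ q ⊕ p ⊗ ∂ q
  ∂-⊗ p q = ≋-trans (mk≋ (⊕-cong (⊕-cong (∂x-⊗ p q) (∂y-⊗ p q)) (∂s-⊗ p q)))
    (solve 8 (λ P Q xp yp sp xq yq sq → (xp :* Q :+ P :* xq) :+ (yp :* Q :+ P :* yq) :+ (sp :* Q :+ P :* sq)
                                      := (xp :+ yp :+ sp) :* Q :+ P :* (xq :+ yq :+ sq))
       ≋-refl p q (∂x p) (∂y p) (∂s p) (∂x q) (∂y q) (∂s q))

  ∂-const-⊗ : ∀ k p → ∂ (const k ⊗ p) ≋ const k ⊗ ∂ p
  ∂-const-⊗ k p = begin
    ∂ (const k ⊗ p)                       ≈⟨ ∂-⊗ (const k) p ⟩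
    ∂ (const k) ⊗ p ⊕ const k ⊗ ∂ p       ≈⟨ ⊕-congˡ (const k ⊗ ∂ p) (⊗-congˡ≋ p (mk≋ (∂-const k))) ⟩
    zeroS ⊗ p ⊕ const k ⊗ ∂ p              ≈⟨ solve 3 (λ P K DP → con 0 :* P :+ K :* DP := K :* DP) ≋-refl p (const k) (∂ p) ⟩
    const k ⊗ ∂ p                          ∎

  ∂-^ : ∀ P m → ∂ (P ^S m) ≋ const (+ m) ⊗ (P ^S (m ∸ 1) ⊗ ∂ P)
  ∂-^ P zero = begin
    ∂ oneS                          ≈⟨ mk≋ (∂-const (+ 1)) ⟩
    zeroS                           ≈⟨ solve 2 (λ A B → con 0 := con 0 :* (A :* B)) ≋-refl oneS (∂ P) ⟩
    zeroS ⊗ (oneS ⊗ ∂ P)            ≈⟨ ⊗-congˡ≋ (oneS ⊗ ∂ P) (≋-sym const-zero) ⟩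
    const (+ 0) ⊗ (oneS ⊗ ∂ P)      ∎
  ∂-^ P (suc zero) = begin
    ∂ (P ⊗ oneS)                    ≈⟨ ∂-⊗ P oneS ⟩
    ∂ P ⊗ oneS ⊕ P ⊗ ∂ oneS         ≈⟨ ⊕-congʳ (∂ P ⊗ oneS) (⊗-congʳ≋ P (mk≋ (∂-const (+ 1)))) ⟩
    ∂ P ⊗ oneS ⊕ P ⊗ zeroS          ≈⟨ solve 2 (λ DP P → DP :* con 1 :+ P :* con 0 := con 1 :* (con 1 :* DP)) ≋-refl (∂ P) P ⟩
    oneS ⊗ (oneS ⊗ ∂ P)             ∎
  ∂-^ P (suc (suc m)) = begin
    ∂ (P ⊗ (P ⊗ P ^S m))
      ≈⟨ ∂-⊗ P (P ⊗ P ^S m) ⟩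
    ∂ P ⊗ (P ⊗ P ^S m) ⊕ P ⊗ ∂ (P ⊗ P ^S m)
      ≈⟨ ⊕-congʳ (∂ P ⊗ (P ⊗ P ^S m)) (⊗-congʳ≋ P (∂-^ P (suc m))) ⟩
    ∂ P ⊗ (P ⊗ P ^S m) ⊕ P ⊗ (const (+ suc m) ⊗ (P ^S m ⊗ ∂ P))
      ≈⟨ solve 4 (λ DP P Pm C → DP :* (P :* Pm) :+ P :* (C :* (Pm :* DP)) := (con 1 :+ C) :* ((P :* Pm) :* DP))
               ≋-refl (∂ P) P (P ^S m) (const (+ suc m)) ⟩
    (oneS ⊕ const (+ suc m)) ⊗ ((P ⊗ P ^S m) ⊗ ∂ P)
      ≈⟨ ⊗-congˡ≋ ((P ⊗ P ^S m) ⊗ ∂ P) (≋-sym (const-+ (+ 1) (+ suc m))) ⟩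
    const (+ suc (suc m)) ⊗ ((P ⊗ P ^S m) ⊗ ∂ P) ∎

  𝓛-cong : ∀ {p q} → p ≋ q → 𝓛 p ≋ 𝓛 q
  𝓛-cong e = +-cong (⊗-congʳ≋ (S ⊕ Y) e) (⊗-congʳ≋ (X ⊗ Y) (mk≋ (∂-cong (get≋ e))))

  𝓛-⊕ : ∀ p q → 𝓛 (p ⊕ q) ≋ 𝓛 p ⊕ 𝓛 q
  𝓛-⊕ p q = ≋-trans (⊕-congʳ ((S ⊕ Y) ⊗ (p ⊕ q)) (⊗-congʳ≋ (X ⊗ Y) (mk≋ (∂-⊕ p q))))
    (solve 6 (λ u xy p q dp dq → u :* (p :+ q) :+ xy :* (dp :+ dq) := (u :* p :+ xy :* dp) :+ (u :* q :+ xy :* dq))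
       ≋-refl (S ⊕ Y) (X ⊗ Y) p q (∂ p) (∂ q))

  𝓛-const-⊗ : ∀ k p → 𝓛 (const k ⊗ p) ≋ const k ⊗ 𝓛 p
  𝓛-const-⊗ k p = ≋-trans (⊕-congʳ ((S ⊕ Y) ⊗ (const k ⊗ p)) (⊗-congʳ≋ (X ⊗ Y) (∂-const-⊗ k p)))
    (solve 5 (λ u xy c p dp → u :* (c :* p) :+ xy :* (c :* dp) := c :* (u :* p :+ xy :* dp))
       ≋-refl (S ⊕ Y) (X ⊗ Y) (const k) p (∂ p))

  𝓛-zero : 𝓛 zeroS ≋ zeroS
  𝓛-zero = ≋-trans (⊕-congʳ ((S ⊕ Y) ⊗ zeroS) (⊗-congʳ≋ (X ⊗ Y) ∂-zero))
    (solve 2 (λ u xy → u :* con 0 :+ xy :* con 0 := con 0) ≋-refl (S ⊕ Y) (X ⊗ Y))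
    where
    ∂-zero : ∂ zeroS ≋ zeroS
    ∂-zero = mk≋ (λ a b c → cong₂ _+_ (cong₂ _+_ (ℤP.*-zeroʳ (+ suc a)) (ℤP.*-zeroʳ (+ suc b))) (ℤP.*-zeroʳ (+ suc c)))

  𝓛-sumList : {A : Set} (f : A → Ser) (L : List A) → 𝓛 (sumList (map f L)) ≋ sumList (map (𝓛 ∘ f) L)
  𝓛-sumList f []      = 𝓛-zero
  𝓛-sumList f (x ∷ L) = ≋-trans (𝓛-⊕ (f x) (sumList (map f L))) (⊕-congʳ (𝓛 (f x)) (𝓛-sumList f L))

  𝓛-sumS : ∀ n (f : ℕ → Ser) → 𝓛 (sumS n f) ≋ sumS n (𝓛 ∘ f)
  𝓛-sumS zero    f = ≋-refl
  𝓛-sumS (suc n) f = ≋-trans (𝓛-⊕ (sumS n f) (f (suc n))) (⊕-congˡ (𝓛 (f (suc n))) (𝓛-sumS n f))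

module Recurrence where

  open Sums
  open Permutations
  open Statistics
  open Series
  open Derivatives
  open Operator using (𝓛; 𝓛-sumList)
  open import Data.Integer using (_+_; _*_; -_)
  open import Data.Integer.Solver using (module +-*-Solver)
  open import Data.List.Membership.Propositional.Properties using (∈-map⁻; ∈-upTo⁻)
  open import Data.List.Relation.Unary.Unique.DecPropositional ℕP._≟_ using (Unique)
  open +-*-Solver

  statMonomial : List ℕ → Ser
  statMonomial π = mono (basc π) (des π) (sucs π)

  statMonomial≡ : ∀ π → statMonomial π ≡ mono (basc′ π) (des′ π) (sucs′ π)
  statMonomial≡ π rewrite basc≡basc′ π | des≡des′ π | sucs≡sucs′ π = refl

  XY≈mono : X ⊗ Y ≈ mono 1 1 0
  XY≈mono a b c = trans (mono-⊗ 1 0 0 Y a b c) (shift-mono 1 0 0 0 1 0 a b c)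

  scale-pred : ∀ p (f : ℕ → ℤ) → (+ p) * f (suc (p ∸ 1)) ≡ (+ p) * f p
  scale-pred zero    f = refl
  scale-pred (suc p) f = refl

  𝓛-mono : ∀ p q r a b c → 𝓛 (mono p q r) a b c ≡
      (mono p q (suc r) a b c + mono p (suc q) r a b c)
    + ((+ p) * mono p (suc q) r a b c + (+ q) * mono (suc p) q r a b c + (+ r) * mono (suc p) (suc q) (r ∸ 1) a b c)
  𝓛-mono p q r a b c = cong₂ _+_ timesSY timesXY∂
    where
    m = mono p q r
    m₁ = mono (p ∸ 1) q r
    m₂ = mono p (q ∸ 1) r
    m₃ = mono p q (r ∸ 1)
    timesSY : ((S ⊕ Y) ⊗ m) a b c ≡ mono p q (suc r) a b c + mono p (suc q) r a b c
    timesSY = trans (⊗-distribʳ S Y m a b c)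
      (cong₂ _+_ (trans (mono-⊗ 0 0 1 m a b c) (shift-mono 0 0 1 p q r a b c))
                 (trans (mono-⊗ 0 1 0 m a b c) (shift-mono 0 1 0 p q r a b c)))
    shiftXY : ∀ k p′ q′ r′ → shift 1 1 0 (scale k (mono p′ q′ r′)) a b c ≡ k * mono (suc p′) (suc q′) r′ a b c
    shiftXY k p′ q′ r′ = trans (shift-scale 1 1 0 k (mono p′ q′ r′) a b c) (cong (k *_) (shift-mono 1 1 0 p′ q′ r′ a b c))
    timesXY∂ : ((X ⊗ Y) ⊗ ∂ m) a b c
      ≡ (+ p) * mono p (suc q) r a b c + (+ q) * mono (suc p) q r a b c + (+ r) * mono (suc p) (suc q) (r ∸ 1) a b c
    timesXY∂ =
      trans (⊗-congˡ (∂ m) XY≈mono a b c)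
      (trans (mono-⊗ 1 1 0 (∂ m) a b c)
      (trans (shift-cong 1 1 0 (∂-mono p q r) a b c)
      (trans (shift-⊕ 1 1 0 (scale (+ p) m₁ ⊕ scale (+ q) m₂) (scale (+ r) m₃) a b c)
      (cong₂ _+_
        (trans (shift-⊕ 1 1 0 (scale (+ p) m₁) (scale (+ q) m₂) a b c)
          (cong₂ _+_ (trans (shiftXY (+ p) (p ∸ 1) q r) (scale-pred p (λ t → mono t (suc q) r a b c)))
                     (trans (shiftXY (+ q) p (q ∸ 1) r) (scale-pred q (λ t → mono (suc p) t r a b c)))))
        (shiftXY (+ r) p q (r ∸ 1))))))

  cancel : ∀ (Z Q X R : ℤ) → Q + (+ 1) * X ≡ R → Z + Q ≡ Z + R + (- X)
  cancel Z Q X R e =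
    trans (solve 3 (λ z q x → z :+ q := z :+ (q :+ con 1ℤ :* x) :+ (:- x)) refl Z Q X)
          (cong (λ t → Z + t + (- X)) e)

  Σl-insertions-new-max : ∀ n v a b c → Unique v → All (_≤ n) v → count n v ≡ 1 →
    Σl (insertions (suc n) v) (λ w → statMonomial w a b c) ≡ 𝓛 (statMonomial v) a b c
  Σl-insertions-new-max n []      a b c _    _         ()
  Σl-insertions-new-max n (y ∷ ρ) a b c uniq bounded once = begin
    Σl (insertions (suc n) (y ∷ ρ)) (λ w → statMonomial w a b c)
      ≡⟨ Σl-cong (insertions (suc n) (y ∷ ρ)) (λ w → cong (λ P → P a b c) (statMonomial≡ w)) ⟩
    atStats δ (suc n ∷ y ∷ ρ) + Σl (map (y ∷_) (insertions (suc n) ρ)) (atStats δ)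
      ≡⟨ cong₂ _+_ insertedFirst (Σl-map (y ∷_) (insertions (suc n) ρ) (atStats δ)) ⟩
    δ B (suc D) S′ + Q
      ≡⟨ cancel (δ B (suc D) S′) Q (δ (suc B) D S′) _ tail ⟩
    δ B (suc D) S′ + insertionTransform δ 1 B D S′ + (- δ (suc B) D S′)
      ≡⟨ solve 7 (λ x y z w b d s → z :+ (con 1ℤ :* y :+ b :* z :+ (con 1ℤ :+ d) :* x :+ s :* w) :+ (:- x)
                                  := (y :+ z) :+ (b :* z :+ d :* x :+ s :* w))
           refl (δ (suc B) D S′) (δ B D (suc S′)) (δ B (suc D) S′) (δ (suc B) (suc D) (S′ ∸ 1)) (+ B) (+ D) (+ S′) ⟩
    (δ B D (suc S′) + δ B (suc D) S′) + ((+ B) * δ B (suc D) S′ + (+ D) * δ (suc B) D S′ + (+ S′) * δ (suc B) (suc D) (S′ ∸ 1))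
      ≡⟨ 𝓛-mono B D S′ a b c ⟨
    𝓛 (mono B D S′) a b c
      ≡⟨ cong (λ P → 𝓛 P a b c) (statMonomial≡ (y ∷ ρ)) ⟨
    𝓛 (statMonomial (y ∷ ρ)) a b c ∎
    where
    open ≡-Reasoning
    δ : Weight
    δ p q r = mono p q r a b c
    B = basc′ (y ∷ ρ)
    D = des′ (y ∷ ρ)
    S′ = sucs′ (y ∷ ρ)
    Q = Σl (insertions (suc n) ρ) (λ v → atStats δ (y ∷ v))
    tail : Q + (+ 1) * δ (suc B) D S′ ≡ insertionTransform δ 1 B D S′
    tail = subst (λ h → Q + (+ h) * δ (suc B) D S′ ≡ insertionTransform δ h B D S′) once
                 (Σl-insertions-tail n y ρ δ uniq bounded)
    insertedFirst : atStats δ (suc n ∷ y ∷ ρ) ≡ δ B (suc D) S′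
    insertedFirst with pairBits-descent (suc n) y (s≤s (All.head bounded))
    ... | b≡0 , d≡1 , s≡0 rewrite b≡0 | d≡1 | s≡0 = refl

  range1-bound : ∀ n {c} → c ∈ range1 n → c < suc n
  range1-bound n c∈ with ∈-map⁻ suc c∈
  ... | i , i∈ , refl = s≤s (∈-upTo⁻ i∈)

  recurrence : ∀ n → 1 ≤ n → Apoly (suc n) ≈ 𝓛 (Apoly n)
  recurrence (suc n) _ a b c = begin
    Apoly (suc (suc n)) a b c
      ≡⟨ sumList-map statMonomial (perms (suc (suc n))) a b c ⟩
    Σl (perms (suc (suc n))) (λ π → statMonomial π a b c)
      ≡⟨ Σl-perms-suc (suc n) _ ⟩
    Σl (perms (suc n)) (λ π → Σl (insertions (suc (suc n)) π) (λ w → statMonomial w a b c))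
      ≡⟨ Σl-perms-suc n _ ⟩
    Σl (perms n) (λ π → Σl (insertions (suc n) π) (λ v → Σl (insertions (suc (suc n)) v) (λ w → statMonomial w a b c)))
      ≡⟨ Σl-perms-cong n (λ π uniq ∈range → Σl-cong-∈ (insertions (suc n) π) (insertingNewMax π uniq ∈range)) ⟩
    Σl (perms n) (λ π → Σl (insertions (suc n) π) (λ v → 𝓛 (statMonomial v) a b c))
      ≡⟨ Σl-perms-suc n _ ⟨
    Σl (perms (suc n)) (λ π → 𝓛 (statMonomial π) a b c)
      ≡⟨ sumList-map (𝓛 ∘ statMonomial) (perms (suc n)) a b c ⟨
    sumList (map (𝓛 ∘ statMonomial) (perms (suc n))) a b c
      ≡⟨ get≋ (𝓛-sumList statMonomial (perms (suc n))) a b c ⟨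
    𝓛 (Apoly (suc n)) a b c ∎
    where
    open ≡-Reasoning
    insertingNewMax : ∀ π → Unique π → All (_∈ range1 n) π → ∀ v → v ∈ insertions (suc n) π →
      Σl (insertions (suc (suc n)) v) (λ w → statMonomial w a b c) ≡ 𝓛 (statMonomial v) a b c
    insertingNewMax π uniq ∈range v v∈ =
      Σl-insertions-new-max (suc n) v a b c
        (insertions-Unique π new uniq v∈)
        (insertions-All π ℕP.≤-refl (All.map (ℕP.<⇒≤ ∘ range1-bound n) ∈range) v∈)
        (count-insertions π new v∈)
      where
      new : All (suc n ≢_) π
      new = All.map (λ c∈ n+1≡c → ℕP.<-irrefl (sym n+1≡c) (range1-bound n c∈)) ∈range

module SeriesSums where

  open IndexSums using (sumℤ-front)
  open Series
  open Operator using (⊕-congˡ)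
  open import Data.Integer using (_+_; _*_)
  open import Algebra.Bundles using (CommutativeSemiring)
  open import Algebra.Solver.Ring.NaturalCoefficients.Default Ser-commutativeSemiring
    using (solve; _:+_; _:=_)
  open CommutativeSemiring Ser-commutativeSemiring
    using (+-cong) renaming (refl to ≋-refl; sym to ≋-sym; trans to ≋-trans)

  sumS-coeff : ∀ n (f : ℕ → Ser) a b c → sumS n f a b c ≡ sumℤ n (λ k → f k a b c)
  sumS-coeff zero    f a b c = refl
  sumS-coeff (suc n) f a b c = cong (_+ f (suc n) a b c) (sumS-coeff n f a b c)

  sumS-cong : ∀ n {f g : ℕ → Ser} → (∀ k → f k ≋ g k) → sumS n f ≋ sumS n g
  sumS-cong zero    e = e zero
  sumS-cong (suc n) e = +-cong (sumS-cong n e) (e (suc n))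

  sumS-cong≤ : ∀ n {f g : ℕ → Ser} → (∀ k → k ≤ n → f k ≋ g k) → sumS n f ≋ sumS n g
  sumS-cong≤ zero    e = e zero z≤n
  sumS-cong≤ (suc n) e = +-cong (sumS-cong≤ n (λ k k≤n → e k (ℕP.m≤n⇒m≤1+n k≤n))) (e (suc n) ℕP.≤-refl)

  sumS-⊕ : ∀ n (f g : ℕ → Ser) → sumS n (λ k → f k ⊕ g k) ≋ sumS n f ⊕ sumS n g
  sumS-⊕ zero    f g = ≋-refl
  sumS-⊕ (suc n) f g = ≋-trans (⊕-congˡ (f (suc n) ⊕ g (suc n)) (sumS-⊕ n f g))
    (solve 4 (λ A B x y → (A :+ B) :+ (x :+ y) := (A :+ x) :+ (B :+ y)) ≋-refl (sumS n f) (sumS n g) (f (suc n)) (g (suc n)))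

  ⊗-sumS : ∀ P n (f : ℕ → Ser) → P ⊗ sumS n f ≋ sumS n (λ k → P ⊗ f k)
  ⊗-sumS P zero    f = ≋-refl
  ⊗-sumS P (suc n) f = ≋-trans (mk≋ (⊗-distribˡ P (sumS n f) (f (suc n)))) (⊕-congˡ (P ⊗ f (suc n)) (⊗-sumS P n f))

  sumS-zero : ∀ n (f : ℕ → Ser) → (∀ k → f k ≋ zeroS) → sumS n f ≋ zeroS
  sumS-zero zero    f e = e zero
  sumS-zero (suc n) f e = ≋-trans (+-cong (sumS-zero n f e) (e (suc n))) (mk≋ (λ a b c → refl))

  delayed : (ℕ → Ser) → ℕ → Ser
  delayed h zero    = zeroS
  delayed h (suc i) = h i

  sumS-delayed : ∀ M (h : ℕ → Ser) → h M ≋ zeroS → sumS M h ≋ sumS M (delayed h)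
  sumS-delayed zero    h e = e
  sumS-delayed (suc M) h e = mk≋ (λ a b c →
    trans (sumS-coeff (suc M) h a b c)
    (trans (cong (_+_ (sumℤ M (λ k → h k a b c))) (get≋ e a b c))
    (trans (ℤP.+-identityʳ (sumℤ M (λ k → h k a b c)))
    (sym (trans (sumS-coeff (suc M) (delayed h) a b c)
         (trans (sumℤ-front M (λ k → delayed h k a b c)) (ℤP.+-identityˡ (sumℤ M (λ k → h k a b c)))))))))

  sumS-advance : ∀ M (h : ℕ → Ser) → h 0 ≋ zeroS → h (suc M) ≋ zeroS → sumS M h ≋ sumS M (h ∘ suc)
  sumS-advance zero    h e₀ e₁ = ≋-trans e₀ (≋-sym e₁)
  sumS-advance (suc M) h e₀ e₁ = mk≋ (λ a b c →
    trans (sumS-coeff (suc M) h a b c)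
    (trans (sumℤ-front M (λ k → h k a b c))
    (trans (cong (_+ sumℤ M (λ k → h (suc k) a b c)) (get≋ e₀ a b c))
    (trans (ℤP.+-identityˡ (sumℤ M (λ k → h (suc k) a b c)))
    (sym (trans (sumS-coeff (suc M) (h ∘ suc) a b c)
         (trans (cong (_+_ (sumℤ M (λ k → h (suc k) a b c))) (get≋ e₁ a b c))
                (ℤP.+-identityʳ (sumℤ M (λ k → h (suc k) a b c))))))))))

  sumS-truncate : ∀ m M (f : ℕ → Ser) → m ≤ M → (∀ k → m < k → k ≤ M → f k ≋ zeroS) → sumS M f ≋ sumS m f
  sumS-truncate m zero    f z≤n e = ≋-refl
  sumS-truncate m (suc M) f m≤M e with ℕP.m≤n⇒m<n∨m≡n m≤M
  ... | inj₂ refl = ≋-refl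
  ... | inj₁ m<M  = ≋-trans (+-cong (sumS-truncate m M f (ℕP.≤-pred m<M) (λ k m<k k≤M → e k m<k (ℕP.m≤n⇒m≤1+n k≤M)))
                                    (e (suc M) m<M ℕP.≤-refl))
                            (mk≋ (λ a b c → ℤP.+-identityʳ _))

  const-⊗-const : ∀ a b p → const a ⊗ (const b ⊗ p) ≋ const (a * b) ⊗ p
  const-⊗-const a b p = mk≋ (λ x y z →
    trans (const-⊗ a (const b ⊗ p) x y z)
    (trans (cong (a *_) (const-⊗ b p x y z))
    (trans (sym (ℤP.*-assoc a b (p x y z))) (sym (const-⊗ (a * b) p x y z)))))

  const-≡ : ∀ {a b} → a ≡ b → ∀ p → const a ⊗ p ≋ const b ⊗ p
  const-≡ refl p = ≋-refl

  const-zero-⊗ : ∀ {c} P → c ≡ 0ℤ → const c ⊗ P ≋ zeroS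
  const-zero-⊗ P refl = mk≋ (λ a b c → const-⊗ 0ℤ P a b c)

module Expansion where

  open Series
  open Derivatives
  open Operator
  open import Algebra.Bundles using (CommutativeSemiring)
  open import Algebra.Solver.Ring.NaturalCoefficients.Default Ser-commutativeSemiring
    using (solve; _:+_; _:*_; _:=_; con)
  open CommutativeSemiring Ser-commutativeSemiring
    using (setoid; +-cong; *-cong) renaming (refl to ≋-refl; sym to ≋-sym; trans to ≋-trans)
  open import Relation.Binary.Reasoning.Setoid setoid

  U V W two : Ser
  U = S ⊕ Y
  V = const (+ 2) ⊗ X ⊗ Y
  W = X ⊕ Y
  two = const (+ 2)

  ∂-U : ∂ U ≋ two
  ∂-U = ≋-trans (mk≋ (∂-⊕ S Y)) (≋-trans (+-cong (mk≋ ∂-S) (mk≋ ∂-Y)) (≋-sym (const-+ (+ 1) (+ 1))))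

  ∂-W : ∂ W ≋ two
  ∂-W = ≋-trans (mk≋ (∂-⊕ X Y)) (≋-trans (+-cong (mk≋ ∂-X) (mk≋ ∂-Y)) (≋-sym (const-+ (+ 1) (+ 1))))

  ∂-V : ∂ V ≋ two ⊗ W
  ∂-V = begin
    ∂ ((two ⊗ X) ⊗ Y)                     ≈⟨ ∂-⊗ (two ⊗ X) Y ⟩
    ∂ (two ⊗ X) ⊗ Y ⊕ (two ⊗ X) ⊗ ∂ Y     ≈⟨ +-cong (⊗-congˡ≋ Y (≋-trans (∂-const-⊗ (+ 2) X) (⊗-congʳ≋ two (mk≋ ∂-X))))
                                                    (⊗-congʳ≋ (two ⊗ X) (mk≋ ∂-Y)) ⟩
    (two ⊗ oneS) ⊗ Y ⊕ (two ⊗ X) ⊗ oneS    ≈⟨ solve 3 (λ C X Y → (C :* con 1) :* Y :+ (C :* X) :* con 1 := C :* (X :+ Y))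
                                                  ≋-refl two X Y ⟩
    two ⊗ W                                ∎

  term : ℕ → ℕ → ℕ → Ser
  term i j k = (U ^S i) ⊗ ((V ^S j) ⊗ (W ^S k))

  -- 𝓛 = U · _ + X Y ∂, and ∂ U = ∂ W = 2, ∂ V = 2 W, so X Y ∂ turns U into V and V into V W (2 X Y = V).
  𝓛-term : ∀ i j k → 𝓛 (term i j k) ≋
    term (suc i) j k ⊕ const (+ i) ⊗ term (i ∸ 1) (suc j) k ⊕ const (+ j) ⊗ term i j (suc k)
      ⊕ const (+ k) ⊗ term i (suc j) (k ∸ 1)
  𝓛-term i j k = ≋-trans (⊕-congʳ (U ⊗ term i j k) (⊗-congʳ≋ (X ⊗ Y) ∂-term)) (collect j)
    where
    ci = const (+ i)
    ck = const (+ k)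
    ∂-Uⁱ : ∂ (U ^S i) ≋ ci ⊗ (U ^S (i ∸ 1) ⊗ two)
    ∂-Uⁱ = ≋-trans (∂-^ U i) (⊗-congʳ≋ ci (⊗-congʳ≋ (U ^S (i ∸ 1)) ∂-U))
    ∂-Wᵏ : ∂ (W ^S k) ≋ ck ⊗ (W ^S (k ∸ 1) ⊗ two)
    ∂-Wᵏ = ≋-trans (∂-^ W k) (⊗-congʳ≋ ck (⊗-congʳ≋ (W ^S (k ∸ 1)) ∂-W))
    ∂-term : ∂ (term i j k) ≋ (ci ⊗ (U ^S (i ∸ 1) ⊗ two)) ⊗ (V ^S j ⊗ W ^S k)
                              ⊕ U ^S i ⊗ (∂ (V ^S j) ⊗ W ^S k ⊕ V ^S j ⊗ (ck ⊗ (W ^S (k ∸ 1) ⊗ two)))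
    ∂-term = ≋-trans (∂-⊗ (U ^S i) (V ^S j ⊗ W ^S k))
      (+-cong (⊗-congˡ≋ (V ^S j ⊗ W ^S k) ∂-Uⁱ)
              (⊗-congʳ≋ (U ^S i) (≋-trans (∂-⊗ (V ^S j) (W ^S k)) (⊕-congʳ (∂ (V ^S j) ⊗ W ^S k) (⊗-congʳ≋ (V ^S j) ∂-Wᵏ)))))
    collect : ∀ j →
      U ⊗ term i j k ⊕ (X ⊗ Y) ⊗ ((ci ⊗ (U ^S (i ∸ 1) ⊗ two)) ⊗ (V ^S j ⊗ W ^S k)
        ⊕ U ^S i ⊗ (∂ (V ^S j) ⊗ W ^S k ⊕ V ^S j ⊗ (ck ⊗ (W ^S (k ∸ 1) ⊗ two))))
      ≋ term (suc i) j k ⊕ ci ⊗ term (i ∸ 1) (suc j) k ⊕ const (+ j) ⊗ term i j (suc k) ⊕ ck ⊗ term i (suc j) (k ∸ 1)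
    collect zero = begin
      _ ≈⟨ ⊕-congʳ (U ⊗ term i 0 k) (⊗-congʳ≋ (X ⊗ Y) (⊕-congʳ ((ci ⊗ (U ^S (i ∸ 1) ⊗ two)) ⊗ (oneS ⊗ W ^S k))
             (⊗-congʳ≋ (U ^S i) (⊕-congˡ (oneS ⊗ (ck ⊗ (W ^S (k ∸ 1) ⊗ two))) (⊗-congˡ≋ (W ^S k) (mk≋ (∂-const (+ 1)))))))) ⟩
      U ⊗ term i 0 k ⊕ (X ⊗ Y) ⊗ ((ci ⊗ (U ^S (i ∸ 1) ⊗ two)) ⊗ (oneS ⊗ W ^S k)
        ⊕ U ^S i ⊗ (zeroS ⊗ W ^S k ⊕ oneS ⊗ (ck ⊗ (W ^S (k ∸ 1) ⊗ two))))
        ≈⟨ solve 10 (λ x y s c ui ui′ wk wk′ Ci Ck →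
              (s :+ y) :* (ui :* (con 1 :* wk)) :+ (x :* y) :* ((Ci :* (ui′ :* c)) :* (con 1 :* wk)
                :+ ui :* (con 0 :* wk :+ con 1 :* (Ck :* (wk′ :* c))))
              := ((s :+ y) :* ui) :* (con 1 :* wk) :+ Ci :* (ui′ :* (((c :* x :* y) :* con 1) :* wk))
                 :+ con 0 :* (ui :* (con 1 :* ((x :+ y) :* wk))) :+ Ck :* (ui :* (((c :* x :* y) :* con 1) :* wk′)))
            ≋-refl X Y S two (U ^S i) (U ^S (i ∸ 1)) (W ^S k) (W ^S (k ∸ 1)) ci ck ⟩
      term (suc i) 0 k ⊕ ci ⊗ term (i ∸ 1) 1 k ⊕ zeroS ⊗ term i 0 (suc k) ⊕ ck ⊗ term i 1 (k ∸ 1)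
        ≈⟨ ⊕-congˡ (ck ⊗ term i 1 (k ∸ 1)) (⊕-congʳ (term (suc i) 0 k ⊕ ci ⊗ term (i ∸ 1) 1 k)
             (⊗-congˡ≋ (term i 0 (suc k)) (≋-sym const-zero))) ⟩
      _ ∎
    collect (suc j) = begin
      _ ≈⟨ ⊕-congʳ (U ⊗ term i (suc j) k) (⊗-congʳ≋ (X ⊗ Y) (⊕-congʳ ((ci ⊗ (U ^S (i ∸ 1) ⊗ two)) ⊗ (V ^S suc j ⊗ W ^S k))
             (⊗-congʳ≋ (U ^S i) (⊕-congˡ (V ^S suc j ⊗ (ck ⊗ (W ^S (k ∸ 1) ⊗ two)))
               (⊗-congˡ≋ (W ^S k) (≋-trans (∂-^ V (suc j)) (⊗-congʳ≋ (const (+ suc j)) (⊗-congʳ≋ (V ^S j) ∂-V)))))))) ⟩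
      _ ≈⟨ solve 12 (λ x y s c ui ui′ vj wk wk′ Ci Cj Ck →
              (s :+ y) :* (ui :* (((c :* x :* y) :* vj) :* wk)) :+ (x :* y) :* ((Ci :* (ui′ :* c)) :* (((c :* x :* y) :* vj) :* wk)
                   :+ ui :* ((Cj :* (vj :* (c :* (x :+ y)))) :* wk :+ ((c :* x :* y) :* vj) :* (Ck :* (wk′ :* c))))
              := ((s :+ y) :* ui) :* (((c :* x :* y) :* vj) :* wk) :+ Ci :* (ui′ :* (((c :* x :* y) :* ((c :* x :* y) :* vj)) :* wk))
                 :+ Cj :* (ui :* (((c :* x :* y) :* vj) :* ((x :+ y) :* wk)))
                 :+ Ck :* (ui :* (((c :* x :* y) :* ((c :* x :* y) :* vj)) :* wk′)))
            ≋-refl X Y S two (U ^S i) (U ^S (i ∸ 1)) (V ^S j) (W ^S k) (W ^S (k ∸ 1)) ci (const (+ suc j)) ck ⟩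
      _ ∎

module Gamma where

  open import Data.Integer using (_+_; _*_; _-_)
  open import Data.Integer.Solver using (module +-*-Solver)

  lastCoeff : ℕ → ℕ → ℕ → ℤ
  lastCoeff n i j = + n - + i - + 2 * + suc j + + 2

  lastCoeff-zero : ∀ i j → lastCoeff (i ℕ.+ 2 ℕ.* j) i j ≡ 0ℤ
  lastCoeff-zero i j =
    trans (cong (λ z → z - + i - + 2 * + suc j + + 2) (trans (ℤP.pos-+ i (2 ℕ.* j)) (cong (_+_ (+ i)) (ℤP.pos-* 2 j))))
          (solve 2 (λ i j → i :+ con (+ 2) :* j :- i :- con (+ 2) :* (con 1ℤ :+ j) :+ con (+ 2) := con 0ℤ) refl (+ i) (+ j))
    where open +-*-Solver

  lastCoeff-layer : ∀ i j k → lastCoeff (i ℕ.+ 2 ℕ.* j ℕ.+ suc k) i j ≡ + suc k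
  lastCoeff-layer i j k =
    trans (cong (λ t → t - + i - + 2 * + suc j + + 2)
            (trans (ℤP.pos-+ (i ℕ.+ 2 ℕ.* j) (suc k))
                   (cong (_+ + suc k) (trans (ℤP.pos-+ i (2 ℕ.* j)) (cong (_+_ (+ i)) (ℤP.pos-* 2 j))))))
          (solve 3 (λ i j k → i :+ con (+ 2) :* j :+ (con 1ℤ :+ k) :- i :- con (+ 2) :* (con 1ℤ :+ j) :+ con (+ 2)
                               := con 1ℤ :+ k) refl (+ i) (+ j) (+ k))
    where open +-*-Solver

  recTerm₁ recTerm₂ recTerm₄ : ℕ → ℕ → ℕ → ℤ
  recTerm₁ n zero    j       = 0ℤ
  recTerm₁ n (suc i) j       = γ n i j
  recTerm₂ n i       zero    = 0ℤ
  recTerm₂ n i       (suc j) = + suc i * γ n (suc i) j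
  recTerm₄ n i       zero    = 0ℤ
  recTerm₄ n i       (suc j) = lastCoeff n i j * γ n i j

  γ-suc : ∀ n i j → γ (suc n) i j ≡ recTerm₁ n i j + recTerm₂ n i j + + j * γ n i j + recTerm₄ n i j
  γ-suc n zero    zero    = refl
  γ-suc n zero    (suc j) = refl
  γ-suc n (suc i) zero    = refl
  γ-suc n (suc i) (suc j) = refl

  *-zero : ∀ k {x} → x ≡ 0ℤ → k * x ≡ 0ℤ
  *-zero k refl = ℤP.*-zeroʳ k

  -- The factor n − i − 2j of the last recurrence term vanishes exactly on the boundary n = i + 2j.
  recTerm₄-vanish : ∀ n i j → (n < i ℕ.+ 2 ℕ.* j → γ n i j ≡ 0ℤ) → n ≤ i ℕ.+ 2 ℕ.* j →
    lastCoeff n i j * γ n i j ≡ 0ℤ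
  recTerm₄-vanish n i j vanish n≤ with ℕP.m≤n⇒m<n∨m≡n n≤
  ... | inj₁ n< = *-zero (lastCoeff n i j) (vanish n<)
  ... | inj₂ refl = cong (_* γ (i ℕ.+ 2 ℕ.* j) i j) (lastCoeff-zero i j)

  γ-vanish : ∀ n i j → n < i ℕ.+ 2 ℕ.* j → γ n i j ≡ 0ℤ
  γ-vanish zero    zero    zero    ()
  γ-vanish zero    zero    (suc j) _ = refl
  γ-vanish zero    (suc i) j       _ = refl
  γ-vanish (suc n) zero    zero    ()
  γ-vanish (suc n) zero    (suc j) n< =
    cong₂ _+_ (cong₂ _+_ (cong (_+_ 0ℤ) (*-zero (+ 1) (γ-vanish n 1 j (s≤s n≤))))
                         (*-zero (+ suc j) (γ-vanish n 0 (suc j) (ℕP.<-trans (ℕP.n<1+n n) n<))))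
              (recTerm₄-vanish n 0 j (γ-vanish n 0 j) n≤)
    where
    n≤ : n ≤ 2 ℕ.* j
    n≤ = ℕP.≤-pred (ℕP.≤-pred (subst (suc (suc n) ≤_) (ℕP.*-suc 2 j) n<))
  γ-vanish (suc n) (suc i) zero    n< =
    cong₂ _+_ (cong₂ _+_ (cong₂ _+_ (γ-vanish n i 0 (ℕP.≤-pred n<)) refl) refl) refl
  γ-vanish (suc n) (suc i) (suc j) n< =
    cong₂ _+_ (cong₂ _+_ (cong₂ _+_ (γ-vanish n i (suc j) (ℕP.≤-pred n<))
                                    (*-zero (+ suc (suc i)) (γ-vanish n (suc (suc i)) j n<₂)))
                         (*-zero (+ suc j) (γ-vanish n (suc i) (suc j) (ℕP.<-trans (ℕP.n<1+n n) n<))))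
              (recTerm₄-vanish n (suc i) j (γ-vanish n (suc i) j) n≤₄)
    where
    open import Data.Nat.Tactic.RingSolver using (solve-∀)
    shift₂ : ∀ i j → suc i ℕ.+ 2 ℕ.* suc j ≡ suc (suc (suc i) ℕ.+ 2 ℕ.* j)
    shift₂ = solve-∀
    shift₄ : ∀ i j → suc i ℕ.+ 2 ℕ.* suc j ≡ suc (suc (suc i ℕ.+ 2 ℕ.* j))
    shift₄ = solve-∀
    n<₂ : n < suc (suc i) ℕ.+ 2 ℕ.* j
    n<₂ = ℕP.≤-pred (subst (suc (suc n) ≤_) (shift₂ i j) n<)
    n≤₄ : n ≤ suc i ℕ.+ 2 ℕ.* j
    n≤₄ = ℕP.≤-pred (ℕP.≤-pred (subst (suc (suc n) ≤_) (shift₄ i j) n<))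

module Box where

  open Sums using (when; when-+)
  open IndexSums
  open Series
  open Operator
  open SeriesSums
  open Expansion
  open Gamma
  open import Data.Integer using (_+_; _*_; _-_)
  open import Algebra.Bundles using (CommutativeSemiring)
  open import Algebra.Solver.Ring.NaturalCoefficients.Default Ser-commutativeSemiring
    using (solve; _:+_; _:*_; _:=_; con)
  open CommutativeSemiring Ser-commutativeSemiring
    using (+-cong) renaming (refl to ≋-refl; sym to ≋-sym; trans to ≋-trans)
  open import Data.Nat.Tactic.RingSolver using (solve-∀)

  boxCoeff : ℕ → ℕ → ℕ → ℕ → ℤ
  boxCoeff n i j k = when (i ℕ.+ 2 ℕ.* j ℕ.+ k ≡ᵇ n) (γ n i j)

  sumS³ : ℕ → (ℕ → ℕ → ℕ → Ser) → Ser
  sumS³ M F = sumS M (λ i → sumS M (λ j → sumS M (F i j)))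

  -- expansion n, spread over the cube [0, M]³ of exponents (i, j, k), where 𝓛's index shifts are easy to match.
  box : ℕ → ℕ → Ser
  box n M = sumS³ M (λ i j k → const (boxCoeff n i j k) ⊗ term i j k)

  sumS³-cong : ∀ M {F G : ℕ → ℕ → ℕ → Ser} → (∀ i j k → F i j k ≋ G i j k) → sumS³ M F ≋ sumS³ M G
  sumS³-cong M e = sumS-cong M (λ i → sumS-cong M (λ j → sumS-cong M (e i j)))

  sumS³-⊕ : ∀ M (F G : ℕ → ℕ → ℕ → Ser) → sumS³ M (λ i j k → F i j k ⊕ G i j k) ≋ sumS³ M F ⊕ sumS³ M G
  sumS³-⊕ M F G =
    ≋-trans (sumS-cong M (λ i → ≋-trans (sumS-cong M (λ j → sumS-⊕ M (F i j) (G i j))) (sumS-⊕ M _ _)))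
            (sumS-⊕ M _ _)

  𝓛-sumS³ : ∀ M F → 𝓛 (sumS³ M F) ≋ sumS³ M (λ i j k → 𝓛 (F i j k))
  𝓛-sumS³ M F = ≋-trans (𝓛-sumS M _) (sumS-cong M (λ i → ≋-trans (𝓛-sumS M _) (sumS-cong M (λ j → 𝓛-sumS M _))))

  when-zero-if : ∀ {P : Set} (d : Dec P) x → (P → x ≡ 0ℤ) → when (does d) x ≡ 0ℤ
  when-zero-if (yes p) x h = h p
  when-zero-if (no _)  x h = refl

  when-*-comm : ∀ {P : Set} (d : Dec P) (x y y′ : ℤ) → (P → y ≡ y′) → when (does d) x * y ≡ when (does d) (y′ * x)
  when-*-comm (yes p) x y y′ h = trans (ℤP.*-comm x y) (cong (_* x) (h p))
  when-*-comm (no _)  x y y′ h = refl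

  boxCoeff-outside : ∀ n i j k → n < i ℕ.+ 2 ℕ.* j ℕ.+ k → boxCoeff n i j k ≡ 0ℤ
  boxCoeff-outside n i j k n< =
    cong (λ b → when b (γ n i j)) (dec-false (i ℕ.+ 2 ℕ.* j ℕ.+ k ≟ n) (λ e → ℕP.<-irrefl (sym e) n<))

  const-⊗-const-zero : ∀ c {d} P → d ≡ 0ℤ → const c ⊗ (const d ⊗ P) ≋ zeroS
  const-⊗-const-zero c P d≡0 =
    ≋-trans (⊗-congʳ≋ (const c) (const-zero-⊗ P d≡0)) (mk≋ (λ a b c′ → trans (const-⊗ c zeroS a b c′) (ℤP.*-zeroʳ c)))

  const-+⁴ : ∀ c₁ c₂ c₃ c₄ P →
    const (c₁ + c₂ + c₃ + c₄) ⊗ P ≋ const c₁ ⊗ P ⊕ const c₂ ⊗ P ⊕ const c₃ ⊗ P ⊕ const c₄ ⊗ P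
  const-+⁴ c₁ c₂ c₃ c₄ P = mk≋ (λ a b c →
    trans (const-⊗ (c₁ + c₂ + c₃ + c₄) P a b c)
    (trans (ℤP.*-distribʳ-+ (P a b c) (c₁ + c₂ + c₃) c₄)
    (cong₂ _+_ (trans (ℤP.*-distribʳ-+ (P a b c) (c₁ + c₂) c₃)
                      (cong₂ _+_ (trans (ℤP.*-distribʳ-+ (P a b c) c₁ c₂)
                                        (sym (cong₂ _+_ (const-⊗ c₁ P a b c) (const-⊗ c₂ P a b c))))
                                 (sym (const-⊗ c₃ P a b c))))
               (sym (const-⊗ c₄ P a b c)))))

  module BoxStep (n M : ℕ) (n<M : suc n ≤ M) where

    lhs₁ lhs₂ lhs₃ lhs₄ rhs₁ rhs₂ rhs₃ rhs₄ : ℕ → ℕ → ℕ → Ser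
    lhs₁ i j k = const (boxCoeff n i j k) ⊗ term (suc i) j k
    lhs₂ i j k = const (boxCoeff n i j k) ⊗ (const (+ i) ⊗ term (i ∸ 1) (suc j) k)
    lhs₃ i j k = const (boxCoeff n i j k) ⊗ (const (+ j) ⊗ term i j (suc k))
    lhs₄ i j k = const (boxCoeff n i j k) ⊗ (const (+ k) ⊗ term i (suc j) (k ∸ 1))

    onLayer : ℕ → ℕ → ℕ → ℤ → ℤ
    onLayer i j k = when (i ℕ.+ 2 ℕ.* j ℕ.+ k ≡ᵇ suc n)

    rhs₁ i j k = const (onLayer i j k (recTerm₁ n i j)) ⊗ term i j k
    rhs₂ i j k = const (onLayer i j k (recTerm₂ n i j)) ⊗ term i j k
    rhs₃ i j k = const (onLayer i j k (+ j * γ n i j)) ⊗ term i j k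
    rhs₄ i j k = const (onLayer i j k (recTerm₄ n i j)) ⊗ term i j k

    𝓛-box-split : 𝓛 (box n M) ≋ sumS³ M lhs₁ ⊕ sumS³ M lhs₂ ⊕ sumS³ M lhs₃ ⊕ sumS³ M lhs₄
    𝓛-box-split =
      ≋-trans (𝓛-sumS³ M _)
      (≋-trans (sumS³-cong M (λ i j k →
         ≋-trans (𝓛-const-⊗ (boxCoeff n i j k) (term i j k))
         (≋-trans (⊗-congʳ≋ (const (boxCoeff n i j k)) (𝓛-term i j k))
           (solve 5 (λ c p q r s → c :* (p :+ q :+ r :+ s) := c :* p :+ c :* q :+ c :* r :+ c :* s)
              ≋-refl (const (boxCoeff n i j k)) (term (suc i) j k) (const (+ i) ⊗ term (i ∸ 1) (suc j) k)
              (const (+ j) ⊗ term i j (suc k)) (const (+ k) ⊗ term i (suc j) (k ∸ 1))))))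
      (≋-trans (sumS³-⊕ M _ lhs₄) (⊕-congˡ (sumS³ M lhs₄)
        (≋-trans (sumS³-⊕ M _ lhs₃) (⊕-congˡ (sumS³ M lhs₃) (sumS³-⊕ M lhs₁ lhs₂))))))

    box-suc-split : box (suc n) M ≋ sumS³ M rhs₁ ⊕ sumS³ M rhs₂ ⊕ sumS³ M rhs₃ ⊕ sumS³ M rhs₄
    box-suc-split =
      ≋-trans (sumS³-cong M (λ i j k → ≋-trans (const-≡ (splitCoeff i j k) (term i j k)) (const-+⁴ _ _ _ _ (term i j k))))
      (≋-trans (sumS³-⊕ M _ rhs₄) (⊕-congˡ (sumS³ M rhs₄)
        (≋-trans (sumS³-⊕ M _ rhs₃) (⊕-congˡ (sumS³ M rhs₃) (sumS³-⊕ M rhs₁ rhs₂)))))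
      where
      splitCoeff : ∀ i j k → boxCoeff (suc n) i j k
        ≡ onLayer i j k (recTerm₁ n i j) + onLayer i j k (recTerm₂ n i j) + onLayer i j k (+ j * γ n i j)
          + onLayer i j k (recTerm₄ n i j)
      splitCoeff i j k =
        let b = i ℕ.+ 2 ℕ.* j ℕ.+ k ≡ᵇ suc n in
        trans (cong (when b) (γ-suc n i j))
        (trans (when-+ b (recTerm₁ n i j + recTerm₂ n i j + + j * γ n i j) (recTerm₄ n i j))
        (cong (_+ when b (recTerm₄ n i j)) (trans (when-+ b (recTerm₁ n i j + recTerm₂ n i j) (+ j * γ n i j))
           (cong (_+ when b (+ j * γ n i j)) (when-+ b (recTerm₁ n i j) (recTerm₂ n i j))))))

    outsideᵢ : ∀ i j k → M ≤ i → n < i ℕ.+ 2 ℕ.* j ℕ.+ k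
    outsideᵢ i j k M≤i =
      ℕP.<-≤-trans n<M (ℕP.≤-trans M≤i (ℕP.≤-trans (ℕP.m≤m+n i (2 ℕ.* j)) (ℕP.m≤m+n (i ℕ.+ 2 ℕ.* j) k)))

    outsideⱼ : ∀ i j k → M ≤ j → n < i ℕ.+ 2 ℕ.* j ℕ.+ k
    outsideⱼ i j k M≤j = ℕP.<-≤-trans n<M (ℕP.≤-trans M≤j (ℕP.≤-trans (ℕP.m≤n*m j 2)
                          (ℕP.≤-trans (ℕP.m≤n+m (2 ℕ.* j) i) (ℕP.m≤m+n (i ℕ.+ 2 ℕ.* j) k))))

    outsideₖ : ∀ i j k → M ≤ k → n < i ℕ.+ 2 ℕ.* j ℕ.+ k
    outsideₖ i j k M≤k = ℕP.<-≤-trans n<M (ℕP.≤-trans M≤k (ℕP.m≤n+m k (i ℕ.+ 2 ℕ.* j)))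

    -- After shifting indices, the ℓ-th sum of 𝓛-box-split is the part of box (suc n) M coming from the
    -- ℓ-th term of γ's recurrence; the terms shifted across the faces of the cube vanish since n < M.
    match₁ : sumS³ M lhs₁ ≋ sumS³ M rhs₁
    match₁ =
      ≋-trans (sumS-delayed M H (sumS-zero M _ (λ j → sumS-zero M _ (λ k →
                 const-zero-⊗ (term (suc M) j k) (boxCoeff-outside n M j k (outsideᵢ M j k ℕP.≤-refl))))))
              (sumS-cong M reindex)
      where
      H : ℕ → Ser
      H i = sumS M (λ j → sumS M (lhs₁ i j))
      reindex : ∀ i → delayed H i ≋ sumS M (λ j → sumS M (rhs₁ i j))
      reindex zero    = ≋-sym (sumS-zero M _ (λ j → sumS-zero M _ (λ k → const-zero-⊗ (term 0 j k) (Sums.when-zero _))))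
      reindex (suc i) = ≋-refl

    match₂ : sumS³ M lhs₂ ≋ sumS³ M rhs₂
    match₂ =
      ≋-trans (sumS-advance M H
                 (sumS-zero M _ (λ j → sumS-zero M _ (λ k → const-⊗-const-zero (boxCoeff n 0 j k) (term 0 (suc j) k) refl)))
                 (sumS-zero M _ (λ j → sumS-zero M _ (λ k → const-zero-⊗ (const (+ suc M) ⊗ term M (suc j) k)
                    (boxCoeff-outside n (suc M) j k (outsideᵢ (suc M) j k (ℕP.n≤1+n M)))))))
              (sumS-cong M reindexᵢ)
      where
      H : ℕ → Ser
      H i = sumS M (λ j → sumS M (lhs₂ i j))
      layer : ∀ i j k → i ℕ.+ 2 ℕ.* suc j ℕ.+ k ≡ suc (suc i ℕ.+ 2 ℕ.* j ℕ.+ k)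
      layer = solve-∀
      reindexᵢ : ∀ i → H (suc i) ≋ sumS M (λ j → sumS M (rhs₂ i j))
      reindexᵢ i =
        ≋-trans (sumS-delayed M H′ (sumS-zero M _ (λ k → const-zero-⊗ (const (+ suc i) ⊗ term i (suc M) k)
                   (boxCoeff-outside n (suc i) M k (outsideⱼ (suc i) M k ℕP.≤-refl)))))
                (sumS-cong M reindexⱼ)
        where
        H′ : ℕ → Ser
        H′ j = sumS M (lhs₂ (suc i) j)
        reindexⱼ : ∀ j → delayed H′ j ≋ sumS M (rhs₂ i j)
        reindexⱼ zero    = ≋-sym (sumS-zero M _ (λ k → const-zero-⊗ (term i 0 k) (Sums.when-zero _)))
        reindexⱼ (suc j) = sumS-cong M (λ k →
          ≋-trans (const-⊗-const (boxCoeff n (suc i) j k) (+ suc i) (term i (suc j) k))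
                  (const-≡ (trans (when-*-comm (suc i ℕ.+ 2 ℕ.* j ℕ.+ k ≟ n) (γ n (suc i) j) (+ suc i) (+ suc i) (λ _ → refl))
                                  (cong (λ x → when (x ≡ᵇ suc n) (+ suc i * γ n (suc i) j)) (sym (layer i j k))))
                           (term i (suc j) k)))

    match₃ : sumS³ M lhs₃ ≋ sumS³ M rhs₃
    match₃ = sumS-cong M (λ i → sumS-cong M (λ j →
      ≋-trans (sumS-delayed M (lhs₃ i j) (const-zero-⊗ (const (+ j) ⊗ term i j (suc M))
                 (boxCoeff-outside n i j M (outsideₖ i j M ℕP.≤-refl))))
              (sumS-cong M (reindex i j))))
      where
      reindex : ∀ i j k → delayed (lhs₃ i j) k ≋ rhs₃ i j k
      reindex i j zero = ≋-sym (const-zero-⊗ (term i j 0)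
        (when-zero-if (i ℕ.+ 2 ℕ.* j ℕ.+ 0 ≟ suc n) _ (λ e →
          *-zero (+ j) (γ-vanish n i j (ℕP.≤-reflexive (trans (sym e) (ℕP.+-identityʳ _)))))))
      reindex i j (suc k) =
        ≋-trans (const-⊗-const (boxCoeff n i j k) (+ j) (term i j (suc k)))
                (const-≡ (trans (when-*-comm (i ℕ.+ 2 ℕ.* j ℕ.+ k ≟ n) (γ n i j) (+ j) (+ j) (λ _ → refl))
                                (cong (λ x → when (x ≡ᵇ suc n) (+ j * γ n i j)) (sym (ℕP.+-suc (i ℕ.+ 2 ℕ.* j) k))))
                         (term i j (suc k)))

    match₄ : sumS³ M lhs₄ ≋ sumS³ M rhs₄
    match₄ = sumS-cong M reindexᵢ
      where
      layer : ∀ i j k → i ℕ.+ 2 ℕ.* suc j ℕ.+ k ≡ suc (i ℕ.+ 2 ℕ.* j ℕ.+ suc k)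
      layer = solve-∀
      reindexᵢ : ∀ i → sumS M (λ j → sumS M (lhs₄ i j)) ≋ sumS M (λ j → sumS M (rhs₄ i j))
      reindexᵢ i =
        ≋-trans (sumS-cong M (λ j → sumS-advance M (lhs₄ i j)
                   (const-⊗-const-zero (boxCoeff n i j 0) (term i (suc j) (0 ∸ 1)) refl)
                   (const-zero-⊗ (const (+ suc M) ⊗ term i (suc j) M)
                      (boxCoeff-outside n i j (suc M) (outsideₖ i j (suc M) (ℕP.n≤1+n M))))))
        (≋-trans (sumS-delayed M H (sumS-zero M _ (λ k → const-zero-⊗ (const (+ suc k) ⊗ term i (suc M) k)
                   (boxCoeff-outside n i M (suc k) (outsideⱼ i M (suc k) ℕP.≤-refl)))))
                 (sumS-cong M reindexⱼ))
        where
        H : ℕ → Ser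
        H j = sumS M (λ k → lhs₄ i j (suc k))
        reindexⱼ : ∀ j → delayed H j ≋ sumS M (rhs₄ i j)
        reindexⱼ zero    = ≋-sym (sumS-zero M _ (λ k → const-zero-⊗ (term i 0 k) (Sums.when-zero _)))
        reindexⱼ (suc j) = sumS-cong M (λ k →
          ≋-trans (const-⊗-const (boxCoeff n i j (suc k)) (+ suc k) (term i (suc j) k))
                  (const-≡ (trans (when-*-comm (i ℕ.+ 2 ℕ.* j ℕ.+ suc k ≟ n) (γ n i j) (+ suc k) (lastCoeff n i j)
                                                   (λ e → subst (λ m → + suc k ≡ lastCoeff m i j) e (sym (lastCoeff-layer i j k))))
                                  (cong (λ x → when (x ≡ᵇ suc n) (lastCoeff n i j * γ n i j)) (sym (layer i j k))))
                           (term i (suc j) k)))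

    𝓛-box : 𝓛 (box n M) ≋ box (suc n) M
    𝓛-box = ≋-trans 𝓛-box-split (≋-trans (+-cong (+-cong (+-cong match₁ match₂) match₃) match₄) (≋-sym box-suc-split))

  j≤⌊m/2⌋⇒2j≤m : ∀ m j → j ≤ ⌊ m /2⌋ → 2 ℕ.* j ≤ m
  j≤⌊m/2⌋⇒2j≤m zero          zero    _         = z≤n
  j≤⌊m/2⌋⇒2j≤m (suc zero)    zero    _         = z≤n
  j≤⌊m/2⌋⇒2j≤m (suc (suc m)) zero    _         = z≤n
  j≤⌊m/2⌋⇒2j≤m (suc (suc m)) (suc j) (s≤s j≤) =
    ℕP.≤-trans (ℕP.≤-reflexive (ℕP.*-suc 2 j)) (s≤s (s≤s (j≤⌊m/2⌋⇒2j≤m m j j≤)))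

  ⌊m/2⌋<j⇒m<2j : ∀ m j → ⌊ m /2⌋ < j → m < 2 ℕ.* j
  ⌊m/2⌋<j⇒m<2j zero          (suc j) _         = s≤s z≤n
  ⌊m/2⌋<j⇒m<2j (suc zero)    (suc j) _         = ℕP.≤-trans (s≤s (s≤s z≤n)) (ℕP.≤-reflexive (sym (ℕP.*-suc 2 j)))
  ⌊m/2⌋<j⇒m<2j (suc (suc m)) (suc j) (s≤s <j) =
    ℕP.≤-trans (s≤s (s≤s (⌊m/2⌋<j⇒m<2j m j <j))) (ℕP.≤-reflexive (sym (ℕP.*-suc 2 j)))

  sumℤ-layer : ∀ M x n (g : ℕ → ℤ) → n ≤ M →
    sumℤ M (λ k → when (x ℕ.+ k ≡ᵇ n) (g k)) ≡ when (does (x ≤? n)) (g (n ∸ x))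
  sumℤ-layer M x n g n≤M = byCases (x ≤? n)
    where
    byCases : (d : Dec (x ≤ n)) → sumℤ M (λ k → when (x ℕ.+ k ≡ᵇ n) (g k)) ≡ when (does d) (g (n ∸ x))
    byCases (yes x≤n) =
      trans (sumℤ-cong M (λ k → cong (λ b → when b (g k)) (onLayer k (x ℕ.+ k ≟ n))))
      (trans (sumℤ-δ M (n ∸ x) g)
             (cong (λ b → when b (g (n ∸ x))) (dec-true (n ∸ x <? suc M) (s≤s (ℕP.≤-trans (ℕP.m∸n≤m n x) n≤M)))))
      where
      onLayer : ∀ k (d : Dec (x ℕ.+ k ≡ n)) → does d ≡ (n ∸ x ≡ᵇ k)
      onLayer k (yes e) = sym (dec-true (n ∸ x ≟ k) (trans (cong (_∸ x) (sym e)) (ℕP.m+n∸m≡n x k)))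
      onLayer k (no ne) = sym (dec-false (n ∸ x ≟ k) (λ e → ne (trans (cong (x ℕ.+_) (sym e)) (ℕP.m+[n∸m]≡n x≤n))))
    byCases (no x≰n) =
      trans (sumℤ-cong M (λ k → cong (λ b → when b (g k))
              (dec-false (x ℕ.+ k ≟ n) (λ e → x≰n (ℕP.≤-trans (ℕP.m≤m+n x k) (ℕP.≤-reflexive e))))))
            (sumℤ-zero M)

  layerTerm : ℕ → ℕ → ℕ → Ser
  layerTerm n i j = const (when (does (i ℕ.+ 2 ℕ.* j ≤? n)) (γ n i j)) ⊗ term i j (n ∸ (i ℕ.+ 2 ℕ.* j))

  sumS-layer : ∀ n M i j → n ≤ M → sumS M (λ k → const (boxCoeff n i j k) ⊗ term i j k) ≋ layerTerm n i j
  sumS-layer n M i j n≤M = mk≋ (λ a b c →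
    trans (sumS-coeff M _ a b c)
    (trans (sumℤ-cong M (λ k → trans (const-⊗ (boxCoeff n i j k) (term i j k) a b c) (Sums.when-* _ (γ n i j) (term i j k a b c))))
    (trans (sumℤ-layer M (i ℕ.+ 2 ℕ.* j) n (λ k → γ n i j * term i j k a b c) n≤M)
    (trans (sym (Sums.when-* _ (γ n i j) _)) (sym (const-⊗ _ (term i j (n ∸ (i ℕ.+ 2 ℕ.* j))) a b c))))))

  layerTerm-outside : ∀ n i j → n < i ℕ.+ 2 ℕ.* j → layerTerm n i j ≋ zeroS
  layerTerm-outside n i j n< = const-zero-⊗ (term i j (n ∸ (i ℕ.+ 2 ℕ.* j)))
    (cong (λ b → when b (γ n i j)) (dec-false (i ℕ.+ 2 ℕ.* j ≤? n) (ℕP.<⇒≱ n<)))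

  expansion : ℕ → Ser
  expansion n = sumS n (λ i → (U ^S i) ⊗ sumS ⌊ (n ∸ i) /2⌋ (λ j → const (γ n i j) ⊗ (V ^S j) ⊗ (W ^S (n ∸ i ∸ 2 ℕ.* j))))

  expansion≋layers : ∀ n → expansion n ≋ sumS n (λ i → sumS ⌊ (n ∸ i) /2⌋ (layerTerm n i))
  expansion≋layers n = sumS-cong≤ n (λ i i≤n →
    ≋-trans (⊗-sumS (U ^S i) ⌊ (n ∸ i) /2⌋ _)
    (sumS-cong≤ ⌊ (n ∸ i) /2⌋ (λ j j≤ →
      ≋-trans (solve 5 (λ u c v w ui → ui :* ((c :* v) :* w) := c :* (ui :* (v :* w)))
                 ≋-refl U (const (γ n i j)) (V ^S j) (W ^S (n ∸ i ∸ 2 ℕ.* j)) (U ^S i))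
      (≋-sym (≋-trans (const-≡ (cong (λ b → when b (γ n i j)) (dec-true (i ℕ.+ 2 ℕ.* j ≤? n) (inside i≤n j≤)))
                                (term i j (n ∸ (i ℕ.+ 2 ℕ.* j))))
                      (⊗-congʳ≋ (const (γ n i j)) (mk≋ (λ a b c → cong (λ t → term i j t a b c) (sym (ℕP.∸-+-assoc n i (2 ℕ.* j)))))))))))
    where
    inside : ∀ {i j} → i ≤ n → j ≤ ⌊ (n ∸ i) /2⌋ → i ℕ.+ 2 ℕ.* j ≤ n
    inside {i} {j} i≤n j≤ =
      ℕP.≤-trans (ℕP.+-monoʳ-≤ i (j≤⌊m/2⌋⇒2j≤m (n ∸ i) j j≤)) (ℕP.≤-reflexive (ℕP.m+[n∸m]≡n i≤n))

  expansion≋box : ∀ n M → n ≤ M → expansion n ≋ box n M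
  expansion≋box n M n≤M = ≋-trans (expansion≋layers n) (≋-sym (≋-trans layers truncate))
    where
    layers : box n M ≋ sumS M (λ i → sumS M (layerTerm n i))
    layers = sumS-cong M (λ i → sumS-cong M (λ j → sumS-layer n M i j n≤M))
    truncate : sumS M (λ i → sumS M (layerTerm n i)) ≋ sumS n (λ i → sumS ⌊ (n ∸ i) /2⌋ (layerTerm n i))
    truncate =
      ≋-trans (sumS-truncate n M _ n≤M (λ i n<i _ → sumS-zero M _ (λ j → layerTerm-outside n i j (ℕP.<-≤-trans n<i (ℕP.m≤m+n i (2 ℕ.* j))))))
      (sumS-cong≤ n (λ i i≤n → sumS-truncate ⌊ (n ∸ i) /2⌋ M _ (ℕP.≤-trans (ℕP.⌊n/2⌋≤n (n ∸ i)) (ℕP.≤-trans (ℕP.m∸n≤m n i) n≤M))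
        (λ j ⌊⌋<j _ → layerTerm-outside n i j
           (ℕP.≤-trans (ℕP.≤-reflexive (trans (cong suc (sym (ℕP.m+[n∸m]≡n i≤n))) (sym (ℕP.+-suc i (n ∸ i)))))
                       (ℕP.+-monoʳ-≤ i (⌊m/2⌋<j⇒m<2j (n ∸ i) j ⌊⌋<j))))))

  Apoly-one : Apoly 1 ≋ expansion 0
  Apoly-one = mk≋ (λ a b c → trans (pointwise a b c) (sym (get≋ (solve 0 (con 1 :* ((con 1 :* con 1) :* con 1) := con 1) ≋-refl) a b c)))
    where
    pointwise : Apoly 1 ≈ oneS
    pointwise zero    zero    zero    = refl
    pointwise zero    zero    (suc c) = refl
    pointwise zero    (suc b) c       = refl
    pointwise (suc a) b       c       = refl

  𝓛-expansion : ∀ n → 𝓛 (expansion n) ≋ expansion (suc n)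
  𝓛-expansion n =
    ≋-trans (𝓛-cong (expansion≋box n (suc n) (ℕP.n≤1+n n)))
    (≋-trans (BoxStep.𝓛-box n (suc n) ℕP.≤-refl)
             (≋-sym (expansion≋box (suc n) (suc n) ℕP.≤-refl)))

  Apoly≋expansion : ∀ n → Apoly (suc n) ≋ expansion n
  Apoly≋expansion zero    = Apoly-one
  Apoly≋expansion (suc n) =
    ≋-trans (mk≋ (Recurrence.recurrence (suc n) (s≤s z≤n)))
    (≋-trans (𝓛-cong (Apoly≋expansion n)) (𝓛-expansion n))

module VertexSums where

  open Sums using (bit; bit-yes; bit-no)
  open import Data.List using (applyUpTo)
  open import Data.Nat using (_+_)
  open import Algebra.Properties.CommutativeSemigroup ℕP.+-commutativeSemigroup using (interchange; xy∙z≈zy∙x)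

  sumVertices : List (ℕ × ℕ) → (ℕ → ℕ → ℕ) → ℕ
  sumVertices []            f = 0
  sumVertices ((v , q) ∷ L) f = f v q + sumVertices L f

  allVertices : List (ℕ × ℕ) → (ℕ → ℕ → Bool) → Bool
  allVertices []            f = true
  allVertices ((v , q) ∷ L) f = f v q ∧ allVertices L f

  sumVertices-cong : ∀ L {f g : ℕ → ℕ → ℕ} → (∀ v q → f v q ≡ g v q) → sumVertices L f ≡ sumVertices L g
  sumVertices-cong []            e = refl
  sumVertices-cong ((v , q) ∷ L) e = cong₂ _+_ (e v q) (sumVertices-cong L e)

  allVertices-cong : ∀ L {f g : ℕ → ℕ → Bool} → (∀ v q → f v q ≡ g v q) → allVertices L f ≡ allVertices L g
  allVertices-cong []            e = refl
  allVertices-cong ((v , q) ∷ L) e = cong₂ _∧_ (e v q) (allVertices-cong L e)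

  sumVertices-+ : ∀ L (f g : ℕ → ℕ → ℕ) →
    sumVertices L (λ v q → f v q + g v q) ≡ sumVertices L f + sumVertices L g
  sumVertices-+ []            f g = refl
  sumVertices-+ ((v , q) ∷ L) f g = trans (cong (_+_ (f v q + g v q)) (sumVertices-+ L f g)) (interchange (f v q) (g v q) _ _)

  sumVertices-++ : ∀ L L′ f → sumVertices (L ++ L′) f ≡ sumVertices L f + sumVertices L′ f
  sumVertices-++ []            L′ f = refl
  sumVertices-++ ((v , q) ∷ L) L′ f = trans (cong (_+_ (f v q)) (sumVertices-++ L L′ f)) (sym (ℕP.+-assoc (f v q) _ _))

  allVertices-++ : ∀ L L′ f → allVertices (L ++ L′) f ≡ allVertices L f ∧ allVertices L′ f
  allVertices-++ []            L′ f = refl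
  allVertices-++ ((v , q) ∷ L) L′ f = trans (cong (f v q ∧_) (allVertices-++ L L′ f)) (sym (∧-assoc (f v q) _ _))

  labelled-snoc : ∀ k w a → labelled k (w ++ [ a ]) ≡ labelled k w ++ [ (k + length w , a) ]
  labelled-snoc k []      a = cong (λ z → (z , a) ∷ []) (sym (ℕP.+-identityʳ k))
  labelled-snoc k (q ∷ w) a =
    cong ((k , q) ∷_) (trans (labelled-snoc (suc k) w a)
                             (cong (λ z → labelled (suc k) w ++ [ (z , a) ]) (sym (ℕP.+-suc k (length w)))))

  applyUpTo-cong : ∀ m {f g : ℕ → ℕ} → (∀ i → f i ≡ g i) → applyUpTo f m ≡ applyUpTo g m
  applyUpTo-cong zero    e = refl
  applyUpTo-cong (suc m) e = cong₂ _∷_ (e 0) (applyUpTo-cong m (e ∘ suc))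

  labels-labelled : ∀ k w → map proj₁ (labelled k w) ≡ applyUpTo (_+_ k) (length w)
  labels-labelled k []      = refl
  labels-labelled k (q ∷ w) =
    cong₂ _∷_ (sym (ℕP.+-identityʳ k))
              (trans (labels-labelled (suc k) w) (applyUpTo-cong (length w) (λ i → sym (ℕP.+-suc k i))))

  labelled-≥ : ∀ k w x → x ∈ labelled k w → k ≤ proj₁ x
  labelled-≥ k (q ∷ w) x (here refl) = ℕP.≤-refl
  labelled-≥ k (q ∷ w) x (there p)   = ℕP.<⇒≤ (labelled-≥ (suc k) w x p)

  labelled-< : ∀ k w x → x ∈ labelled k w → proj₁ x < k + length w
  labelled-< k (q ∷ w) x (here refl) = ℕP.m<m+n k (s≤s z≤n)
  labelled-< k (q ∷ w) x (there p)   =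
    ℕP.<-≤-trans (labelled-< (suc k) w x p) (ℕP.≤-reflexive (sym (ℕP.+-suc k (length w))))

  bumpedAt : (ℕ → ℕ) → ℕ → ℕ → ℕ
  bumpedAt ch a v = bit (a ≟ v) + ch v

  module _ (ch : ℕ → ℕ) where

    sumVertices-unbumped : ∀ (f : ℕ → ℕ → ℕ) a k w → a < k →
      sumVertices (labelled k w) (λ v q → f (bumpedAt ch a v) q) ≡ sumVertices (labelled k w) (λ v q → f (ch v) q)
    sumVertices-unbumped f a k []      a<k = refl
    sumVertices-unbumped f a k (q ∷ w) a<k =
      cong₂ _+_ (cong (λ z → f (z + ch k) q) (bit-no (a ≟ k) (λ a≡k → ℕP.<-irrefl a≡k a<k)))
                (sumVertices-unbumped f a (suc k) w (ℕP.m<n⇒m<1+n a<k))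

    allVertices-unbumped : ∀ (f : ℕ → ℕ → Bool) a k w → a < k →
      allVertices (labelled k w) (λ v q → f (bumpedAt ch a v) q) ≡ allVertices (labelled k w) (λ v q → f (ch v) q)
    allVertices-unbumped f a k []      a<k = refl
    allVertices-unbumped f a k (q ∷ w) a<k =
      cong₂ _∧_ (cong (λ z → f (z + ch k) q) (bit-no (a ≟ k) (λ a≡k → ℕP.<-irrefl a≡k a<k)))
                (allVertices-unbumped f a (suc k) w (ℕP.m<n⇒m<1+n a<k))

    sumVertices-bumped : ∀ (f : ℕ → ℕ → ℕ) k w x → x ∈ labelled k w →
      sumVertices (labelled k w) (λ v q → f (bumpedAt ch (proj₁ x) v) q) + f (ch (proj₁ x)) (proj₂ x)
      ≡ sumVertices (labelled k w) (λ v q → f (ch v) q) + f (suc (ch (proj₁ x))) (proj₂ x)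
    sumVertices-bumped f k (q ∷ w) .(k , q) (here refl)
      rewrite bit-yes (k ≟ k) refl | sumVertices-unbumped f k (suc k) w ℕP.≤-refl =
      xy∙z≈zy∙x (f (suc (ch k)) q) (sumVertices (labelled (suc k) w) (λ v q′ → f (ch v) q′)) (f (ch k) q)
    sumVertices-bumped f k (q ∷ w) x (there x∈)
      rewrite bit-no (proj₁ x ≟ k) (λ x≡k → ℕP.<-irrefl (sym x≡k) (labelled-≥ (suc k) w x x∈)) =
      trans (ℕP.+-assoc (f (ch k) q) _ _)
      (trans (cong (_+_ (f (ch k) q)) (sumVertices-bumped f (suc k) w x x∈)) (sym (ℕP.+-assoc (f (ch k) q) _ _)))

    allVertices-bumped : ∀ (f : ℕ → ℕ → Bool) → (∀ c q → f (suc c) q ≡ true → f c q ≡ true) →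
      ∀ k w x → x ∈ labelled k w →
      allVertices (labelled k w) (λ v q → f (bumpedAt ch (proj₁ x) v) q)
      ≡ allVertices (labelled k w) (λ v q → f (ch v) q) ∧ f (suc (ch (proj₁ x))) (proj₂ x)
    allVertices-bumped f antitone k (q ∷ w) .(k , q) (here refl)
      rewrite bit-yes (k ≟ k) refl | allVertices-unbumped f k (suc k) w ℕP.≤-refl =
      weaken (f (suc (ch k)) q) (f (ch k) q) (antitone (ch k) q) _
      where
      weaken : ∀ x y → (x ≡ true → y ≡ true) → ∀ z → x ∧ z ≡ (y ∧ z) ∧ x
      weaken false y x⇒y z = sym (∧-zeroʳ (y ∧ z))
      weaken true  y x⇒y z rewrite x⇒y refl = sym (∧-identityʳ z)
    allVertices-bumped f antitone k (q ∷ w) x (there x∈)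
      rewrite bit-no (proj₁ x ≟ k) (λ x≡k → ℕP.<-irrefl (sym x≡k) (labelled-≥ (suc k) w x x∈)) =
      trans (cong (f (ch k) q ∧_) (allVertices-bumped f antitone (suc k) w x x∈)) (sym (∧-assoc (f (ch k) q) _ _))

module PlantedTrees where

  open Sums
  open VertexSums
  open Statistics using (Weight; length-filter-∷)
  open import Data.Integer using (_+_; _*_)
  open import Data.Integer.Tactic.RingSolver using (solve-∀)
  open import Relation.Nullary.Decidable using (_×-dec_; _→-dec_)
  open import Algebra.Properties.CommutativeSemigroup ℕP.+-commutativeSemigroup using (x∙yz≈y∙xz)

  -- A vertex is described by its number c of children and its parent q (q = 0 for a child of the root).
  isLeaf : ℕ → ℕ
  isLeaf zero    = 1
  isLeaf (suc _) = 0

  isRootLeaf isInnerLeaf isUnary : ℕ → ℕ → ℕ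
  isRootLeaf zero zero = 1
  isRootLeaf _    _    = 0
  isInnerLeaf zero (suc _) = 1
  isInnerLeaf _    _       = 0
  isUnary (suc zero) (suc _) = 1
  isUnary _          _       = 0

  admissible : ℕ → ℕ → Bool
  admissible zero                q       = true
  admissible (suc zero)          q       = true
  admissible (suc (suc zero))    zero    = false
  admissible (suc (suc zero))    (suc q) = true
  admissible (suc (suc (suc c))) q       = false

  admissible-antitone : ∀ c q → admissible (suc c) q ≡ true → admissible c q ≡ true
  admissible-antitone zero             q       _  = refl
  admissible-antitone (suc zero)       q       _  = refl
  admissible-antitone (suc (suc zero)) zero    ()
  admissible-antitone (suc (suc zero)) (suc q) ()
  admissible-antitone (suc (suc (suc c))) q    ()

  #leaves #rootLeaves #innerLeaves #unary : List ℕ → ℕ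
  #leaves w      = sumVertices (vertices w) (λ v q → isLeaf (children w v))
  #rootLeaves w  = sumVertices (vertices w) (λ v q → isRootLeaf (children w v) q)
  #innerLeaves w = sumVertices (vertices w) (λ v q → isInnerLeaf (children w v) q)
  #unary w       = sumVertices (vertices w) (λ v q → isUnary (children w v) q)

  is012 isIncreasing : List ℕ → Bool
  is012 w        = allVertices (vertices w) (λ v q → admissible (children w v) q)
  isIncreasing w = allVertices (vertices w) (λ v q → does (q <? v))

  length-filter≡sumVertices : ∀ L {P : ℕ × ℕ → Set} (P? : Decidable P) →
    length (filter P? L) ≡ sumVertices L (λ v q → bit (P? (v , q)))
  length-filter≡sumVertices []            P? = refl
  length-filter≡sumVertices ((v , q) ∷ L) P? =
    trans (length-filter-∷ P? (v , q) L) (cong (bit (P? (v , q)) ℕ.+_) (length-filter≡sumVertices L P?))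

  does-all≡allVertices : ∀ L {P : ℕ × ℕ → Set} (P? : Decidable P) →
    does (All.all? P? L) ≡ allVertices L (λ v q → does (P? (v , q)))
  does-all≡allVertices []            P? = refl
  does-all≡allVertices ((v , q) ∷ L) P? = cong (does (P? (v , q)) ∧_) (does-all≡allVertices L P?)

  leaves≡#leaves : ∀ w → leaves w ≡ #leaves w
  leaves≡#leaves w =
    trans (length-filter≡sumVertices (vertices w) _) (sumVertices-cong (vertices w) (λ v q → pointwise (children w v)))
    where
    pointwise : ∀ c → bit (c ≟ 0) ≡ isLeaf c
    pointwise zero    = refl
    pointwise (suc c) = refl

  rootLeaves≡#rootLeaves : ∀ w → rootLeaves w ≡ #rootLeaves w
  rootLeaves≡#rootLeaves w =
    trans (length-filter≡sumVertices (vertices w) _) (sumVertices-cong (vertices w) (λ v q → pointwise (children w v) q))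
    where
    pointwise : ∀ c q → bit ((c ≟ 0) ×-dec (q ≟ 0)) ≡ isRootLeaf c q
    pointwise zero    zero    = refl
    pointwise zero    (suc q) = refl
    pointwise (suc c) zero    = refl
    pointwise (suc c) (suc q) = refl

  planted?≡ : ∀ w → does (planted? w) ≡ isIncreasing w ∧ is012 w
  planted?≡ w =
    cong₂ _∧_ (does-all≡allVertices (vertices w) _)
              (trans (does-all≡allVertices (vertices w) _) (allVertices-cong (vertices w) (λ v q → pointwise (children w v) q)))
    where
    pointwise : ∀ c q → does ((c ≤? 2) ×-dec ((q ≟ 0) →-dec (c ≤? 1))) ≡ admissible c q
    pointwise zero                zero    = refl
    pointwise zero                (suc q) = refl
    pointwise (suc zero)          zero    = refl
    pointwise (suc zero)          (suc q) = refl
    pointwise (suc (suc zero))    zero    = refl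
    pointwise (suc (suc zero))    (suc q) = refl
    pointwise (suc (suc (suc c))) zero    = refl
    pointwise (suc (suc (suc c))) (suc q) = refl

  #leaves-split : ∀ w → #leaves w ≡ #rootLeaves w ℕ.+ #innerLeaves w
  #leaves-split w =
    trans (sumVertices-cong (vertices w) (λ v q → pointwise (children w v) q))
          (sumVertices-+ (vertices w) (λ v q → isRootLeaf (children w v) q) (λ v q → isInnerLeaf (children w v) q))
    where
    pointwise : ∀ c q → isLeaf c ≡ isRootLeaf c q ℕ.+ isInnerLeaf c q
    pointwise zero    zero    = refl
    pointwise zero    (suc q) = refl
    pointwise (suc c) zero    = refl
    pointwise (suc c) (suc q) = refl

  children-snoc : ∀ w a u → children (w ++ [ a ]) u ≡ bumpedAt (children w) a u
  children-snoc []      a u = length-filter-∷ (_≟ u) a []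
  children-snoc (q ∷ w) a u =
    trans (length-filter-∷ (_≟ u) q (w ++ [ a ]))
    (trans (cong (bit (q ≟ u) ℕ.+_) (children-snoc w a u))
    (trans (x∙yz≈y∙xz (bit (q ≟ u)) (bit (a ≟ u)) (children w u))
           (cong (bit (a ≟ u) ℕ.+_) (sym (length-filter-∷ (_≟ u) q w)))))

  children-absent : ∀ w u → All (_< u) w → children w u ≡ 0
  children-absent []      u []           = refl
  children-absent (q ∷ w) u (q<u ∷ w<u) =
    trans (length-filter-∷ (_≟ u) q w) (cong₂ ℕ._+_ (bit-no (q ≟ u) (λ q≡u → ℕP.<-irrefl q≡u q<u)) (children-absent w u w<u))

  -- The new vertex n+1 is hung below the root (a new root leaf), below a root leaf, below an inner leaf,
  -- or below a non-root vertex with one child; all other choices violate the 0-1-2 condition.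
  attach : Weight → Weight
  attach Ψ l r e =
    Ψ (suc l) (suc r) e + + r * Ψ l (r ∸ 1) e + + (l ∸ r) * Ψ l r (suc e) + + e * Ψ (suc l) r (e ∸ 1)

  attachAt : Weight → ℕ → ℕ → ℕ → ℕ → ℕ → ℤ
  attachAt Ψ l r e zero       zero    = Ψ l (r ∸ 1) e
  attachAt Ψ l r e zero       (suc q) = Ψ l r (suc e)
  attachAt Ψ l r e (suc zero) (suc q) = Ψ (suc l) r (e ∸ 1)
  attachAt Ψ l r e _          _       = 0ℤ

  private
    #rl #il #un : List (ℕ × ℕ) → (ℕ → ℕ) → ℤ
    #rl L ch = + sumVertices L (λ v q → isRootLeaf (ch v) q)
    #il L ch = + sumVertices L (λ v q → isInnerLeaf (ch v) q)
    #un L ch = + sumVertices L (λ v q → isUnary (ch v) q)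

    gains : ∀ {x y} → x ℕ.+ 1 ≡ y ℕ.+ 0 → y ≡ suc x
    gains {x} {y} e = trans (sym (ℕP.+-identityʳ y)) (trans (sym e) (ℕP.+-comm x 1))

    keeps : ∀ {x y} → x ℕ.+ 0 ≡ y ℕ.+ 0 → y ≡ x
    keeps e = sym (ℕP.+-cancelʳ-≡ 0 _ _ e)

    loses : ∀ {x y} → x ℕ.+ 0 ≡ y ℕ.+ 1 → x ≡ suc y
    loses e = gains (sym e)

  -- lA, rA, eA are the statistics of the old vertices after the new vertex is hung below a vertex
  -- with c children and parent q.
  attachAt-correct : ∀ (Ψ : Weight) ok l r e lA rA eA c q →
    lA ℕ.+ isLeaf c ≡ l ℕ.+ isLeaf (suc c) → rA ℕ.+ isRootLeaf c q ≡ r ℕ.+ isRootLeaf (suc c) q →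
    eA ℕ.+ isUnary c q ≡ e ℕ.+ isUnary (suc c) q →
    when (ok ∧ admissible (suc c) q) (Ψ (suc lA) rA eA) ≡ when ok (attachAt Ψ l r e c q)
  attachAt-correct Ψ ok l r e lA rA eA zero zero el er ee
    rewrite gains el | gains er | keeps ee = cong (λ b → when b (Ψ (suc lA) rA eA)) (∧-identityʳ ok)
  attachAt-correct Ψ ok l r e lA rA eA zero (suc q) el er ee
    rewrite gains el | keeps er | loses ee = cong (λ b → when b (Ψ (suc lA) rA (suc e))) (∧-identityʳ ok)
  attachAt-correct Ψ ok l r e lA rA eA (suc zero) zero el er ee
    rewrite ∧-zeroʳ ok = sym (when-zero ok)
  attachAt-correct Ψ ok l r e lA rA eA (suc zero) (suc q) el er ee
    rewrite keeps el | keeps er | gains ee = cong (λ b → when b (Ψ (suc lA) rA eA)) (∧-identityʳ ok)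
  attachAt-correct Ψ ok l r e lA rA eA (suc (suc c)) zero el er ee
    rewrite ∧-zeroʳ ok = sym (when-zero ok)
  attachAt-correct Ψ ok l r e lA rA eA (suc (suc c)) (suc q) el er ee
    rewrite ∧-zeroʳ ok = sym (when-zero ok)

  private
    countsˡ : ∀ (A B C x y z : ℤ) → A + (x * A + y * B + z * C) ≡ (1ℤ + x) * A + y * B + z * C
    countsˡ = solve-∀
    countsᵐ : ∀ (A B C x y z : ℤ) → B + (x * A + y * B + z * C) ≡ x * A + (1ℤ + y) * B + z * C
    countsᵐ = solve-∀
    countsʳ : ∀ (A B C x y z : ℤ) → C + (x * A + y * B + z * C) ≡ x * A + y * B + (1ℤ + z) * C
    countsʳ = solve-∀

  Σl-attachAt : ∀ L (ch : ℕ → ℕ) Ψ l r e →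
    Σl L (λ x → attachAt Ψ l r e (ch (proj₁ x)) (proj₂ x))
    ≡ + sumVertices L (λ v q → isRootLeaf (ch v) q) * Ψ l (r ∸ 1) e
      + + sumVertices L (λ v q → isInnerLeaf (ch v) q) * Ψ l r (suc e)
      + + sumVertices L (λ v q → isUnary (ch v) q) * Ψ (suc l) r (e ∸ 1)
  Σl-attachAt [] ch Ψ l r e = refl
  Σl-attachAt ((v , q) ∷ L) ch Ψ l r e with ch v | q | Σl-attachAt L ch Ψ l r e
  ... | zero        | zero  | ih = trans (cong (_+_ (Ψ l (r ∸ 1) e)) ih)
    (countsˡ (Ψ l (r ∸ 1) e) (Ψ l r (suc e)) (Ψ (suc l) r (e ∸ 1)) (#rl L ch) (#il L ch) (#un L ch))
  ... | zero        | suc _ | ih = trans (cong (_+_ (Ψ l r (suc e))) ih)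
    (countsᵐ (Ψ l (r ∸ 1) e) (Ψ l r (suc e)) (Ψ (suc l) r (e ∸ 1)) (#rl L ch) (#il L ch) (#un L ch))
  ... | suc zero    | zero  | ih = trans (ℤP.+-identityˡ _) ih
  ... | suc zero    | suc _ | ih = trans (cong (_+_ (Ψ (suc l) r (e ∸ 1))) ih)
    (countsʳ (Ψ l (r ∸ 1) e) (Ψ l r (suc e)) (Ψ (suc l) r (e ∸ 1)) (#rl L ch) (#il L ch) (#un L ch))
  ... | suc (suc _) | zero  | ih = trans (ℤP.+-identityˡ _) ih
  ... | suc (suc _) | suc _ | ih = trans (ℤP.+-identityˡ _) ih

  weight : Weight → List ℕ → ℤ
  weight Ψ w = when (is012 w) (Ψ (#leaves w) (#rootLeaves w) (#unary w))

  module Attaching (w : List ℕ) (Ψ : Weight) (bounded : All (_≤ length w) w) where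

    private
      n = length w
      L = vertices w
      ch = children w
      l = #leaves w
      r = #rootLeaves w
      e = #unary w

    newVertex-childless : ∀ a → a ≤ n → children (w ++ [ a ]) (suc n) ≡ 0
    newVertex-childless a a≤n =
      trans (children-snoc w a (suc n))
            (cong₂ ℕ._+_ (bit-no (a ≟ suc n) (λ a≡ → ℕP.1+n≰n (subst (_≤ n) a≡ a≤n)))
                         (children-absent w (suc n) (All.map s≤s bounded)))

    sumVertices-snoc : ∀ a → a ≤ n → ∀ (f : ℕ → ℕ → ℕ) →
      sumVertices (vertices (w ++ [ a ])) (λ v q → f (children (w ++ [ a ]) v) q)
      ≡ sumVertices L (λ v q → f (bumpedAt ch a v) q) ℕ.+ (f 0 a ℕ.+ 0)
    sumVertices-snoc a a≤n f =
      trans (cong (λ M → sumVertices M (λ v q → f (children (w ++ [ a ]) v) q)) (labelled-snoc 1 w a))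
      (trans (sumVertices-++ L [ (suc n , a) ] _)
             (cong₂ ℕ._+_ (sumVertices-cong L (λ v q → cong (λ c → f c q) (children-snoc w a v)))
                          (cong (λ c → f c a ℕ.+ 0) (newVertex-childless a a≤n))))

    is012-snoc : ∀ a → a ≤ n → is012 (w ++ [ a ]) ≡ allVertices L (λ v q → admissible (bumpedAt ch a v) q)
    is012-snoc a a≤n =
      trans (cong (λ M → allVertices M (λ v q → admissible (children (w ++ [ a ]) v) q)) (labelled-snoc 1 w a))
      (trans (allVertices-++ L [ (suc n , a) ] _)
      (trans (cong₂ _∧_ (allVertices-cong L (λ v q → cong (λ c → admissible c q) (children-snoc w a v)))
                        (cong (λ c → admissible c a ∧ true) (newVertex-childless a a≤n)))
             (∧-identityʳ _)))

    weight-snoc : ∀ a → a ≤ n → weight Ψ (w ++ [ a ])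
      ≡ when (allVertices L (λ v q → admissible (bumpedAt ch a v) q))
             (Ψ (sumVertices L (λ v q → isLeaf (bumpedAt ch a v)) ℕ.+ 1)
                (sumVertices L (λ v q → isRootLeaf (bumpedAt ch a v) q) ℕ.+ (isRootLeaf 0 a ℕ.+ 0))
                (sumVertices L (λ v q → isUnary (bumpedAt ch a v) q) ℕ.+ 0))
    weight-snoc a a≤n =
      cong₂ when (is012-snoc a a≤n)
        (cong₂ (λ x y → x y) (cong₂ Ψ (sumVertices-snoc a a≤n (λ c q → isLeaf c)) (sumVertices-snoc a a≤n isRootLeaf))
                             (sumVertices-snoc a a≤n isUnary))

    weight-below-root : weight Ψ (w ++ [ 0 ]) ≡ when (is012 w) (Ψ (suc l) (suc r) e)
    weight-below-root =
      trans (weight-snoc 0 z≤n)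
      (cong₂ when (allVertices-unbumped ch admissible 0 1 w (s≤s z≤n))
        (cong₂ (λ x y → x y)
          (cong₂ Ψ (trans (cong (ℕ._+ 1) (sumVertices-unbumped ch (λ c q → isLeaf c) 0 1 w (s≤s z≤n))) (ℕP.+-comm l 1))
                   (trans (cong (ℕ._+ 1) (sumVertices-unbumped ch isRootLeaf 0 1 w (s≤s z≤n))) (ℕP.+-comm r 1)))
          (trans (cong (ℕ._+ 0) (sumVertices-unbumped ch isUnary 0 1 w (s≤s z≤n))) (ℕP.+-identityʳ e))))

    weight-below-vertex : ∀ x → x ∈ L → weight Ψ (w ++ [ proj₁ x ]) ≡ when (is012 w) (attachAt Ψ l r e (ch (proj₁ x)) (proj₂ x))
    weight-below-vertex (a , q) x∈ =
      trans (weight-snoc a (ℕP.≤-pred (labelled-< 1 w (a , q) x∈)))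
      (trans (cong₂ when (allVertices-bumped ch admissible admissible-antitone 1 w (a , q) x∈)
                         (cong₂ (λ s t → Ψ s (rA ℕ.+ (t ℕ.+ 0)) (eA ℕ.+ 0)) (ℕP.+-comm lA 1) (notRootLeaf a (labelled-≥ 1 w (a , q) x∈))))
      (attachAt-correct Ψ (is012 w) l r e lA (rA ℕ.+ 0) (eA ℕ.+ 0) (ch a) q
         (sumVertices-bumped ch (λ c q → isLeaf c) 1 w (a , q) x∈)
         (trans (cong (ℕ._+ isRootLeaf (ch a) q) (ℕP.+-identityʳ rA)) (sumVertices-bumped ch isRootLeaf 1 w (a , q) x∈))
         (trans (cong (ℕ._+ isUnary (ch a) q) (ℕP.+-identityʳ eA)) (sumVertices-bumped ch isUnary 1 w (a , q) x∈))))
      where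
      lA = sumVertices L (λ v q → isLeaf (bumpedAt ch a v))
      rA = sumVertices L (λ v q → isRootLeaf (bumpedAt ch a v) q)
      eA = sumVertices L (λ v q → isUnary (bumpedAt ch a v) q)
      notRootLeaf : ∀ a → 1 ≤ a → isRootLeaf 0 a ≡ 0
      notRootLeaf (suc a) _ = refl

    Σl-attach : Σl (upTo (suc n)) (λ a → weight Ψ (w ++ [ a ])) ≡ weight (attach Ψ) w
    Σl-attach = begin
      weight Ψ (w ++ [ 0 ]) + Σl (applyUpTo suc n) (λ a → weight Ψ (w ++ [ a ]))
        ≡⟨ cong (_+_ (weight Ψ (w ++ [ 0 ]))) (trans (cong (λ M → Σl M (λ a → weight Ψ (w ++ [ a ]))) (sym (labels-labelled 1 w)))
                                                    (Σl-map proj₁ L _)) ⟩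
      weight Ψ (w ++ [ 0 ]) + Σl L (λ x → weight Ψ (w ++ [ proj₁ x ]))
        ≡⟨ cong₂ _+_ weight-below-root (trans (Σl-cong-∈ L weight-below-vertex) (Σl-when L (is012 w) _)) ⟩
      when (is012 w) (Ψ (suc l) (suc r) e) + when (is012 w) (Σl L (λ x → attachAt Ψ l r e (ch (proj₁ x)) (proj₂ x)))
        ≡⟨ when-+ (is012 w) _ _ ⟨
      when (is012 w) (Ψ (suc l) (suc r) e + Σl L (λ x → attachAt Ψ l r e (ch (proj₁ x)) (proj₂ x)))
        ≡⟨ cong (λ t → when (is012 w) (Ψ (suc l) (suc r) e + t)) (trans (Σl-attachAt L ch Ψ l r e) innerLeaves) ⟩
      when (is012 w) (Ψ (suc l) (suc r) e + (+ r * Ψ l (r ∸ 1) e + + (l ∸ r) * Ψ l r (suc e) + + e * Ψ (suc l) r (e ∸ 1)))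
        ≡⟨ cong (when (is012 w))
             (reassociate (Ψ (suc l) (suc r) e) (+ r * Ψ l (r ∸ 1) e) (+ (l ∸ r) * Ψ l r (suc e)) (+ e * Ψ (suc l) r (e ∸ 1))) ⟩
      weight (attach Ψ) w ∎
      where
      open ≡-Reasoning
      open import Data.List using (applyUpTo)
      innerLeaves : + r * Ψ l (r ∸ 1) e + + #innerLeaves w * Ψ l r (suc e) + + e * Ψ (suc l) r (e ∸ 1)
                  ≡ + r * Ψ l (r ∸ 1) e + + (l ∸ r) * Ψ l r (suc e) + + e * Ψ (suc l) r (e ∸ 1)
      innerLeaves = cong (λ k → + r * Ψ l (r ∸ 1) e + + k * Ψ l r (suc e) + + e * Ψ (suc l) r (e ∸ 1))
                         (sym (trans (cong (_∸ r) (#leaves-split w)) (ℕP.m+n∸m≡n r (#innerLeaves w))))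
      reassociate : ∀ (x a b c : ℤ) → x + (a + b + c) ≡ x + a + b + c
      reassociate = solve-∀

module TreeSums where

  open Sums
  open Permutations using (Σl-words-snoc; Σl-words-cong)
  open Statistics using (Weight)
  open Gamma using (lastCoeff; recTerm₁; recTerm₂; recTerm₄; γ-suc)
  open VertexSums
  open PlantedTrees
  open import Data.Empty using (⊥-elim)
  open import Data.Integer using (_+_; _*_; _-_)
  open import Data.Integer.Solver using (module +-*-Solver)
  open import Data.List.Properties using (length-++; upTo-∷ʳ)
  open import Data.List.Membership.Propositional.Properties using (∈-upTo⁻)
  open import Data.List.Relation.Unary.All.Properties using (++⁺)
  open import Data.Nat.Tactic.RingSolver using (solve-∀)
  open import Relation.Nullary.Decidable using (_×-dec_)

  increasingWords : ℕ → List (List ℕ)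
  increasingWords zero    = [ [] ]
  increasingWords (suc n) = concatMap (λ w → map (λ a → w ++ [ a ]) (upTo (suc n))) (increasingWords n)

  Σl-increasingWords-suc : ∀ n (f : List ℕ → ℤ) →
    Σl (increasingWords (suc n)) f ≡ Σl (increasingWords n) (λ w → Σl (upTo (suc n)) (λ a → f (w ++ [ a ])))
  Σl-increasingWords-suc n f =
    trans (Σl-concatMap _ (increasingWords n) f) (Σl-cong (increasingWords n) (λ w → Σl-map (λ a → w ++ [ a ]) (upTo (suc n)) f))

  Σl-increasingWords-cong : ∀ n {f g : List ℕ → ℤ} → (∀ w → length w ≡ n → All (_≤ n) w → f w ≡ g w) →
    Σl (increasingWords n) f ≡ Σl (increasingWords n) g
  Σl-increasingWords-cong zero    h = cong (_+ 0ℤ) (h [] refl [])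
  Σl-increasingWords-cong (suc n) {f} {g} h =
    trans (Σl-increasingWords-suc n f)
    (trans (Σl-increasingWords-cong n (λ w len bounded → Σl-cong-∈ (upTo (suc n)) (λ a a∈ →
              h (w ++ [ a ]) (trans (length-++ w) (trans (cong (ℕ._+ 1) len) (ℕP.+-comm n 1)))
                (++⁺ (All.map ℕP.m≤n⇒m≤1+n bounded) (ℕP.m≤n⇒m≤1+n (ℕP.≤-pred (∈-upTo⁻ a∈)) ∷ [])))))
           (sym (Σl-increasingWords-suc n g)))

  treeSum : ℕ → Weight → ℤ
  treeSum n Ψ = Σl (increasingWords n) (weight Ψ)

  treeSum-suc : ∀ n Ψ → treeSum (suc n) Ψ ≡ treeSum n (attach Ψ)
  treeSum-suc n Ψ =
    trans (Σl-increasingWords-suc n (weight Ψ))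
          (Σl-increasingWords-cong n (λ { w refl bounded → Attaching.Σl-attach w Ψ bounded }))

  treeSum-cong : ∀ n {Ψ Ψ′ : Weight} → (∀ l r e → Ψ l r e ≡ Ψ′ l r e) → treeSum n Ψ ≡ treeSum n Ψ′
  treeSum-cong n e = Σl-cong (increasingWords n) (λ w → cong (when (is012 w)) (e _ _ _))

  treeSum-+ : ∀ n Ψ Ψ′ → treeSum n (λ l r e → Ψ l r e + Ψ′ l r e) ≡ treeSum n Ψ + treeSum n Ψ′
  treeSum-+ n Ψ Ψ′ = trans (Σl-cong (increasingWords n) (λ w → when-+ (is012 w) _ _)) (Σl-+ (increasingWords n) _ _)

  treeSum-* : ∀ n c Ψ → treeSum n (λ l r e → c * Ψ l r e) ≡ c * treeSum n Ψ
  treeSum-* n c Ψ = trans (Σl-cong (increasingWords n) (λ w → sym (*-when c (is012 w) _))) (Σl-*ˡ (increasingWords n) c _)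

  treeSum-zero : ∀ n → treeSum n (λ _ _ _ → 0ℤ) ≡ 0ℤ
  treeSum-zero n = trans (Σl-cong (increasingWords n) (λ w → when-zero (is012 w))) (Σl-zero (increasingWords n))

  -- Counting children of the n non-root vertices of a 0-1-2 planted tree gives e + 2 l = n + r.
  balanced : ℕ → ℕ → ℕ → ℕ → Bool
  balanced n l r e = does ((e ℕ.+ 2 ℕ.* l ≟ n ℕ.+ r) ×-dec (r ≤? l))

  onBalanced : ℕ → Weight → Weight
  onBalanced n Ψ l r e = when (balanced n l r e) (Ψ l r e)

  private
    +2 : ∀ e l → e ℕ.+ 2 ℕ.* suc l ≡ suc (suc (e ℕ.+ 2 ℕ.* l))
    +2 = solve-∀

  attach-balanced : ∀ n l r e (Ψ : Weight) →
    onBalanced n (attach Ψ) l r e ≡ onBalanced n (attach (onBalanced (suc n) Ψ)) l r e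
  attach-balanced n l r e Ψ =
    when-cong (balanced n l r e) (λ b → preserved (does⇒ ((e ℕ.+ 2 ℕ.* l ≟ n ℕ.+ r) ×-dec (r ≤? l)) b))
    where
    stays : ∀ {l r e} → e ℕ.+ 2 ℕ.* l ≡ suc n ℕ.+ r → r ≤ l → Ψ l r e ≡ onBalanced (suc n) Ψ l r e
    stays {l} {r} {e} h r≤l = sym (cong (λ b → when b (Ψ l r e)) (dec-true ((_ ≟ _) ×-dec (r ≤? l)) (h , r≤l)))
    belowRootLeaf : ∀ r → e ℕ.+ 2 ℕ.* l ≡ n ℕ.+ r → r ≤ l →
      + r * Ψ l (r ∸ 1) e ≡ + r * onBalanced (suc n) Ψ l (r ∸ 1) e
    belowRootLeaf zero    h r≤l = refl
    belowRootLeaf (suc r) h r<l = cong (+ suc r *_) (stays (trans h (ℕP.+-suc n r)) (ℕP.<⇒≤ r<l))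
    belowUnary : ∀ e → e ℕ.+ 2 ℕ.* l ≡ n ℕ.+ r → r ≤ l →
      + e * Ψ (suc l) r (e ∸ 1) ≡ + e * onBalanced (suc n) Ψ (suc l) r (e ∸ 1)
    belowUnary zero    h r≤l = refl
    belowUnary (suc e) h r≤l = cong (+ suc e *_) (stays (trans (+2 e l) (cong suc h)) (ℕP.m≤n⇒m≤1+n r≤l))
    preserved : (e ℕ.+ 2 ℕ.* l ≡ n ℕ.+ r) × (r ≤ l) → attach Ψ l r e ≡ attach (onBalanced (suc n) Ψ) l r e
    preserved (h , r≤l) =
      cong₂ _+_ (cong₂ _+_ (cong₂ _+_
        (stays (trans (+2 e l) (trans (cong (suc ∘ suc) h) (cong suc (sym (ℕP.+-suc n r))))) (s≤s r≤l))
        (belowRootLeaf r h r≤l))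
        (cong (+ (l ∸ r) *_) (stays (cong suc h) r≤l)))
        (belowUnary e h r≤l)

  treeSum-balanced : ∀ n Ψ → treeSum n Ψ ≡ treeSum n (onBalanced n Ψ)
  treeSum-balanced zero    Ψ = refl
  treeSum-balanced (suc n) Ψ =
    trans (treeSum-suc n Ψ)
    (trans (treeSum-balanced n (attach Ψ))
    (trans (treeSum-cong n (λ l r e → attach-balanced n l r e Ψ))
    (trans (sym (treeSum-balanced n (attach (onBalanced (suc n) Ψ))))
           (sym (treeSum-suc n (onBalanced (suc n) Ψ))))))

  shape : ℕ → ℕ → Weight
  shape i j l r e = when (does ((l ≟ i ℕ.+ j) ×-dec (r ≟ i))) 1ℤ

  shape₁ shape₂ : ℕ → ℕ → Weight
  shape₁ zero    j l r e = 0ℤ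
  shape₁ (suc i) j l r e = shape i j l r e
  shape₂ i zero    l r e = 0ℤ
  shape₂ i (suc j) l r e = + suc i * shape (suc i) j l r e

  shape₄ : ℕ → ℕ → ℕ → Weight
  shape₄ n i zero    l r e = 0ℤ
  shape₄ n i (suc j) l r e = lastCoeff n i j * shape i j l r e

  *-when-iff : ∀ (x y : ℤ) {P P′ : Set} (d : Dec P) (d′ : Dec P′) → (P → P′) → (P′ → P) → (P → x ≡ y) →
    x * when (does d) 1ℤ ≡ y * when (does d′) 1ℤ
  *-when-iff x y (yes p) (yes p′) _ _ x≡y = cong (_* 1ℤ) (x≡y p)
  *-when-iff x y (yes p) (no ¬p′) to _  _   = ⊥-elim (¬p′ (to p))
  *-when-iff x y (no ¬p) (yes p′) _ from _ = ⊥-elim (¬p (from p′))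
  *-when-iff x y (no _)  (no _)   _ _  _   = trans (ℤP.*-zeroʳ x) (sym (ℤP.*-zeroʳ y))

  *-when-absurd : ∀ (x : ℤ) {P : Set} (d : Dec P) → ¬ P → x * when (does d) 1ℤ ≡ 0ℤ
  *-when-absurd x (yes p) ¬p = ⊥-elim (¬p p)
  *-when-absurd x (no _)  ¬p = ℤP.*-zeroʳ x

  attach-shape : ∀ n i j l r e → balanced n l r e ≡ true →
    attach (shape i j) l r e ≡ shape₁ i j l r e + shape₂ i j l r e + + j * shape i j l r e + shape₄ n i j l r e
  attach-shape n i j l r e b =
    cong₂ _+_ (cong₂ _+_ (cong₂ _+_ (newRoot i) (belowRootLeaf r j r≤l)) belowInnerLeaf) (belowUnary j)
    where
    balance = does⇒ ((e ℕ.+ 2 ℕ.* l ≟ n ℕ.+ r) ×-dec (r ≤? l)) b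
    r≤l = proj₂ balance
    newRoot : ∀ i → shape i j (suc l) (suc r) e ≡ shape₁ i j l r e
    newRoot zero    = cong (λ b → when b 1ℤ) (∧-zeroʳ _)
    newRoot (suc i) = refl
    belowRootLeaf : ∀ r j → r ≤ l → + r * shape i j l (r ∸ 1) e ≡ shape₂ i j l r e
    belowRootLeaf zero    zero    _   = refl
    belowRootLeaf zero    (suc j) _   = sym (*-when-absurd (+ suc i) ((l ≟ suc i ℕ.+ j) ×-dec (0 ≟ suc i)) (λ ()))
    belowRootLeaf (suc r) zero    r<l = *-when-absurd (+ suc r) ((l ≟ i ℕ.+ 0) ×-dec (r ≟ i))
      (λ (l≡i , r≡i) → ℕP.<-irrefl refl (ℕP.≤-trans r<l (ℕP.≤-reflexive (trans l≡i (trans (ℕP.+-identityʳ i) (sym r≡i))))))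
    belowRootLeaf (suc r) (suc j) _   = *-when-iff (+ suc r) (+ suc i)
      ((l ≟ i ℕ.+ suc j) ×-dec (r ≟ i)) ((l ≟ suc i ℕ.+ j) ×-dec (suc r ≟ suc i))
      (λ (l≡ , r≡i) → trans l≡ (ℕP.+-suc i j) , cong suc r≡i)
      (λ (l≡ , r≡i) → trans l≡ (sym (ℕP.+-suc i j)) , ℕP.suc-injective r≡i)
      (λ (_ , r≡i) → cong (λ z → + suc z) r≡i)
    belowInnerLeaf : + (l ∸ r) * shape i j l r (suc e) ≡ + j * shape i j l r e
    belowInnerLeaf = *-when-iff (+ (l ∸ r)) (+ j) ((l ≟ i ℕ.+ j) ×-dec (r ≟ i)) ((l ≟ i ℕ.+ j) ×-dec (r ≟ i))
      (λ p → p) (λ p → p) (λ (l≡ , r≡i) → cong +_ (trans (cong₂ _∸_ l≡ r≡i) (ℕP.m+n∸m≡n i j)))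
    belowUnary : ∀ j → + e * shape i j (suc l) r (e ∸ 1) ≡ shape₄ n i j l r e
    belowUnary zero = *-when-absurd (+ e) ((suc l ≟ i ℕ.+ 0) ×-dec (r ≟ i))
      (λ (l+1≡i , r≡i) →
         ℕP.<-irrefl refl (ℕP.≤-trans (s≤s r≤l) (ℕP.≤-reflexive (trans l+1≡i (trans (ℕP.+-identityʳ i) (sym r≡i))))))
    belowUnary (suc j) = *-when-iff (+ e) (lastCoeff n i j)
      ((suc l ≟ i ℕ.+ suc j) ×-dec (r ≟ i)) ((l ≟ i ℕ.+ j) ×-dec (r ≟ i))
      (λ (l+1≡ , r≡i) → ℕP.suc-injective (trans l+1≡ (ℕP.+-suc i j)) , r≡i)
      (λ (l≡ , r≡i) → trans (cong suc l≡) (sym (ℕP.+-suc i j)) , r≡i)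
      (λ (l+1≡ , r≡i) → unaryCount (ℕP.suc-injective (trans l+1≡ (ℕP.+-suc i j))) r≡i)
      where
      open +-*-Solver
      unaryCount : l ≡ i ℕ.+ j → r ≡ i → + e ≡ lastCoeff n i j
      unaryCount refl refl =
        trans (solve 3 (λ e i j → e := (e :+ con (+ 2) :* (i :+ j)) :- con (+ 2) :* (i :+ j)) refl (+ e) (+ i) (+ j))
        (trans (cong (λ z → z - + 2 * (+ i + + j)) inℤ)
               (solve 3 (λ n i j → (n :+ i) :- con (+ 2) :* (i :+ j) := n :- i :- con (+ 2) :* (con 1ℤ :+ j) :+ con (+ 2))
                  refl (+ n) (+ i) (+ j)))
        where
        inℤ : + e + + 2 * (+ i + + j) ≡ + n + + i
        inℤ = trans (cong (λ z → + e + + 2 * z) (sym (ℤP.pos-+ i j)))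
              (trans (cong (_+_ (+ e)) (sym (ℤP.pos-* 2 (i ℕ.+ j))))
              (trans (sym (ℤP.pos-+ e (2 ℕ.* (i ℕ.+ j))))
              (trans (cong +_ (proj₁ balance)) (ℤP.pos-+ n i))))

  treeSum-suc-shape : ∀ n i j → treeSum (suc n) (shape i j)
    ≡ treeSum n (shape₁ i j) + treeSum n (shape₂ i j) + + j * treeSum n (shape i j) + treeSum n (shape₄ n i j)
  treeSum-suc-shape n i j =
    trans (treeSum-suc n (shape i j))
    (trans (treeSum-balanced n (attach (shape i j)))
    (trans (treeSum-cong n (λ l r e → when-cong (balanced n l r e) (attach-shape n i j l r e)))
    (trans (sym (treeSum-balanced n terms))
    (trans (treeSum-+ n three (shape₄ n i j))
           (cong (_+ treeSum n (shape₄ n i j))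
                 (trans (treeSum-+ n two (λ l r e → + j * shape i j l r e))
                        (cong₂ _+_ (treeSum-+ n (shape₁ i j) (shape₂ i j)) (treeSum-* n (+ j) (shape i j)))))))))
    where
    two three terms : Weight
    two l r e   = shape₁ i j l r e + shape₂ i j l r e
    three l r e = two l r e + + j * shape i j l r e
    terms l r e = three l r e + shape₄ n i j l r e

  γ≡treeSum : ∀ n i j → γ n i j ≡ treeSum n (shape i j)
  γ≡treeSum zero    zero    zero    = refl
  γ≡treeSum zero    zero    (suc j) = refl
  γ≡treeSum zero    (suc i) j       = refl
  γ≡treeSum (suc n) i       j       =
    trans (γ-suc n i j)
    (trans (cong₂ _+_ (cong₂ _+_ (cong₂ _+_ (term₁ i) (term₂ j)) (cong (+ j *_) (γ≡treeSum n i j))) (term₄ j))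
           (sym (treeSum-suc-shape n i j)))
    where
    term₁ : ∀ i → recTerm₁ n i j ≡ treeSum n (shape₁ i j)
    term₁ zero    = sym (treeSum-zero n)
    term₁ (suc i) = γ≡treeSum n i j
    term₂ : ∀ j → recTerm₂ n i j ≡ treeSum n (shape₂ i j)
    term₂ zero    = sym (treeSum-zero n)
    term₂ (suc j) = trans (cong (+ suc i *_) (γ≡treeSum n (suc i) j)) (sym (treeSum-* n (+ suc i) (shape (suc i) j)))
    term₄ : ∀ j → recTerm₄ n i j ≡ treeSum n (shape₄ n i j)
    term₄ zero    = sym (treeSum-zero n)
    term₄ (suc j) = trans (cong (lastCoeff n i j *_) (γ≡treeSum n i j)) (sym (treeSum-* n (lastCoeff n i j) (shape i j)))

  Σl-upTo-below : ∀ m M → m ≤ M → (f : ℕ → ℤ) → Σl (upTo M) (λ a → when (does (a <? m)) (f a)) ≡ Σl (upTo m) f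
  Σl-upTo-below zero    zero    _   f = refl
  Σl-upTo-below m       (suc M) m≤M f with m ≤? M
  ... | yes m≤M′ =
    trans (cong (λ L → Σl L (λ a → when (does (a <? m)) (f a))) (sym (upTo-∷ʳ M)))
    (trans (Σl-++ (upTo M) [ M ] _)
    (trans (cong₂ _+_ (Σl-upTo-below m M m≤M′ f) (cong (λ b → when b (f M) + 0ℤ) (dec-false (M <? m) (ℕP.≤⇒≯ m≤M′))))
           (ℤP.+-identityʳ _)))
  ... | no m≰M with ℕP.≤-antisym m≤M (ℕP.≰⇒> m≰M)
  ...   | refl =
    trans (cong (λ L → Σl L (λ a → when (does (a <? suc M)) (f a))) (sym (upTo-∷ʳ M)))
    (trans (Σl-++ (upTo M) [ M ] _)
    (trans (cong₂ _+_ (Σl-cong-∈ (upTo M) (λ a a∈ → cong (λ b → when b (f a)) (dec-true (a <? suc M) (ℕP.m<n⇒m<1+n (∈-upTo⁻ a∈)))))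
                      (cong (λ b → when b (f M) + 0ℤ) (dec-true (M <? suc M) ℕP.≤-refl)))
    (trans (sym (Σl-++ (upTo M) [ M ] f)) (cong (λ L → Σl L f) (upTo-∷ʳ M)))))

  isIncreasing-snoc : ∀ w a → isIncreasing (w ++ [ a ]) ≡ isIncreasing w ∧ (does (a <? suc (length w)) ∧ true)
  isIncreasing-snoc w a =
    trans (cong (λ L → allVertices L (λ v q → does (q <? v))) (labelled-snoc 1 w a)) (allVertices-++ (vertices w) _ _)

  Σl-increasing : ∀ n N → n ≤ N → (ψ : List ℕ → ℤ) →
    Σl (words n (upTo (suc N))) (λ w → when (isIncreasing w) (ψ w)) ≡ Σl (increasingWords n) ψ
  Σl-increasing zero    N _   ψ = refl
  Σl-increasing (suc n) N n<N ψ =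
    trans (Σl-words-snoc n (upTo (suc N)) _)
    (trans (Σl-words-cong n (upTo (suc N)) (λ w len _ → appendLetter w len))
    (trans (Σl-increasing n N (ℕP.<⇒≤ n<N) (λ w → Σl (upTo (suc n)) (λ a → ψ (w ++ [ a ]))))
           (sym (Σl-increasingWords-suc n ψ))))
    where
    appendLetter : ∀ w → length w ≡ n →
      Σl (upTo (suc N)) (λ a → when (isIncreasing (w ++ [ a ])) (ψ (w ++ [ a ])))
      ≡ when (isIncreasing w) (Σl (upTo (suc n)) (λ a → ψ (w ++ [ a ])))
    appendLetter w refl =
      trans (Σl-cong (upTo (suc N)) (λ a →
               trans (cong (λ b → when b (ψ (w ++ [ a ]))) (trans (isIncreasing-snoc w a) (cong (isIncreasing w ∧_) (∧-identityʳ _))))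
                     (when-∧ (isIncreasing w) _ _)))
      (trans (Σl-when (upTo (suc N)) (isIncreasing w) _)
             (cong (when (isIncreasing w)) (Σl-upTo-below (suc n) (suc N) (s≤s (ℕP.<⇒≤ n<N)) (λ a → ψ (w ++ [ a ])))))

  treeCount≡treeSum : ∀ n i j → + treeCount n i j ≡ treeSum n (shape i j)
  treeCount≡treeSum n i j =
    trans (length-filter≡Σl _ (plantedTrees n))
    (trans (Σl-filter planted? (parentMaps n) _)
    (trans (Σl-cong (words n (upTo (suc n))) splitCondition)
           (Σl-increasing n n ℕP.≤-refl (weight (shape i j)))))
    where
    splitCondition : ∀ p →
      when (does (planted? p)) (when (does ((leaves p ≟ i ℕ.+ j) ×-dec (rootLeaves p ≟ i))) 1ℤ)
      ≡ when (isIncreasing p) (weight (shape i j) p)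
    splitCondition p rewrite planted?≡ p | leaves≡#leaves p | rootLeaves≡#rootLeaves p =
      when-∧ (isIncreasing p) (is012 p) _

  γ≡treeCount : ∀ n i j → γ n i j ≡ + treeCount n i j
  γ≡treeCount n i j = trans (γ≡treeSum n i j) (sym (treeCount≡treeSum n i j))

open import Data.Nat using (_*_)

theorem3p2 :
  (∀ (n : ℕ) → 1 ≤ n →
      Apoly (suc n) ≈ (S ⊕ Y) ⊗ Apoly n
                      ⊕ (X ⊗ Y) ⊗ (∂x (Apoly n) ⊕ ∂y (Apoly n) ⊕ ∂s (Apoly n)))
  × (∀ (n : ℕ) →
      Apoly (suc n) ≈ sumS n (λ i → ((S ⊕ Y) ^S i) ⊗
                        sumS ⌊ (n ∸ i) /2⌋ (λ j →
                          const (γ n i j) ⊗ ((const (+ 2) ⊗ X ⊗ Y) ^S j)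
                            ⊗ ((X ⊕ Y) ^S (n ∸ i ∸ 2 * j)))))
  × (∀ (n i j : ℕ) → γ n i j ≡ + (treeCount n i j))
theorem3p2 = Recurrence.recurrence , (λ n → Series.get≋ (Box.Apoly≋expansion n)) , TreeSums.γ≡treeCount
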